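{- Let $A\in\mathbb{Z}^{m\times n}$, $b\in\mathbb{Z}^m$, $c\in\mathbb{Z}^n$ and $u\in\mathbb{N}^n$, and let $\Delta$ be an upper bound on the absolute values of the entries of $A$. Consider the integer program $$\max\{c^Tx : Ax=b,\ 0\le x\le u,\ x\in\mathbb{Z}^n\},$$ and assume it has a feasible solution. Let $x^*$ be an optimal vertex solution of its linear programming relaxation $\max\{c^Tx : Ax=b,\ 0\le x\le u,\ x\in\mathbb{R}^n\}$. Then there exists an optimal solution $z^*$ of the integer program such that $$\|z^*-x^*\|_1 \le m\cdot (2\,m\cdot\Delta+1)^m.$$
   Formalization: The linear programming relaxation is taken over ℚ^n instead of ℝ^n, so the optimal vertex $x^*$ and the feasible points against which its extremality and optimality are judged have rational coordinates. -}

module Defs where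

open import Data.Nat as ℕ using (ℕ)
open import Data.Integer as ℤ using (ℤ; +_)
open import Data.Rational as ℚ using (ℚ; _/_; 0ℚ)
open import Data.Fin using (Fin; zero; suc)
open import Data.Product using (_×_; Σ)
open import Relation.Binary.PropositionalEquality using (_≡_)

sumℤ : ∀ {n} → (Fin n → ℤ) → ℤ
sumℤ {ℕ.zero}  f = + 0
sumℤ {ℕ.suc n} f = f zero ℤ.+ sumℤ (λ j → f (suc j))

sumℚ : ∀ {n} → (Fin n → ℚ) → ℚ
sumℚ {ℕ.zero}  f = 0ℚ
sumℚ {ℕ.suc n} f = f zero ℚ.+ sumℚ (λ j → f (suc j))

ℤtoℚ : ℤ → ℚ
ℤtoℚ z = z / 1

ℕtoℚ : ℕ → ℚ
ℕtoℚ k = (+ k) / 1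

Matrix : ℕ → ℕ → Set
Matrix m n = Fin m → Fin n → ℤ

LPFeasible : ∀ {m n} → Matrix m n → (Fin m → ℤ) → (Fin n → ℕ) → (Fin n → ℚ) → Set
LPFeasible A b u x =
  (∀ i → sumℚ (λ j → ℤtoℚ (A i j) ℚ.* x j) ≡ ℤtoℚ (b i)) ×
  (∀ j → (0ℚ ℚ.≤ x j) × (x j ℚ.≤ ℕtoℚ (u j)))

IPFeasible : ∀ {m n} → Matrix m n → (Fin m → ℤ) → (Fin n → ℕ) → (Fin n → ℤ) → Set
IPFeasible A b u z =
  (∀ i → sumℤ (λ j → A i j ℤ.* z j) ≡ b i) ×
  (∀ j → (+ 0 ℤ.≤ z j) × (z j ℤ.≤ + u j))

objℚ : ∀ {n} → (Fin n → ℤ) → (Fin n → ℚ) → ℚ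
objℚ c x = sumℚ (λ j → ℤtoℚ (c j) ℚ.* x j)

objℤ : ∀ {n} → (Fin n → ℤ) → (Fin n → ℤ) → ℤ
objℤ c z = sumℤ (λ j → c j ℤ.* z j)

-- Vertex (extreme point) of the LP feasible region:
-- x is not the midpoint of two distinct feasible points.
IsVertex : ∀ {m n} → Matrix m n → (Fin m → ℤ) → (Fin n → ℕ) → (Fin n → ℚ) → Set
IsVertex A b u x =
  LPFeasible A b u x ×
  (∀ y w → LPFeasible A b u y → LPFeasible A b u w →
     (∀ j → y j ℚ.+ w j ≡ ℤtoℚ (+ 2) ℚ.* x j) → ∀ j → y j ≡ w j)

IsOptimalLPVertex : ∀ {m n} → Matrix m n → (Fin m → ℤ) → (Fin n → ℤ) → (Fin n → ℕ) → (Fin n → ℚ) → Set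
IsOptimalLPVertex A b c u x =
  IsVertex A b u x × (∀ y → LPFeasible A b u y → objℚ c y ℚ.≤ objℚ c x)

IsOptimalIP : ∀ {m n} → Matrix m n → (Fin m → ℤ) → (Fin n → ℤ) → (Fin n → ℕ) → (Fin n → ℤ) → Set
IsOptimalIP A b c u z =
  IPFeasible A b u z × (∀ w → IPFeasible A b u w → objℤ c w ℤ.≤ objℤ c z)

dist₁ : ∀ {n} → (Fin n → ℤ) → (Fin n → ℚ) → ℚ
dist₁ z x = sumℚ (λ j → ℚ.∣ ℤtoℚ (z j) ℚ.- x j ∣)

module Submission where

-- Let z be an optimal integer solution and v = x − z.  Since x is a vertex, at most m coordinates of x lie
-- strictly between their bounds, so v splits into ⌊|vⱼ|⌋ copies of sign(vⱼ) Aⱼ together with at most m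
-- fractional multiples of columns: at least ‖v‖₁ vectors of norm ≤ Δ that sum to A v = 0.  By the
-- Steinitz lemma they can be ordered with every prefix sum in [−mΔ, mΔ]ᵐ.  If ‖v‖₁ > m (2mΔ + 1)ᵐ, some
-- cyclic run of integral copies is longer than (2mΔ + 1)ᵐ, so by pigeonhole two of its prefix sums agree
-- and a nonempty block sums to zero.  That block is an integral y with A y = 0 lying coordinatewise between
-- 0 and v: z + y stays integer feasible and x − y LP feasible, so c y ≥ 0 by optimality of x and z + y is
-- an optimal integer solution strictly closer to x.  Descending from any optimal solution (one exists,
-- the box being finite) ends within distance m (2mΔ + 1)ᵐ.

module Proximity where

  open import Defs
  open import Data.Nat as ℕ using (ℕ; zero; suc; _^_)
  import Data.Nat.Properties as ℕP
  open import Data.Nat.Divisibility using (∣1⇒≡1)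
  open import Data.Integer as ℤ using (ℤ)
  import Data.Integer.Properties as ℤP
  open import Data.Rational as ℚ using (ℚ; 0ℚ; 1ℚ; _+_; _*_; _-_; -_; _≤_; _<_; ∣_∣; mkℚ; nonNegative; positive; *≤*; *<*; _÷_; 1/_)
  open import Data.Rational.Properties
  import Data.Rational.Unnormalised as ℚᵘ
  import Data.Rational.Unnormalised.Properties as ℚᵘP
  open import Data.Rational.Solver
  open import Data.Fin as F using (Fin; zero; suc; toℕ; fromℕ<; funToFin; finToFun)
  import Data.Fin.Properties as FinP
  open import Data.Bool using (Bool; true; false; if_then_else_)
  import Data.Bool
  open import Data.Maybe using (Maybe; just; nothing)
  open import Data.List using (List; []; _∷_; _++_; take; drop; length; map; replicate; lookup)
  import Data.List.Properties as LP
  open import Data.List.Relation.Unary.All as All using (All; []; _∷_)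
  import Data.List.Relation.Unary.All.Properties as AllP
  open import Data.Product using (_×_; _,_; Σ; proj₁; proj₂; ∃)
  open import Data.Sum using (_⊎_; inj₁; inj₂)
  open import Data.Unit using (⊤; tt)
  open import Data.Empty using (⊥; ⊥-elim)
  open import Relation.Nullary using (Dec; yes; no; ¬_)
  open import Relation.Nullary.Decidable using (_×-dec_; ¬?)
  open import Relation.Binary.PropositionalEquality
  open +-*-Solver

  p≤q⇒0≤q-p : ∀ {p q} → p ≤ q → 0ℚ ≤ q - p
  p≤q⇒0≤q-p {p} {q} h = subst (_≤ q - p) (+-inverseʳ p) (+-monoˡ-≤ (- p) h)

  0≤q-p⇒p≤q : ∀ {p q} → 0ℚ ≤ q - p → p ≤ q
  0≤q-p⇒p≤q {p} {q} h = subst₂ _≤_ (+-identityˡ p) eq (+-monoˡ-≤ p h)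
    where eq : q - p + p ≡ q
          eq = solve 2 (λ q p → q :- p :+ p := q) refl q p

  p<q⇒0<q-p : ∀ {p q} → p < q → 0ℚ < q - p
  p<q⇒0<q-p {p} {q} h = subst (_< q - p) (+-inverseʳ p) (+-monoˡ-< (- p) h)

  0<q-p⇒p<q : ∀ {p q} → 0ℚ < q - p → p < q
  0<q-p⇒p<q {p} {q} h = subst₂ _<_ (+-identityˡ p) eq (+-monoˡ-< p h)
    where eq : q - p + p ≡ q
          eq = solve 2 (λ q p → q :- p :+ p := q) refl q p

  +-pres-0≤ : ∀ {p q} → 0ℚ ≤ p → 0ℚ ≤ q → 0ℚ ≤ p + q
  +-pres-0≤ {p} {q} h1 h2 = subst (_≤ p + q) (+-identityˡ 0ℚ) (+-mono-≤ h1 h2)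

  +-pres-0< : ∀ {p q} → 0ℚ < p → 0ℚ ≤ q → 0ℚ < p + q
  +-pres-0< {p} {q} h1 h2 = subst (_< p + q) (+-identityˡ 0ℚ) (+-mono-<-≤ h1 h2)

  *-pres-0≤ : ∀ {p q} → 0ℚ ≤ p → 0ℚ ≤ q → 0ℚ ≤ p * q
  *-pres-0≤ {p} {q} h1 h2 = subst (_≤ p * q) (*-zeroʳ p) (*-monoˡ-≤-nonNeg p {{nonNegative h1}} h2)

  *-pres-0< : ∀ {p q} → 0ℚ < p → 0ℚ < q → 0ℚ < p * q
  *-pres-0< {p} {q} h1 h2 = subst (_< p * q) (*-zeroʳ p) (*-monoʳ-<-pos p {{positive h1}} h2)

  ≤-by-diff : ∀ {p q} e → q - p ≡ e → 0ℚ ≤ e → p ≤ q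
  ≤-by-diff e eq h = 0≤q-p⇒p≤q (subst (0ℚ ≤_) (sym eq) h)

  <-by-diff : ∀ {p q} e → q - p ≡ e → 0ℚ < e → p < q
  <-by-diff e eq h = 0<q-p⇒p<q (subst (0ℚ <_) (sym eq) h)

  0≤1 : 0ℚ ≤ 1ℚ
  0≤1 = *≤* (ℤ.+≤+ ℕ.z≤n)

  0<1 : 0ℚ < 1ℚ
  0<1 = *<* (ℤ.+<+ (ℕ.s≤s ℕ.z≤n))

  +-cancelʳ : ∀ x y c → x + c ≡ y + c → x ≡ y
  +-cancelʳ x y c e = trans (solve 2 (λ x c → x := x :+ c :- c) refl x c) (trans (cong (_- c) e) (solve 2 (λ y c → y :+ c :- c := y) refl y c))

  ∣p∣-cases : ∀ p → (0ℚ ≤ p × ∣ p ∣ ≡ p) ⊎ (p < 0ℚ × ∣ p ∣ ≡ - p)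
  ∣p∣-cases p with 0ℚ ≤? p
  ... | yes h = inj₁ (h , 0≤p⇒∣p∣≡p h)
  ... | no h = inj₂ (≰⇒> h , trans (sym (∣-p∣≡∣p∣ p)) (0≤p⇒∣p∣≡p (neg-mono-< (≰⇒> h))))
    where
    neg-mono-< : ∀ {p} → p < 0ℚ → 0ℚ ≤ - p
    neg-mono-< {p} h = subst (0ℚ ≤_) (+-identityˡ (- p)) (p≤q⇒0≤q-p (<⇒≤ h))

  ±p≤r⇒∣p∣≤r : ∀ {p r} → p ≤ r → - p ≤ r → ∣ p ∣ ≤ r
  ±p≤r⇒∣p∣≤r {p} {r} h1 h2 with ∣p∣-cases p
  ... | inj₁ (_ , e) = subst (_≤ r) (sym e) h1
  ... | inj₂ (_ , e) = subst (_≤ r) (sym e) h2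

  p≤∣p∣ : ∀ p → p ≤ ∣ p ∣
  p≤∣p∣ p with ∣p∣-cases p
  ... | inj₁ (_ , e) = ≤-reflexive (sym e)
  ... | inj₂ (h , e) = ≤-trans (<⇒≤ h) (0≤∣p∣ p)

  -p≤∣p∣ : ∀ p → - p ≤ ∣ p ∣
  -p≤∣p∣ p = subst (- p ≤_) (∣-p∣≡∣p∣ p) (p≤∣p∣ (- p))

  ∣p∣≤r⇒±p≤r : ∀ {p r} → ∣ p ∣ ≤ r → p ≤ r × - p ≤ r
  ∣p∣≤r⇒±p≤r {p} h = ≤-trans (p≤∣p∣ p) h , ≤-trans (-p≤∣p∣ p) h

  ∣p*q∣≡p*∣q∣ : ∀ {p} q → 0ℚ ≤ p → ∣ p * q ∣ ≡ p * ∣ q ∣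
  ∣p*q∣≡p*∣q∣ {p} q 0≤p = trans (∣p*q∣≡∣p∣*∣q∣ p q) (cong (_* ∣ q ∣) (0≤p⇒∣p∣≡p 0≤p))

  recip : ℚ → ℚ
  recip q with q ≟ 0ℚ
  ... | yes _ = 0ℚ
  ... | no ne = (1/ q) {{ℚ.≢-nonZero ne}}

  recip-inverseˡ : ∀ q → ¬ q ≡ 0ℚ → recip q * q ≡ 1ℚ
  recip-inverseˡ q ne with q ≟ 0ℚ
  ... | yes e = ⊥-elim (ne e)
  ... | no ne' = *-inverseˡ q {{ℚ.≢-nonZero ne'}}

  recip-pos : ∀ {q} → 0ℚ < q → 0ℚ < recip q
  recip-pos {q} h with q ≟ 0ℚ
  ... | yes e = ⊥-elim (<⇒≢ h (sym e))
  ... | no ne = positive⁻¹ _ {{1/pos⇒pos q {{positive h}}}}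

  recip-neg : ∀ {q} → q < 0ℚ → recip q < 0ℚ
  recip-neg {q} h with q ≟ 0ℚ
  ... | yes e = ⊥-elim (<⇒≢ h e)
  ... | no ne = negative⁻¹ _ {{1/neg⇒neg q {{ℚ.negative h}}}}

  ≤∧≢⇒< : ∀ {p q} → p ≤ q → ¬ p ≡ q → p < q
  ≤∧≢⇒< {p} {q} le ne with p <? q
  ... | yes h = h
  ... | no h = ⊥-elim (ne (≤-antisym le (≮⇒≥ h)))

  p<0⇒0<-p : ∀ {p} → p < 0ℚ → 0ℚ < - p
  p<0⇒0<-p {p} h = subst (0ℚ <_) (+-identityˡ (- p)) (p<q⇒0<q-p h)

  neg*neg⇒0< : ∀ {p q} → p < 0ℚ → q < 0ℚ → 0ℚ < p * q
  neg*neg⇒0< {p} {q} h1 h2 = subst (0ℚ <_) (solve 2 (λ p q → (:- p) :* (:- q) := p :* q) refl p q) (*-pres-0< (p<0⇒0<-p h1) (p<0⇒0<-p h2))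

  ℤtoℚ-mk : ∀ z → ℤtoℚ z ≡ mkℚ z 0 (λ {d} x → ∣1⇒≡1 (proj₂ x))
  ℤtoℚ-mk z = ↥p/↧p≡p (mkℚ z 0 (λ {d} x → ∣1⇒≡1 (proj₂ x)))

  toℚᵘ-ℤtoℚ : ∀ z → ℚ.toℚᵘ (ℤtoℚ z) ≡ ℚᵘ.mkℚᵘ z 0
  toℚᵘ-ℤtoℚ z rewrite ℤtoℚ-mk z = refl

  ℤtoℚ-homo-+ : ∀ a b → ℤtoℚ (a ℤ.+ b) ≡ ℤtoℚ a + ℤtoℚ b
  ℤtoℚ-homo-+ a b = toℚᵘ-injective (ℚᵘP.≃-trans (ℚᵘP.≃-reflexive (trans (toℚᵘ-ℤtoℚ (a ℤ.+ b)) mk-sum))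
       (ℚᵘP.≃-sym (ℚᵘP.≃-trans (toℚᵘ-homo-+ (ℤtoℚ a) (ℤtoℚ b)) (ℚᵘP.≃-reflexive (cong₂ ℚᵘ._+_ (toℚᵘ-ℤtoℚ a) (toℚᵘ-ℤtoℚ b))))))
    where
    mk-sum : ℚᵘ.mkℚᵘ (a ℤ.+ b) 0 ≡ ℚᵘ.mkℚᵘ a 0 ℚᵘ.+ ℚᵘ.mkℚᵘ b 0
    mk-sum = cong₂ (λ x y → ℚᵘ.mkℚᵘ (x ℤ.+ y) 0) (sym (ℤP.*-identityʳ a)) (sym (ℤP.*-identityʳ b))

  ℤtoℚ-homo-* : ∀ a b → ℤtoℚ (a ℤ.* b) ≡ ℤtoℚ a * ℤtoℚ b
  ℤtoℚ-homo-* a b = toℚᵘ-injective (ℚᵘP.≃-trans (ℚᵘP.≃-reflexive (toℚᵘ-ℤtoℚ (a ℤ.* b)))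
       (ℚᵘP.≃-sym (ℚᵘP.≃-trans (toℚᵘ-homo-* (ℤtoℚ a) (ℤtoℚ b)) (ℚᵘP.≃-reflexive (cong₂ ℚᵘ._*_ (toℚᵘ-ℤtoℚ a) (toℚᵘ-ℤtoℚ b))))))

  ℤtoℚ-homo-neg : ∀ a → ℤtoℚ (ℤ.- a) ≡ - ℤtoℚ a
  ℤtoℚ-homo-neg a = toℚᵘ-injective (ℚᵘP.≃-trans (ℚᵘP.≃-reflexive (toℚᵘ-ℤtoℚ (ℤ.- a)))
       (ℚᵘP.≃-sym (ℚᵘP.≃-trans (toℚᵘ-homo‿- (ℤtoℚ a)) (ℚᵘP.≃-reflexive (cong ℚᵘ.-_ (toℚᵘ-ℤtoℚ a))))))

  ℤtoℚ-mono-≤ : ∀ {a b} → a ℤ.≤ b → ℤtoℚ a ≤ ℤtoℚ b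
  ℤtoℚ-mono-≤ {a} {b} h = toℚᵘ-cancel-≤ (subst₂ ℚᵘ._≤_ (sym (toℚᵘ-ℤtoℚ a)) (sym (toℚᵘ-ℤtoℚ b))
     (ℚᵘ.*≤* (subst₂ ℤ._≤_ (sym (ℤP.*-identityʳ a)) (sym (ℤP.*-identityʳ b)) h)))

  ℤtoℚ-cancel-≤ : ∀ {a b} → ℤtoℚ a ≤ ℤtoℚ b → a ℤ.≤ b
  ℤtoℚ-cancel-≤ {a} {b} h with subst₂ ℚᵘ._≤_ (toℚᵘ-ℤtoℚ a) (toℚᵘ-ℤtoℚ b) (toℚᵘ-mono-≤ h)
  ... | ℚᵘ.*≤* h' = subst₂ ℤ._≤_ (ℤP.*-identityʳ a) (ℤP.*-identityʳ b) h'

  ℤtoℚ-injective : ∀ {a b} → ℤtoℚ a ≡ ℤtoℚ b → a ≡ b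
  ℤtoℚ-injective e = ℤP.≤-antisym (ℤtoℚ-cancel-≤ (≤-reflexive e)) (ℤtoℚ-cancel-≤ (≤-reflexive (sym e)))

  ℤtoℚ-homo-∣∣ : ∀ a → ℤtoℚ (ℤ.+ ℤ.∣ a ∣) ≡ ∣ ℤtoℚ a ∣
  ℤtoℚ-homo-∣∣ a rewrite ℤtoℚ-mk a | ℤtoℚ-mk (ℤ.+ ℤ.∣ a ∣) = refl

  i-k≡j-k⇒i≡j : ∀ {i j} k → i ℤ.- k ≡ j ℤ.- k → i ≡ j
  i-k≡j-k⇒i≡j {i} {j} k e = ℤtoℚ-injective (begin
    ℤtoℚ i                                ≡⟨ solve 2 (λ i k → i := (i :- k) :+ k) refl (ℤtoℚ i) (ℤtoℚ k) ⟩
    (ℤtoℚ i - ℤtoℚ k) + ℤtoℚ k            ≡⟨ cong (_+ ℤtoℚ k) (trans (sym (difference i)) (trans (cong ℤtoℚ e) (difference j))) ⟩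
    (ℤtoℚ j - ℤtoℚ k) + ℤtoℚ k            ≡⟨ solve 2 (λ j k → (j :- k) :+ k := j) refl (ℤtoℚ j) (ℤtoℚ k) ⟩
    ℤtoℚ j                                ∎)
    where
    open ≡-Reasoning
    difference : ∀ a → ℤtoℚ (a ℤ.- k) ≡ ℤtoℚ a - ℤtoℚ k
    difference a = trans (ℤtoℚ-homo-+ a (ℤ.- k)) (cong (ℤtoℚ a +_) (ℤtoℚ-homo-neg k))

  ℕtoℚ-homo-+ : ∀ a b → ℕtoℚ (a ℕ.+ b) ≡ ℕtoℚ a + ℕtoℚ b
  ℕtoℚ-homo-+ a b = ℤtoℚ-homo-+ (ℤ.+ a) (ℤ.+ b)

  ℕtoℚ-homo-* : ∀ a b → ℕtoℚ (a ℕ.* b) ≡ ℕtoℚ a * ℕtoℚ b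
  ℕtoℚ-homo-* a b = trans (cong ℤtoℚ (ℤP.pos-* a b)) (ℤtoℚ-homo-* (ℤ.+ a) (ℤ.+ b))

  ℕtoℚ-mono-≤ : ∀ {a b} → a ℕ.≤ b → ℕtoℚ a ≤ ℕtoℚ b
  ℕtoℚ-mono-≤ h = ℤtoℚ-mono-≤ (ℤ.+≤+ h)

  ℕtoℚ-cancel-≤ : ∀ {a b} → ℕtoℚ a ≤ ℕtoℚ b → a ℕ.≤ b
  ℕtoℚ-cancel-≤ {a} {b} h with ℤtoℚ-cancel-≤ {ℤ.+ a} {ℤ.+ b} h
  ... | ℤ.+≤+ h' = h'

  ℕtoℚ-suc : ∀ a → ℕtoℚ (suc a) ≡ ℕtoℚ a + 1ℚ
  ℕtoℚ-suc a = trans (cong ℕtoℚ (ℕP.+-comm 1 a)) (ℕtoℚ-homo-+ a 1)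

  ℕtoℚ-mono-< : ∀ {a b} → a ℕ.< b → ℕtoℚ a < ℕtoℚ b
  ℕtoℚ-mono-< {a} a<b = <-≤-trans
    (subst (ℕtoℚ a <_) (sym (ℕtoℚ-suc a)) (<-by-diff 1ℚ (solve 1 (λ x → x :+ con 1ℚ :- x := con 1ℚ) refl (ℕtoℚ a)) 0<1))
    (ℕtoℚ-mono-≤ a<b)

  0≤ℕtoℚ : ∀ a → 0ℚ ≤ ℕtoℚ a
  0≤ℕtoℚ a = ℕtoℚ-mono-≤ {0} {a} ℕ.z≤n

  p+1≤1+n⇒p≤n : ∀ {p} n → p + 1ℚ ≤ ℕtoℚ (suc n) → p ≤ ℕtoℚ n
  p+1≤1+n⇒p≤n {p} n p+1≤1+n = ≤-by-diff (ℕtoℚ (suc n) - (p + 1ℚ))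
    (trans (solve 2 (λ f d → f :- d := (f :+ con 1ℚ) :- (d :+ con 1ℚ)) refl (ℕtoℚ n) p)
           (cong (λ w → w - (p + 1ℚ)) (sym (ℕtoℚ-suc n))))
    (p≤q⇒0≤q-p p+1≤1+n)

  integer-part : (q : ℚ) (B : ℕ) → 0ℚ ≤ q → q ≤ ℕtoℚ B → Σ ℕ λ g → ℕtoℚ g ≤ q × q ≤ ℕtoℚ g + 1ℚ
  integer-part q zero h0 h1 = 0 , h0 , ≤-trans h1 (subst (0ℚ ≤_) (sym (+-identityˡ 1ℚ)) 0≤1)
  integer-part q (suc B) h0 h1 = by-step (q ≤? ℕtoℚ B)
    where
    by-step : Dec (q ≤ ℕtoℚ B) → Σ ℕ λ g → ℕtoℚ g ≤ q × q ≤ ℕtoℚ g + 1ℚ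
    by-step (yes le) = integer-part q B h0 le
    by-step (no gt) = B , <⇒≤ (≰⇒> gt) , subst (q ≤_) (ℕtoℚ-suc B) h1

  sgn : ℚ → ℤ
  sgn q with 0ℚ ≤? q
  ... | yes _ = ℤ.+ 1
  ... | no _ = ℤ.- ℤ.+ 1

  sgn-cases : ∀ q → (sgn q ≡ ℤ.+ 1 × 0ℚ ≤ q) ⊎ (sgn q ≡ ℤ.- ℤ.+ 1 × q < 0ℚ)
  sgn-cases q with 0ℚ ≤? q
  ... | yes 0≤q = inj₁ (refl , 0≤q)
  ... | no 0≰q = inj₂ (refl , ≰⇒> 0≰q)

  sgnℚ : ℚ → ℚ
  sgnℚ q = ℤtoℚ (sgn q)

  sgnℚ-±1 : ∀ q → sgnℚ q ≡ 1ℚ ⊎ sgnℚ q ≡ - 1ℚ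
  sgnℚ-±1 q with sgn-cases q
  ... | inj₁ (sgn≡1 , _) = inj₁ (cong ℤtoℚ sgn≡1)
  ... | inj₂ (sgn≡-1 , _) = inj₂ (trans (cong ℤtoℚ sgn≡-1) (ℤtoℚ-homo-neg (ℤ.+ 1)))

  ±1⇒∣s∣≡1 : ∀ {s} → s ≡ 1ℚ ⊎ s ≡ - 1ℚ → ∣ s ∣ ≡ 1ℚ
  ±1⇒∣s∣≡1 (inj₁ refl) = refl
  ±1⇒∣s∣≡1 (inj₂ refl) = refl

  ±1⇒s*s≡1 : ∀ {s} → s ≡ 1ℚ ⊎ s ≡ - 1ℚ → s * s ≡ 1ℚ
  ±1⇒s*s≡1 (inj₁ refl) = refl
  ±1⇒s*s≡1 (inj₂ refl) = refl

  sgnℚ*p≡∣p∣ : ∀ q → sgnℚ q * q ≡ ∣ q ∣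
  sgnℚ*p≡∣p∣ q with sgn-cases q
  ... | inj₁ (sgn≡1 , 0≤q) = trans (cong (λ s → ℤtoℚ s * q) sgn≡1) (trans (*-identityˡ q) (sym (0≤p⇒∣p∣≡p 0≤q)))
  ... | inj₂ (sgn≡-1 , q<0) = trans (cong (λ s → ℤtoℚ s * q) sgn≡-1)
      (trans (solve 1 (λ x → (:- con 1ℚ) :* x := :- x) refl q)
             (sym (trans (sym (∣-p∣≡∣p∣ q)) (0≤p⇒∣p∣≡p (subst (0ℚ ≤_) (+-identityˡ (- q)) (p≤q⇒0≤q-p (<⇒≤ q<0)))))))

  sumℚ-cong : ∀ {n} {f g : Fin n → ℚ} → (∀ i → f i ≡ g i) → sumℚ f ≡ sumℚ g
  sumℚ-cong {zero} h = refl
  sumℚ-cong {suc n} h = cong₂ _+_ (h zero) (sumℚ-cong (λ i → h (suc i)))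

  sumℚ-+ : ∀ {n} (f g : Fin n → ℚ) → sumℚ (λ i → f i + g i) ≡ sumℚ f + sumℚ g
  sumℚ-+ {zero} f g = refl
  sumℚ-+ {suc n} f g = trans (cong ((f zero + g zero) +_) (sumℚ-+ (λ i → f (suc i)) (λ i → g (suc i))))
    (solve 4 (λ a b c d → (a :+ b) :+ (c :+ d) := (a :+ c) :+ (b :+ d)) refl (f zero) (g zero) _ _)

  sumℚ-*ˡ : ∀ {n} c (f : Fin n → ℚ) → sumℚ (λ i → c * f i) ≡ c * sumℚ f
  sumℚ-*ˡ {zero} c f = sym (*-zeroʳ c)
  sumℚ-*ˡ {suc n} c f = trans (cong (c * f zero +_) (sumℚ-*ˡ c (λ i → f (suc i)))) (sym (*-distribˡ-+ c _ _))

  sumℚ-*ʳ : ∀ {n} c (f : Fin n → ℚ) → sumℚ (λ i → f i * c) ≡ sumℚ f * c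
  sumℚ-*ʳ c f = trans (sumℚ-cong (λ i → *-comm (f i) c)) (trans (sumℚ-*ˡ c f) (*-comm c _))

  sumℚ-0 : ∀ {n} → sumℚ {n} (λ _ → 0ℚ) ≡ 0ℚ
  sumℚ-0 {zero} = refl
  sumℚ-0 {suc n} = trans (+-identityˡ _) (sumℚ-0 {n})

  sumℚ-zero : ∀ {n} {f : Fin n → ℚ} → (∀ i → f i ≡ 0ℚ) → sumℚ f ≡ 0ℚ
  sumℚ-zero {n} h = trans (sumℚ-cong h) (sumℚ-0 {n})

  sumℚ-neg : ∀ {n} (f : Fin n → ℚ) → sumℚ (λ i → - f i) ≡ - sumℚ f
  sumℚ-neg f = trans (sumℚ-cong (λ i → solve 1 (λ x → :- x := (:- con 1ℚ) :* x) refl (f i)))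
              (trans (sumℚ-*ˡ (- 1ℚ) f) (solve 1 (λ x → (:- con 1ℚ) :* x := :- x) refl _))

  sumℚ-- : ∀ {n} (f g : Fin n → ℚ) → sumℚ (λ i → f i - g i) ≡ sumℚ f - sumℚ g
  sumℚ-- f g = trans (sumℚ-+ f (λ i → - g i)) (cong (sumℚ f +_) (sumℚ-neg g))

  sumℚ-mono-≤ : ∀ {n} {f g : Fin n → ℚ} → (∀ i → f i ≤ g i) → sumℚ f ≤ sumℚ g
  sumℚ-mono-≤ {zero} h = ≤-refl
  sumℚ-mono-≤ {suc n} h = +-mono-≤ (h zero) (sumℚ-mono-≤ (λ i → h (suc i)))

  sumℚ-mono-< : ∀ {n} {f g : Fin n → ℚ} → (∀ i → f i ≤ g i) → (a : Fin n) → f a < g a → sumℚ f < sumℚ g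
  sumℚ-mono-< {suc n} h zero lt = +-mono-<-≤ lt (sumℚ-mono-≤ (λ i → h (suc i)))
  sumℚ-mono-< {suc n} h (suc a) lt = +-mono-≤-< (h zero) (sumℚ-mono-< (λ i → h (suc i)) a lt)

  sumℚ-const : ∀ {n} c → sumℚ {n} (λ _ → c) ≡ ℕtoℚ n * c
  sumℚ-const {zero} c = sym (*-zeroˡ c)
  sumℚ-const {suc n} c = trans (cong (c +_) (sumℚ-const {n} c))
    (trans (solve 2 (λ l c → c :+ l :* c := (l :+ con 1ℚ) :* c) refl (ℕtoℚ n) c)
           (cong (_* c) (sym (ℕtoℚ-suc n))))

  ∣sumℚ∣≤sumℚ∣∣ : ∀ {n} (f : Fin n → ℚ) → ∣ sumℚ f ∣ ≤ sumℚ (λ i → ∣ f i ∣)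
  ∣sumℚ∣≤sumℚ∣∣ {zero} f = ≤-refl
  ∣sumℚ∣≤sumℚ∣∣ {suc n} f = ≤-trans (∣p+q∣≤∣p∣+∣q∣ (f zero) (sumℚ (λ i → f (suc i)))) (+-monoʳ-≤ ∣ f zero ∣ (∣sumℚ∣≤sumℚ∣∣ (λ i → f (suc i))))

  ∣weighted-sum∣≤ : ∀ {n} (a : Fin n → ℚ) (x : Fin n → ℚ) (D : ℚ) → (∀ i → 0ℚ ≤ a i) → (∀ i → ∣ x i ∣ ≤ D) →
    ∣ sumℚ (λ i → a i * x i) ∣ ≤ sumℚ a * D
  ∣weighted-sum∣≤ a x D ha hx = ≤-trans (∣sumℚ∣≤sumℚ∣∣ (λ i → a i * x i))
    (≤-trans (sumℚ-mono-≤ (λ i → ≤-trans (≤-reflexive (∣p*q∣≡p*∣q∣ (x i) (ha i))) (*-monoˡ-≤-nonNeg (a i) {{ℚ.nonNegative (ha i)}} (hx i))))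
             (≤-reflexive (sumℚ-*ʳ D a)))

  δ : ∀ {n} → Fin n → Fin n → ℚ
  δ zero zero = 1ℚ
  δ zero (suc _) = 0ℚ
  δ (suc _) zero = 0ℚ
  δ (suc p) (suc i) = δ p i

  δ-refl : ∀ {n} (p : Fin n) → δ p p ≡ 1ℚ
  δ-refl zero = refl
  δ-refl (suc p) = δ-refl p

  δ-≢ : ∀ {n} {p i : Fin n} → ¬ p ≡ i → δ p i ≡ 0ℚ
  δ-≢ {p = zero} {zero} h = ⊥-elim (h refl)
  δ-≢ {p = zero} {suc i} h = refl
  δ-≢ {p = suc p} {zero} h = refl
  δ-≢ {p = suc p} {suc i} h = δ-≢ (λ e → h (cong suc e))

  δ≥0 : ∀ {n} (p i : Fin n) → 0ℚ ≤ δ p i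
  δ≥0 zero zero = 0≤1
  δ≥0 zero (suc i) = ≤-refl
  δ≥0 (suc p) zero = ≤-refl
  δ≥0 (suc p) (suc i) = δ≥0 p i

  δ-swap : ∀ {n} (a j : Fin n) (f : Fin n → ℚ) → δ a j * f j ≡ δ a j * f a
  δ-swap a j f = by-index (a FinP.≟ j)
    where
    by-index : Dec (a ≡ j) → δ a j * f j ≡ δ a j * f a
    by-index (yes refl) = refl
    by-index (no ne) = trans (cong (_* f j) (δ-≢ ne)) (trans (*-zeroˡ (f j)) (sym (trans (cong (_* f a) (δ-≢ ne)) (*-zeroˡ (f a)))))

  sumℚ-δ : ∀ {n} (p : Fin n) (f : Fin n → ℚ) → sumℚ (λ i → δ p i * f i) ≡ f p
  sumℚ-δ zero f = trans (cong₂ _+_ (*-identityˡ (f zero)) (sumℚ-zero {f = λ i → 0ℚ * f (suc i)} (λ i → *-zeroˡ (f (suc i))))) (+-identityʳ _)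
  sumℚ-δ (suc p) f = trans (cong (_+ sumℚ (λ i → δ p i * f (suc i))) (*-zeroˡ (f zero)))
     (trans (+-identityˡ _) (sumℚ-δ p (λ i → f (suc i))))

  sumℚ-δ′ : ∀ {n} (p : Fin n) (f : Fin n → ℚ) → sumℚ (λ i → δ i p * f i) ≡ f p
  sumℚ-δ′ zero f = trans (cong₂ _+_ (*-identityˡ (f zero)) (sumℚ-zero {f = λ i → 0ℚ * f (suc i)} (λ i → *-zeroˡ (f (suc i))))) (+-identityʳ _)
  sumℚ-δ′ (suc p) f = trans (cong (_+ sumℚ (λ i → δ i p * f (suc i))) (*-zeroˡ (f zero)))
     (trans (+-identityˡ _) (sumℚ-δ′ p (λ i → f (suc i))))

  sumℚ-+δ : ∀ {n} (μ : Fin n → ℚ) (p : Fin n) (β : ℚ) (x : Fin n → ℚ) →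
    sumℚ (λ i → (μ i + δ p i * β) * x i) ≡ sumℚ (λ i → μ i * x i) + β * x p
  sumℚ-+δ μ p β x = trans (sumℚ-cong (λ i → expand i)) (trans (sumℚ-+ (λ i → μ i * x i) (λ i → β * (δ p i * x i)))
     (cong (sumℚ (λ i → μ i * x i) +_) (trans (sumℚ-*ˡ β (λ i → δ p i * x i)) (cong (β *_) (sumℚ-δ p x)))))
    where
    expand : ∀ i → (μ i + δ p i * β) * x i ≡ μ i * x i + β * (δ p i * x i)
    expand i = solve 4 (λ m d b y → (m :+ d :* b) :* y := m :* y :+ b :* (d :* y)) refl (μ i) (δ p i) β (x i)

  δz : ∀ {n} → Fin n → Fin n → ℤ
  δz zero zero = ℤ.+ 1
  δz zero (suc _) = ℤ.+ 0
  δz (suc _) zero = ℤ.+ 0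
  δz (suc p) (suc i) = δz p i

  δz-ℚ : ∀ {n} (p i : Fin n) → ℤtoℚ (δz p i) ≡ δ p i
  δz-ℚ zero zero = refl
  δz-ℚ zero (suc i) = refl
  δz-ℚ (suc p) zero = refl
  δz-ℚ (suc p) (suc i) = δz-ℚ p i

  ℤtoℚ-sumℤ : ∀ {n} (f : Fin n → ℤ) → ℤtoℚ (sumℤ f) ≡ sumℚ (λ i → ℤtoℚ (f i))
  ℤtoℚ-sumℤ {zero} f = refl
  ℤtoℚ-sumℤ {suc n} f = trans (ℤtoℚ-homo-+ (f zero) _) (cong (ℤtoℚ (f zero) +_) (ℤtoℚ-sumℤ (λ i → f (suc i))))

  sumℤ-as-ℚ : ∀ {n} (a w : Fin n → ℤ) → ℤtoℚ (sumℤ (λ j → a j ℤ.* w j)) ≡ sumℚ (λ j → ℤtoℚ (a j) * ℤtoℚ (w j))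
  sumℤ-as-ℚ a w = trans (ℤtoℚ-sumℤ (λ j → a j ℤ.* w j)) (sumℚ-cong (λ j → ℤtoℚ-homo-* (a j) (w j)))

  sumℤ-cong : ∀ {n} {f g : Fin n → ℤ} → (∀ j → f j ≡ g j) → sumℤ f ≡ sumℤ g
  sumℤ-cong {zero} h = refl
  sumℤ-cong {suc n} h = cong₂ ℤ._+_ (h zero) (sumℤ-cong (λ j → h (suc j)))

  sumℕ : ∀ {n} → (Fin n → ℕ) → ℕ
  sumℕ {zero} f = 0
  sumℕ {suc n} f = f zero ℕ.+ sumℕ (λ i → f (suc i))

  ℕtoℚ-sumℕ : ∀ {n} (f : Fin n → ℕ) → ℕtoℚ (sumℕ f) ≡ sumℚ (λ i → ℕtoℚ (f i))
  ℕtoℚ-sumℕ {zero} f = refl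
  ℕtoℚ-sumℕ {suc n} f = trans (ℕtoℚ-homo-+ (f zero) _) (cong (ℕtoℚ (f zero) +_) (ℕtoℚ-sumℕ (λ i → f (suc i))))

  indicator : ∀ {A : Set} → Dec A → ℕ
  indicator (yes _) = 1
  indicator (no _) = 0

  indicatorℚ : ∀ {A : Set} → Dec A → ℚ
  indicatorℚ a = ℕtoℚ (indicator a)

  indicator-yes : ∀ {A : Set} (a : Dec A) → A → indicator a ≡ 1
  indicator-yes (yes _) _ = refl
  indicator-yes (no n) x = ⊥-elim (n x)

  0≤indicatorℚ : ∀ {A : Set} (a : Dec A) → 0ℚ ≤ indicatorℚ a
  0≤indicatorℚ a = 0≤ℕtoℚ (indicator a)

  indicator-cong : ∀ {A B : Set} (a : Dec A) (b : Dec B) → (A → B) → (B → A) → indicator a ≡ indicator b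
  indicator-cong (yes _) (yes _) f g = refl
  indicator-cong (yes x) (no y) f g = ⊥-elim (y (f x))
  indicator-cong (no x) (yes y) f g = ⊥-elim (x (g y))
  indicator-cong (no _) (no _) f g = refl

  indicator-mono : ∀ {A B : Set} (a : Dec A) (b : Dec B) → (A → B) → indicator a ℕ.≤ indicator b
  indicator-mono (yes x) (yes _) f = ℕP.≤-refl
  indicator-mono (yes x) (no y) f = ⊥-elim (y (f x))
  indicator-mono (no _) b f = ℕ.z≤n

  count : ∀ {n} {P : Fin n → Set} → (∀ i → Dec (P i)) → ℕ
  count P? = sumℕ (λ i → indicator (P? i))

  sumℕ-cong : ∀ {n} {f g : Fin n → ℕ} → (∀ i → f i ≡ g i) → sumℕ f ≡ sumℕ g
  sumℕ-cong {zero} h = refl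
  sumℕ-cong {suc n} h = cong₂ ℕ._+_ (h zero) (sumℕ-cong (λ i → h (suc i)))

  count-cong : ∀ {n} {P Q : Fin n → Set} (P? : ∀ i → Dec (P i)) (Q? : ∀ i → Dec (Q i)) →
    (∀ i → P i → Q i) → (∀ i → Q i → P i) → count P? ≡ count Q?
  count-cong P? Q? f g = sumℕ-cong (λ i → indicator-cong (P? i) (Q? i) (f i) (g i))

  count>0⇒witness : ∀ {n} {P : Fin n → Set} (P? : ∀ i → Dec (P i)) → 0 ℕ.< count P? → Σ (Fin n) P
  count>0⇒witness {zero} P? ()
  count>0⇒witness {suc n} P? h with P? zero
  ... | yes p = zero , p
  ... | no _ = let (i , q) = count>0⇒witness (λ i → P? (suc i)) h in suc i , q

  except? : ∀ {n} {P : Fin n → Set} (P? : ∀ i → Dec (P i)) (p : Fin n) → ∀ i → Dec (P i × ¬ i ≡ p)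
  except? P? p i = P? i ×-dec ¬? (i FinP.≟ p)

  count-except : ∀ {n} {P : Fin n → Set} (P? : ∀ i → Dec (P i)) (p : Fin n) → P p →
    count P? ≡ suc (count (except? P? p))
  count-except {suc n} P? zero Pp with P? zero
  ... | no q = ⊥-elim (q Pp)
  ... | yes _ = cong suc (count-cong (λ i → P? (suc i)) (λ i → except? P? zero (suc i))
                   (λ i x → x , λ ()) (λ i x → proj₁ x))
  count-except {suc n} P? (suc p) Pp = trans (cong₂ ℕ._+_ same-at-head (count-except (λ i → P? (suc i)) p Pp))
    (trans (ℕP.+-suc _ _) (cong suc (cong (indicator (except? P? (suc p) zero) ℕ.+_)
       (count-cong (except? (λ i → P? (suc i)) p) (λ i → except? P? (suc p) (suc i))
          (λ i x → proj₁ x , λ e → proj₂ x (FinP.suc-injective e))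
          (λ i x → proj₁ x , λ e → proj₂ x (cong suc e))))))
    where
    same-at-head : indicator (P? zero) ≡ indicator (except? P? (suc p) zero)
    same-at-head = indicator-cong (P? zero) (except? P? (suc p) zero) (λ x → x , λ ()) proj₁

  count-mono-⊆ : ∀ {n} {P Q : Fin n → Set} (Q? : ∀ i → Dec (Q i)) (P? : ∀ i → Dec (P i)) →
    (∀ i → Q i → P i) → count Q? ℕ.≤ count P?
  count-mono-⊆ {zero} Q? P? f = ℕ.z≤n
  count-mono-⊆ {suc n} Q? P? f = ℕP.+-mono-≤ (indicator-mono (Q? zero) (P? zero) (f zero))
                                          (count-mono-⊆ (λ i → Q? (suc i)) (λ i → P? (suc i)) (λ i → f (suc i)))

  count-mono-⊂ : ∀ {n} {P Q : Fin n → Set} (Q? : ∀ i → Dec (Q i)) (P? : ∀ i → Dec (P i)) →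
    (∀ i → Q i → P i) → (a : Fin n) → P a → ¬ Q a → count Q? ℕ.< count P?
  count-mono-⊂ Q? P? f a Pa nQa = subst (count Q? ℕ.<_) (sym (count-except P? a Pa))
    (ℕ.s≤s (count-mono-⊆ Q? (except? P? a) (λ i q → f i q , λ e → nQa (subst _ e q))))

  count≤size : ∀ {n} {P : Fin n → Set} (P? : ∀ i → Dec (P i)) → count P? ℕ.≤ n
  count≤size {zero} P? = ℕ.z≤n
  count≤size {suc n} P? = ℕP.+-mono-≤ (indicator≤1 (P? zero)) (count≤size (λ i → P? (suc i)))
    where indicator≤1 : ∀ {A : Set} (a : Dec A) → indicator a ℕ.≤ 1
          indicator≤1 (yes _) = ℕP.≤-refl
          indicator≤1 (no _) = ℕ.z≤n

  argmin : ∀ {k} {P : Fin k → Set} (P? : ∀ i → Dec (P i)) (f : Fin k → ℚ) → Σ (Fin k) P →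
    Σ (Fin k) λ a → P a × (∀ j → P j → f a ≤ f j)
  argmin {suc k} {P} P? f w with FinP.any? (λ i → P? (suc i))
  ... | no none = zero , at-head w , λ { zero _ → ≤-refl ; (suc j) pj → ⊥-elim (none (j , pj)) }
    where
    at-head : Σ (Fin (suc k)) P → P zero
    at-head (zero , p) = p
    at-head (suc i , p) = ⊥-elim (none (i , p))
  ... | yes w' with argmin (λ i → P? (suc i)) (λ i → f (suc i)) w'
  ...   | (a , Pa , ba) with P? zero
  ...     | no nz = suc a , Pa , λ { zero pz → ⊥-elim (nz pz) ; (suc j) pj → ba j pj }
  ...     | yes pz with f zero ≤? f (suc a)
  ...       | yes le = zero , pz , λ { zero _ → ≤-refl ; (suc j) pj → ≤-trans le (ba j pj) }
  ...       | no gt = suc a , Pa , λ { zero _ → <⇒≤ (≰⇒> gt) ; (suc j) pj → ba j pj }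

  sumL : ∀ {A : Set} → List A → (A → ℚ) → ℚ
  sumL [] g = 0ℚ
  sumL (x ∷ xs) g = g x + sumL xs g

  sumL-++ : ∀ {A : Set} (xs ys : List A) (g : A → ℚ) → sumL (xs ++ ys) g ≡ sumL xs g + sumL ys g
  sumL-++ [] ys g = sym (+-identityˡ _)
  sumL-++ (x ∷ xs) ys g = trans (cong (g x +_) (sumL-++ xs ys g)) (sym (+-assoc (g x) _ _))

  sumL-cong : ∀ {A : Set} (xs : List A) {g h : A → ℚ} → (∀ x → g x ≡ h x) → sumL xs g ≡ sumL xs h
  sumL-cong [] e = refl
  sumL-cong (x ∷ xs) e = cong₂ _+_ (e x) (sumL-cong xs e)

  sumL-map : ∀ {A B : Set} (f : A → B) (xs : List A) (g : B → ℚ) → sumL (map f xs) g ≡ sumL xs (λ x → g (f x))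
  sumL-map f [] g = refl
  sumL-map f (x ∷ xs) g = cong (g (f x) +_) (sumL-map f xs g)

  sumL-mono : ∀ {A : Set} (xs : List A) {g h : A → ℚ} → (∀ x → g x ≤ h x) → sumL xs g ≤ sumL xs h
  sumL-mono [] e = ≤-refl
  sumL-mono (x ∷ xs) e = +-mono-≤ (e x) (sumL-mono xs e)

  sumL-abs : ∀ {A : Set} (xs : List A) (g : A → ℚ) → ∣ sumL xs g ∣ ≤ sumL xs (λ x → ∣ g x ∣)
  sumL-abs [] g = ≤-refl
  sumL-abs (x ∷ xs) g = ≤-trans (∣p+q∣≤∣p∣+∣q∣ (g x) (sumL xs g)) (+-monoʳ-≤ ∣ g x ∣ (sumL-abs xs g))

  sumL-const : ∀ {A : Set} (xs : List A) c → sumL xs (λ _ → c) ≡ ℕtoℚ (length xs) * c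
  sumL-const [] c = sym (*-zeroˡ c)
  sumL-const (x ∷ xs) c = trans (cong (c +_) (sumL-const xs c))
    (trans (solve 2 (λ l c → c :+ l :* c := (l :+ con 1ℚ) :* c) refl (ℕtoℚ (length xs)) c)
           (cong (_* c) (sym (ℕtoℚ-suc (length xs)))))

  sumL-len : ∀ {A : Set} (xs : List A) → sumL xs (λ _ → 1ℚ) ≡ ℕtoℚ (length xs)
  sumL-len xs = trans (sumL-const xs 1ℚ) (*-identityʳ _)

  sumL-rep : ∀ {A : Set} k (a : A) (h : A → ℚ) → sumL (replicate k a) h ≡ ℕtoℚ k * h a
  sumL-rep zero a h = sym (*-zeroˡ (h a))
  sumL-rep (suc k) a h = trans (cong (h a +_) (sumL-rep k a h))
    (trans (solve 2 (λ k x → x :+ k :* x := (k :+ con 1ℚ) :* x) refl (ℕtoℚ k) (h a)) (cong (_* h a) (sym (ℕtoℚ-suc k))))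

  sumL-*ˡ : ∀ {A : Set} (xs : List A) c (h : A → ℚ) → sumL xs (λ t → c * h t) ≡ c * sumL xs h
  sumL-*ˡ [] c h = sym (*-zeroʳ c)
  sumL-*ˡ (x ∷ xs) c h = trans (cong (c * h x +_) (sumL-*ˡ xs c h)) (sym (*-distribˡ-+ c (h x) _))

  sumL-comm : ∀ {A : Set} (xs ys : List A) g → sumL (xs ++ ys) g ≡ sumL (ys ++ xs) g
  sumL-comm xs ys g = trans (sumL-++ xs ys g) (trans (+-comm (sumL xs g) (sumL ys g)) (sym (sumL-++ ys xs g)))

  sumL-nonNeg : ∀ {A : Set} (Z : List A) (h : A → ℚ) → All (λ t → 0ℚ ≤ h t) Z → 0ℚ ≤ sumL Z h
  sumL-nonNeg [] h [] = ≤-refl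
  sumL-nonNeg (z ∷ Z) h (p ∷ ps) = +-pres-0≤ p (sumL-nonNeg Z h ps)

  sumL-sub : ∀ {A : Set} (X B Y : List A) (h : A → ℚ) → All (λ t → 0ℚ ≤ h t) X → All (λ t → 0ℚ ≤ h t) Y →
    sumL B h ≤ sumL (X ++ B ++ Y) h
  sumL-sub X B Y h aX aY = subst (sumL B h ≤_) (sym (trans (sumL-++ X (B ++ Y) h) (cong (sumL X h +_) (sumL-++ B Y h))))
    (≤-by-diff (sumL X h + sumL Y h) (solve 3 (λ x b y → x :+ (b :+ y) :- b := x :+ y) refl (sumL X h) (sumL B h) (sumL Y h))
       (+-pres-0≤ (sumL-nonNeg X h aX) (sumL-nonNeg Y h aY)))

  sumL-sumℚ : ∀ {A : Set} {n} (xs : List A) (f : A → Fin n → ℚ) →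
    sumL xs (λ t → sumℚ (f t)) ≡ sumℚ (λ j → sumL xs (λ t → f t j))
  sumL-sumℚ {n = n} [] f = sym (sumℚ-0 {n})
  sumL-sumℚ (x ∷ xs) f = trans (cong (sumℚ (f x) +_) (sumL-sumℚ xs f)) (sym (sumℚ-+ (f x) (λ j → sumL xs (λ t → f t j))))

  sumℚ-lookup : ∀ {A : Set} (xs : List A) (h : A → ℚ) → sumℚ (λ i → h (lookup xs i)) ≡ sumL xs h
  sumℚ-lookup [] h = refl
  sumℚ-lookup (x ∷ xs) h = cong (h x +_) (sumℚ-lookup xs h)

  all-lookup : ∀ {A : Set} {P : A → Set} (xs : List A) → All P xs → ∀ i → P (lookup xs i)
  all-lookup (x ∷ xs) (p ∷ ps) zero = p
  all-lookup (x ∷ xs) (p ∷ ps) (suc i) = all-lookup xs ps i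

  concatF : ∀ {A : Set} {n} → (Fin n → List A) → List A
  concatF {n = zero} f = []
  concatF {n = suc n} f = f zero ++ concatF (λ j → f (suc j))

  sumL-concatF : ∀ {A : Set} {n} (f : Fin n → List A) (h : A → ℚ) → sumL (concatF f) h ≡ sumℚ (λ j → sumL (f j) h)
  sumL-concatF {n = zero} f h = refl
  sumL-concatF {n = suc n} f h = trans (sumL-++ (f zero) _ h) (cong (sumL (f zero) h +_) (sumL-concatF (λ j → f (suc j)) h))

  all-concatF : ∀ {A : Set} {P : A → Set} {n} (f : Fin n → List A) → (∀ j → All P (f j)) → All P (concatF f)
  all-concatF {n = zero} f h = []
  all-concatF {n = suc n} f h = AllP.++⁺ (h zero) (all-concatF (λ j → f (suc j)) (λ j → h (suc j)))

  sumLℤ : ∀ {A : Set} → List A → (A → ℤ) → ℤ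
  sumLℤ [] g = ℤ.+ 0
  sumLℤ (x ∷ xs) g = g x ℤ.+ sumLℤ xs g

  ℤtoℚ-sumLℤ : ∀ {A : Set} (xs : List A) (h : A → ℤ) → ℤtoℚ (sumLℤ xs h) ≡ sumL xs (λ t → ℤtoℚ (h t))
  ℤtoℚ-sumLℤ [] h = refl
  ℤtoℚ-sumLℤ (x ∷ xs) h = trans (ℤtoℚ-homo-+ (h x) _) (cong (ℤtoℚ (h x) +_) (ℤtoℚ-sumLℤ xs h))

  take-snoc : ∀ {A : Set} ℓ (xs : List A) x → take ℓ (xs ++ x ∷ []) ≡ take ℓ xs ⊎ take ℓ (xs ++ x ∷ []) ≡ xs ++ x ∷ []
  take-snoc zero xs x = inj₁ refl
  take-snoc (suc ℓ) [] x = inj₂ (cong (x ∷_) (take-[] ℓ))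
    where take-[] : ∀ {A : Set} ℓ → take {A = A} ℓ [] ≡ []
          take-[] zero = refl
          take-[] (suc ℓ) = refl
  take-snoc (suc ℓ) (y ∷ xs) x with take-snoc ℓ xs x
  ... | inj₁ e = inj₁ (cong (y ∷_) e)
  ... | inj₂ e = inj₂ (cong (y ∷_) e)

  length-take≤ : ∀ {A : Set} ℓ (xs : List A) → length (take ℓ xs) ℕ.≤ length xs
  length-take≤ ℓ xs = subst (ℕ._≤ length xs) (sym (LP.length-take ℓ xs)) (ℕP.m⊓n≤n ℓ (length xs))

  take-le : ∀ {A : Set} i j (xs : List A) → i ℕ.≤ j → take j xs ≡ take i xs ++ drop i (take j xs)
  take-le zero j xs i≤j = refl
  take-le (suc i) (suc j) [] i≤j = refl
  take-le (suc i) (suc j) (x ∷ xs) (ℕ.s≤s i≤j) = cong (x ∷_) (take-le i j xs i≤j)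

  length-take-le : ∀ {A : Set} j (xs : List A) → j ℕ.≤ length xs → length (take j xs) ≡ j
  length-take-le zero xs j≤ = refl
  length-take-le (suc j) (x ∷ xs) (ℕ.s≤s j≤) = cong suc (length-take-le j xs j≤)

  take-pre : ∀ {A : Set} ℓ (xs ys : List A) → Σ ℕ λ ℓ' → take ℓ xs ≡ take ℓ' (xs ++ ys)
  take-pre zero xs ys = 0 , refl
  take-pre (suc ℓ) [] ys = 0 , refl
  take-pre (suc ℓ) (x ∷ xs) ys = let (ℓ' , e) = take-pre ℓ xs ys in suc ℓ' , cong (x ∷_) e

  take-len-++ : ∀ {A : Set} (xs ys : List A) ℓ → take (length xs ℕ.+ ℓ) (xs ++ ys) ≡ xs ++ take ℓ ys
  take-len-++ [] ys ℓ = refl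
  take-len-++ (x ∷ xs) ys ℓ = cong (x ∷_) (take-len-++ xs ys ℓ)

  take-++-cases : ∀ {A : Set} ℓ (xs ys : List A) →
    take ℓ (xs ++ ys) ≡ take ℓ xs ⊎ Σ ℕ (λ ℓ' → take ℓ (xs ++ ys) ≡ xs ++ take ℓ' ys)
  take-++-cases zero xs ys = inj₁ refl
  take-++-cases (suc ℓ) [] ys = inj₂ (suc ℓ , refl)
  take-++-cases (suc ℓ) (x ∷ xs) ys = extend (take-++-cases ℓ xs ys)
    where
    extend : take ℓ (xs ++ ys) ≡ take ℓ xs ⊎ Σ ℕ (λ ℓ' → take ℓ (xs ++ ys) ≡ xs ++ take ℓ' ys) →
      take (suc ℓ) (x ∷ xs ++ ys) ≡ take (suc ℓ) (x ∷ xs) ⊎ Σ ℕ (λ ℓ' → take (suc ℓ) (x ∷ xs ++ ys) ≡ (x ∷ xs) ++ take ℓ' ys)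
    extend (inj₁ e) = inj₁ (cong (x ∷_) e)
    extend (inj₂ (ℓ' , e)) = inj₂ (ℓ' , cong (x ∷_) e)

  χ : ∀ {N} → (Fin N → Bool) → Fin N → ℚ
  χ W i = if W i then 1ℚ else 0ℚ

  χ≤1 : ∀ {N} (W : Fin N → Bool) i → χ W i ≤ 1ℚ
  χ≤1 W i with W i
  ... | true = ≤-refl
  ... | false = 0≤1

  χ-cases : ∀ {N} (W : Fin N → Bool) i → (W i ≡ true × χ W i ≡ 1ℚ) ⊎ (W i ≡ false × χ W i ≡ 0ℚ)
  χ-cases W i with W i
  ... | true = inj₁ (refl , refl)
  ... | false = inj₂ (refl , refl)

  elements : ∀ {N} → (Fin N → Bool) → List (Fin N)
  elements {zero} W = []
  elements {suc N} W = (if W zero then zero ∷ [] else []) ++ map suc (elements (λ i → W (suc i)))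

  sumL-elements : ∀ {N} (W : Fin N → Bool) (g : Fin N → ℚ) → sumL (elements W) g ≡ sumℚ (λ i → χ W i * g i)
  sumL-elements {zero} W g = refl
  sumL-elements {suc N} W g = trans (sumL-++ (if W zero then zero ∷ [] else []) _ g)
     (cong₂ _+_ (head (W zero) refl) (trans (sumL-map suc (elements (λ i → W (suc i))) g) (sumL-elements (λ i → W (suc i)) (λ i → g (suc i)))))
    where
    head : ∀ b → W zero ≡ b → sumL (if b then zero ∷ [] else []) g ≡ χ W zero * g zero
    head true e rewrite e = trans (+-identityʳ (g zero)) (sym (*-identityˡ (g zero)))
    head false e rewrite e = sym (*-zeroˡ (g zero))

  remove : ∀ {N} → (Fin N → Bool) → Fin N → Fin N → Bool
  remove W i j with i FinP.≟ j
  ... | yes _ = false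
  ... | no _ = W j

  χ-remove : ∀ {N} (W : Fin N → Bool) i → W i ≡ true → ∀ j → χ W j ≡ χ (remove W i) j + δ i j
  χ-remove W i Wi j with i FinP.≟ j
  ... | yes refl rewrite Wi | δ-refl i = sym (+-identityˡ 1ℚ)
  ... | no ne rewrite δ-≢ ne = sym (+-identityʳ _)

  χ-remove-≢ : ∀ {N} (W : Fin N → Bool) i j → ¬ i ≡ j → χ (remove W i) j ≡ χ W j
  χ-remove-≢ W i j ne with i FinP.≟ j
  ... | yes e = ⊥-elim (ne e)
  ... | no _ = refl

  χ-remove-≡ : ∀ {N} (W : Fin N → Bool) i → χ (remove W i) i ≡ 0ℚ
  χ-remove-≡ W i with i FinP.≟ i
  ... | yes _ = refl
  ... | no ne = ⊥-elim (ne refl)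

  -- Kernel vectors and moving inside a box

  KernelVector : ∀ (r k : ℕ) (v : Fin k → Fin r → ℚ) {S : Fin k → Set} → (∀ i → Dec (S i)) → Set
  KernelVector r k v {S} S? = Σ (Fin k → ℚ) λ μ → (∀ i → ¬ S i → μ i ≡ 0ℚ) × (Σ (Fin k) λ i → ¬ μ i ≡ 0ℚ) ×
      (∀ c → sumℚ (λ i → μ i * v i c) ≡ 0ℚ)

  pivot-elimination : ∀ {r k} (v : Fin k → Fin (suc r) → ℚ) (p : Fin k) → ¬ v p zero ≡ 0ℚ → Fin k → Fin r → ℚ
  pivot-elimination v p vp≢0 i c = v i (suc c) - (v i zero ÷ v p zero) {{ℚ.≢-nonZero vp≢0}} * v p (suc c)

  -- One step of Gaussian elimination: a kernel vector μ' of the eliminated rows lifts to one of v by giving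
  -- the pivot row the coefficient β that cancels the first column.
  kernel-vector-after-pivot : ∀ {r k} (v : Fin k → Fin (suc r) → ℚ) {S : Fin k → Set} (S? : ∀ i → Dec (S i))
    (p : Fin k) → S p → (vp≢0 : ¬ v p zero ≡ 0ℚ) →
    KernelVector r k (pivot-elimination v p vp≢0) (except? S? p) → KernelVector (suc r) k v S?
  kernel-vector-after-pivot {r} {k} v {S} S? p Sp vp≢0 (μ' , supp' , (j , μ'j≢0) , eqs') = μ , supp , nz , eqs
    where
    instance
      nzp : ℚ.NonZero (v p zero)
      nzp = ℚ.≢-nonZero vp≢0
    α : Fin k → ℚ
    α i = v i zero ÷ v p zero
    β : ℚ
    β = - sumℚ (λ i → μ' i * α i)
    μ : Fin k → ℚ
    μ i = μ' i + δ p i * β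
    μ-off-p : ∀ {i} → ¬ p ≡ i → μ i ≡ μ' i
    μ-off-p {i} p≢i = trans (cong (μ' i +_) (trans (cong (_* β) (δ-≢ p≢i)) (*-zeroˡ β))) (+-identityʳ _)
    supp : ∀ i → ¬ S i → μ i ≡ 0ℚ
    supp i nS = trans (μ-off-p (λ e → nS (subst S e Sp))) (supp' i (λ x → nS (proj₁ x)))
    nz : Σ (Fin k) λ i → ¬ μ i ≡ 0ℚ
    nz with j FinP.≟ p
    ... | yes j≡p = ⊥-elim (μ'j≢0 (supp' j (λ x → proj₂ x j≡p)))
    ... | no j≢p = j , λ e → μ'j≢0 (trans (sym (μ-off-p (λ e → j≢p (sym e)))) e)
    αv : ∀ i → α i * v p zero ≡ v i zero
    αv i = trans (*-assoc (v i zero) _ _) (trans (cong (v i zero *_) (*-inverseˡ (v p zero))) (*-identityʳ _))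
    eqs : ∀ c → sumℚ (λ i → μ i * v i c) ≡ 0ℚ
    eqs zero = trans (sumℚ-+δ μ' p β (λ i → v i zero))
      (trans (cong (_+ β * v p zero) (trans (sumℚ-cong (λ i → trans (cong (μ' i *_) (sym (αv i))) (sym (*-assoc (μ' i) (α i) _))))
                                              (sumℚ-*ʳ (v p zero) (λ i → μ' i * α i))))
             (solve 2 (λ s x → s :* x :+ (:- s) :* x := con 0ℚ) refl (sumℚ (λ i → μ' i * α i)) (v p zero)))
    eqs (suc c) = trans (sumℚ-+δ μ' p β (λ i → v i (suc c)))
      (trans (cong (_+ β * v p (suc c)) (trans (sumℚ-cong split) (trans (sumℚ-+ (λ i → μ' i * w i c) (λ i → μ' i * α i * v p (suc c)))
             (cong₂ _+_ (eqs' c) (sumℚ-*ʳ (v p (suc c)) (λ i → μ' i * α i))))))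
             (solve 2 (λ s x → con 0ℚ :+ s :* x :+ (:- s) :* x := con 0ℚ) refl (sumℚ (λ i → μ' i * α i)) (v p (suc c))))
      where
      w : Fin k → Fin r → ℚ
      w = pivot-elimination v p vp≢0
      split : ∀ i → μ' i * v i (suc c) ≡ μ' i * w i c + μ' i * α i * v p (suc c)
      split i = solve 4 (λ m a x y → m :* x := m :* (x :- a :* y) :+ m :* a :* y) refl (μ' i) (α i) (v i (suc c)) (v p (suc c))

  kernel-vector : ∀ r {k} (v : Fin k → Fin r → ℚ) {S : Fin k → Set} (S? : ∀ i → Dec (S i)) →
    r ℕ.< count S? → KernelVector r k v S?
  kernel-vector zero v {S} S? h =
    let (p , Sp) = count>0⇒witness S? h in
    δ p , (λ i ¬Si → δ-≢ (λ e → ¬Si (subst S e Sp))) , (p , subst (λ x → ¬ x ≡ 0ℚ) (sym (δ-refl p)) 1≢0) , (λ ())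
  kernel-vector (suc r) {k} v {S} S? h with FinP.any? (λ i → S? i ×-dec ¬? (v i zero ≟ 0ℚ))
  ... | yes (p , Sp , vp≢0) = kernel-vector-after-pivot v S? p Sp vp≢0
          (kernel-vector r (pivot-elimination v p vp≢0) (except? S? p) (ℕP.≤-pred (subst (suc r ℕ.<_) (count-except S? p Sp) h)))
  ... | no none =
    let (μ , supp , nz , eqs) = kernel-vector r (λ i c → v i (suc c)) S? (ℕP.<-trans (ℕP.n<1+n r) h) in
    μ , supp , nz , λ { zero → sumℚ-zero (λ i → first-column-vanishes i μ supp) ; (suc c) → eqs c }
    where
    first-column-vanishes : ∀ i (μ : Fin k → ℚ) → (∀ i → ¬ S i → μ i ≡ 0ℚ) → μ i * v i zero ≡ 0ℚ
    first-column-vanishes i μ supp with S? i | v i zero ≟ 0ℚ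
    ... | _ | yes e = trans (cong (μ i *_) e) (*-zeroʳ (μ i))
    ... | yes Si | no ne = ⊥-elim (none (i , Si , ne))
    ... | no nS | no _ = trans (cong (_* v i zero) (supp i nS)) (*-zeroˡ (v i zero))

  InBox : ∀ {k} → (Fin k → ℚ) → (Fin k → ℚ) → Set
  InBox {k} μ u = ∀ i → 0ℚ ≤ μ i × μ i ≤ u i

  Interior : ∀ {k} → (Fin k → ℚ) → (Fin k → ℚ) → Fin k → Set
  Interior μ u i = 0ℚ < μ i × μ i < u i

  Interior? : ∀ {k} (μ u : Fin k → ℚ) → ∀ i → Dec (Interior μ u i)
  Interior? μ u i = (0ℚ <? μ i) ×-dec (μ i <? u i)

  shift : ∀ {k} → (Fin k → ℚ) → ℚ → (Fin k → ℚ) → Fin k → ℚ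
  shift μ t d i = μ i + t * d i

  sumℚ-shift : ∀ {k} (μ : Fin k → ℚ) t (d : Fin k → ℚ) (x : Fin k → ℚ) →
    sumℚ (λ i → d i * x i) ≡ 0ℚ → sumℚ (λ i → shift μ t d i * x i) ≡ sumℚ (λ i → μ i * x i)
  sumℚ-shift μ t d x h = trans (sumℚ-cong (λ i → solve 4 (λ m t d x → (m :+ t :* d) :* x := m :* x :+ t :* (d :* x)) refl (μ i) t (d i) (x i)))
    (trans (sumℚ-+ (λ i → μ i * x i) (λ i → t * (d i * x i)))
    (trans (cong (sumℚ (λ i → μ i * x i) +_) (trans (sumℚ-*ˡ t (λ i → d i * x i)) (trans (cong (t *_) h) (*-zeroʳ t))))
    (+-identityʳ _)))

  boundary-ahead : (u d : ℚ) → ℚ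
  boundary-ahead u d with 0ℚ <? d
  ... | yes _ = u
  ... | no _ = 0ℚ

  boundary-ahead-pos : ∀ {u d} → 0ℚ < d → boundary-ahead u d ≡ u
  boundary-ahead-pos {u} {d} d>0 with 0ℚ <? d
  ... | yes _ = refl
  ... | no d≯0 = ⊥-elim (d≯0 d>0)

  boundary-ahead-nonpos : ∀ {u d} → ¬ 0ℚ < d → boundary-ahead u d ≡ 0ℚ
  boundary-ahead-nonpos {u} {d} d≯0 with 0ℚ <? d
  ... | yes d>0 = ⊥-elim (d≯0 d>0)
  ... | no _ = refl

  exit-time : (μ u d : ℚ) → ℚ
  exit-time μ u d = (boundary-ahead u d - μ) * recip d

  exit-time-reaches : ∀ {μ u d} → ¬ d ≡ 0ℚ → exit-time μ u d * d ≡ boundary-ahead u d - μ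
  exit-time-reaches {μ} {u} {d} d≢0 = trans (*-assoc (boundary-ahead u d - μ) (recip d) d)
    (trans (cong ((boundary-ahead u d - μ) *_) (recip-inverseˡ d d≢0)) (*-identityʳ _))

  exit-time-pos : ∀ {μ u d} → 0ℚ < μ → μ < u → ¬ d ≡ 0ℚ → 0ℚ < exit-time μ u d
  exit-time-pos {μ} {u} {d} μ>0 μ<u d≢0 = by-sign (0ℚ <? d)
    where
    by-sign : Dec (0ℚ < d) → 0ℚ < exit-time μ u d
    by-sign (yes d>0) = subst (λ x → 0ℚ < (x - μ) * recip d) (sym (boundary-ahead-pos d>0))
                    (*-pres-0< (p<q⇒0<q-p μ<u) (recip-pos d>0))
    by-sign (no d≯0) = subst (λ x → 0ℚ < (x - μ) * recip d) (sym (boundary-ahead-nonpos d≯0))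
                   (neg*neg⇒0< (subst (_< 0ℚ) (sym (+-identityˡ (- μ))) (neg-antimono-< μ>0))
                               (recip-neg (≤∧≢⇒< (≮⇒≥ d≯0) d≢0)))

  shift-at-exit-time : ∀ {μ u d} → ¬ d ≡ 0ℚ →
    μ + exit-time μ u d * d ≡ 0ℚ ⊎ μ + exit-time μ u d * d ≡ u
  shift-at-exit-time {μ} {u} {d} d≢0 = by-sign (0ℚ <? d)
    where
    by-sign : Dec (0ℚ < d) → μ + exit-time μ u d * d ≡ 0ℚ ⊎ μ + exit-time μ u d * d ≡ u
    by-sign (yes d>0) = inj₂ (trans (cong (μ +_) (trans (exit-time-reaches d≢0) (cong (_- μ) (boundary-ahead-pos d>0))))
                          (solve 2 (λ m u → m :+ (u :- m) := u) refl μ u))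
    by-sign (no d≯0) = inj₁ (trans (cong (μ +_) (trans (exit-time-reaches d≢0) (cong (_- μ) (boundary-ahead-nonpos d≯0))))
                         (solve 1 (λ m → m :+ (con 0ℚ :- m) := con 0ℚ) refl μ))

  shift-before-exit-time : ∀ {μ u d t} → 0ℚ ≤ μ → μ ≤ u → ¬ d ≡ 0ℚ → 0ℚ ≤ t → t ≤ exit-time μ u d →
    0ℚ ≤ μ + t * d × μ + t * d ≤ u
  shift-before-exit-time {μ} {u} {d} {t} μ≥0 μ≤u d≢0 t≥0 t≤exit = by-sign (0ℚ <? d)
    where
    by-sign : Dec (0ℚ < d) → 0ℚ ≤ μ + t * d × μ + t * d ≤ u
    by-sign (yes d>0) =
        ≤-trans μ≥0 (≤-by-diff (t * d) (solve 2 (λ m x → m :+ x :- m := x) refl μ _) (*-pres-0≤ t≥0 (<⇒≤ d>0)))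
      , ≤-trans (+-monoʳ-≤ μ (*-monoʳ-≤-nonNeg d {{nonNegative (<⇒≤ d>0)}} t≤exit))
                (≤-reflexive (trans (cong (μ +_) reach) (solve 2 (λ m u → m :+ (u :- m) := u) refl μ u)))
      where
      reach : exit-time μ u d * d ≡ u - μ
      reach = trans (exit-time-reaches d≢0) (cong (_- μ) (boundary-ahead-pos d>0))
    by-sign (no d≯0) =
        ≤-trans (≤-reflexive (sym (trans (cong (μ +_) reach) (solve 1 (λ m → m :+ (con 0ℚ :- m) := con 0ℚ) refl μ))))
                (+-monoʳ-≤ μ (*-monoʳ-≤-nonPos d {{ℚ.nonPositive (≮⇒≥ d≯0)}} t≤exit))
      , ≤-trans (≤-by-diff (- (t * d)) (solve 2 (λ m x → m :- (m :+ x) := :- x) refl μ _)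
                   (subst (0ℚ ≤_) (solve 2 (λ t d → t :* (:- d) := :- (t :* d)) refl t d)
                      (*-pres-0≤ t≥0 (neg-antimono-≤ (≮⇒≥ d≯0)))))
                μ≤u
      where
      reach : exit-time μ u d * d ≡ 0ℚ - μ
      reach = trans (exit-time-reaches d≢0) (cong (_- μ) (boundary-ahead-nonpos d≯0))

  record BoundaryStep {k} (μ u d : Fin k → ℚ) : Set where
    field
      t : ℚ
      t-pos : 0ℚ < t
      ok : ∀ t' → 0ℚ ≤ t' → t' ≤ t → InBox (shift μ t' d) u
      hit : Σ (Fin k) λ a → ¬ d a ≡ 0ℚ × (shift μ t d a ≡ 0ℚ ⊎ shift μ t d a ≡ u a)

  step-to-boundary : ∀ {k} (μ u d : Fin k → ℚ) → InBox μ u → (∀ i → ¬ d i ≡ 0ℚ → Interior μ u i) →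
    Σ (Fin k) (λ i → ¬ d i ≡ 0ℚ) → BoundaryStep μ u d
  step-to-boundary {k} μ u d box supp nz = record
    { t = ρ a
    ; t-pos = exit-time-pos (proj₁ (supp a da≢0)) (proj₂ (supp a da≢0)) da≢0
    ; ok = ok
    ; hit = a , da≢0 , shift-at-exit-time {μ a} da≢0
    }
    where
    ρ : Fin k → ℚ
    ρ i = exit-time (μ i) (u i) (d i)
    first-exit : Σ (Fin k) λ a → ¬ d a ≡ 0ℚ × (∀ j → ¬ d j ≡ 0ℚ → ρ a ≤ ρ j)
    first-exit = argmin (λ i → ¬? (d i ≟ 0ℚ)) ρ nz
    a : Fin k
    a = proj₁ first-exit
    da≢0 : ¬ d a ≡ 0ℚ
    da≢0 = proj₁ (proj₂ first-exit)
    ok : ∀ t' → 0ℚ ≤ t' → t' ≤ ρ a → InBox (shift μ t' d) u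
    ok t' t'≥0 t'≤ρa i = by-direction (d i ≟ 0ℚ)
      where
      by-direction : Dec (d i ≡ 0ℚ) → 0ℚ ≤ shift μ t' d i × shift μ t' d i ≤ u i
      by-direction (yes di≡0) = subst (λ x → 0ℚ ≤ x × x ≤ u i)
        (sym (trans (cong (λ y → μ i + t' * y) di≡0) (trans (cong (μ i +_) (*-zeroʳ t')) (+-identityʳ _)))) (box i)
      by-direction (no di≢0) = shift-before-exit-time (proj₁ (box i)) (proj₂ (box i)) di≢0 t'≥0
        (≤-trans t'≤ρa (proj₂ (proj₂ first-exit) i di≢0))

  support-in : ∀ {k} {S : Fin k → Set} (S? : ∀ i → Dec (S i)) {d : Fin k → ℚ} →
    (∀ i → ¬ S i → d i ≡ 0ℚ) → ∀ i → ¬ d i ≡ 0ℚ → S i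
  support-in S? d-off i di≢0 with S? i
  ... | yes Si = Si
  ... | no ¬Si = ⊥-elim (di≢0 (d-off i ¬Si))

  Reduced : ∀ r {k} (M : Fin k → Fin r → ℚ) (u μ : Fin k → ℚ) → Set
  Reduced r {k} M u μ = Σ (Fin k → ℚ) λ μ' → InBox μ' u ×
      (∀ c → sumℚ (λ i → μ' i * M i c) ≡ sumℚ (λ i → μ i * M i c)) × count (Interior? μ' u) ℕ.≤ r

  module _ (r : ℕ) {k : ℕ} (M : Fin k → Fin r → ℚ) (u : Fin k → ℚ) where

    reduce-interior-once : (μ : Fin k → ℚ) → InBox μ u → r ℕ.< count (Interior? μ u) →
      Σ (Fin k → ℚ) λ μ' → InBox μ' u × (∀ c → sumℚ (λ i → μ' i * M i c) ≡ sumℚ (λ i → μ i * M i c)) ×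
        count (Interior? μ' u) ℕ.< count (Interior? μ u)
    reduce-interior-once μ box many =
      μ' , box' , (λ c → sumℚ-shift μ t d (λ i → M i c) (Md≡0 c)) ,
      count-mono-⊂ (Interior? μ' u) (Interior? μ u) still-interior a (supp a da≢0) a-on-boundary
      where
      K : KernelVector r k M (Interior? μ u)
      K = kernel-vector r M (Interior? μ u) many
      d : Fin k → ℚ
      d = proj₁ K
      Md≡0 : ∀ c → sumℚ (λ i → d i * M i c) ≡ 0ℚ
      Md≡0 = proj₂ (proj₂ (proj₂ K))
      supp : ∀ i → ¬ d i ≡ 0ℚ → Interior μ u i
      supp = support-in (Interior? μ u) (proj₁ (proj₂ K))
      S : BoundaryStep μ u d
      S = step-to-boundary μ u d box supp (proj₁ (proj₂ (proj₂ K)))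
      t : ℚ
      t = BoundaryStep.t S
      μ' : Fin k → ℚ
      μ' = shift μ t d
      box' : InBox μ' u
      box' = BoundaryStep.ok S t (<⇒≤ (BoundaryStep.t-pos S)) ≤-refl
      still-interior : ∀ i → Interior μ' u i → Interior μ u i
      still-interior i int' = by-direction (d i ≟ 0ℚ)
        where
        by-direction : Dec (d i ≡ 0ℚ) → Interior μ u i
        by-direction (yes di≡0) = subst (λ x → 0ℚ < x × x < u i)
                                    (trans (cong (λ y → μ i + t * y) di≡0) (trans (cong (μ i +_) (*-zeroʳ t)) (+-identityʳ _))) int'
        by-direction (no di≢0) = supp i di≢0
      a : Fin k
      a = proj₁ (BoundaryStep.hit S)
      da≢0 : ¬ d a ≡ 0ℚ
      da≢0 = proj₁ (proj₂ (BoundaryStep.hit S))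
      a-on-boundary : ¬ Interior μ' u a
      a-on-boundary (μ'a>0 , μ'a<ua) = on-boundary (proj₂ (proj₂ (BoundaryStep.hit S)))
        where
        on-boundary : μ' a ≡ 0ℚ ⊎ μ' a ≡ u a → ⊥
        on-boundary (inj₁ μ'a≡0) = <-irrefl (sym μ'a≡0) μ'a>0
        on-boundary (inj₂ μ'a≡ua) = <-irrefl μ'a≡ua μ'a<ua

    reduce : (fuel : ℕ) (μ : Fin k → ℚ) → InBox μ u → count (Interior? μ u) ℕ.≤ fuel → Reduced r M u μ
    reduce fuel μ box cf = by-count fuel cf (count (Interior? μ u) ℕ.≤? r)
      where
      by-count : ∀ fuel → count (Interior? μ u) ℕ.≤ fuel → Dec (count (Interior? μ u) ℕ.≤ r) → Reduced r M u μ
      by-count _ _ (yes few) = μ , box , (λ _ → refl) , few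
      by-count zero cf (no many) = ⊥-elim (many (ℕP.≤-trans cf ℕ.z≤n))
      by-count (suc fuel) cf (no many) =
        let (μ' , box' , same' , fewer) = reduce-interior-once μ box (ℕP.≰⇒> many)
            (μ'' , box'' , same'' , few) = reduce fuel μ' box' (ℕP.≤-pred (ℕP.≤-trans fewer cf))
        in μ'' , box'' , (λ c → trans (same'' c) (same' c)) , few

  -- Vertices of the LP relaxation

  uℚ : ∀ {n} → (Fin n → ℕ) → Fin n → ℚ
  uℚ u j = ℕtoℚ (u j)

  LPFeasible-shift : ∀ {m n} (A : Matrix m n) (b : Fin m → ℤ) (u : Fin n → ℕ) (x d : Fin n → ℚ) (t : ℚ) →
    LPFeasible A b u x → (∀ c → sumℚ (λ j → d j * ℤtoℚ (A c j)) ≡ 0ℚ) → InBox (shift x t d) (uℚ u) →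
    LPFeasible A b u (shift x t d)
  LPFeasible-shift A b u x d t (eqx , _) eqd box = (λ i → trans (sumℚ-cong (λ j → *-comm (ℤtoℚ (A i j)) (shift x t d j)))
     (trans (sumℚ-shift x t d (λ j → ℤtoℚ (A i j)) (eqd i)) (trans (sumℚ-cong (λ j → *-comm (x j) (ℤtoℚ (A i j)))) (eqx i)))) , box

  step-both-ways : ∀ {k} (μ u d : Fin k → ℚ) → InBox μ u → (∀ i → ¬ d i ≡ 0ℚ → Interior μ u i) →
    Σ (Fin k) (λ i → ¬ d i ≡ 0ℚ) →
    Σ ℚ λ t → 0ℚ < t × InBox (shift μ t d) u × InBox (shift μ t (λ i → - d i)) u
  step-both-ways μ u d box supp (j , dj≢0) =
    shorter (step-to-boundary μ u d box supp (j , dj≢0))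
            (step-to-boundary μ u (λ i → - d i) box (λ i -di≢0 → supp i (λ e → -di≢0 (cong -_ e)))
                              (j , λ e → dj≢0 (neg-injective {d j} {0ℚ} e)))
    where
    open BoundaryStep
    shorter : BoundaryStep μ u d → BoundaryStep μ u (λ i → - d i) →
      Σ ℚ λ t → 0ℚ < t × InBox (shift μ t d) u × InBox (shift μ t (λ i → - d i)) u
    shorter fwd bwd = by-order (t fwd ≤? t bwd)
      where
      by-order : Dec (t fwd ≤ t bwd) → Σ ℚ λ t → 0ℚ < t × InBox (shift μ t d) u × InBox (shift μ t (λ i → - d i)) u
      by-order (yes t₁≤t₂) = t fwd , t-pos fwd , ok fwd (t fwd) (<⇒≤ (t-pos fwd)) ≤-refl , ok bwd (t fwd) (<⇒≤ (t-pos fwd)) t₁≤t₂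
      by-order (no t₁≰t₂) = t bwd , t-pos bwd , ok fwd (t bwd) (<⇒≤ (t-pos bwd)) (<⇒≤ (≰⇒> t₁≰t₂)) , ok bwd (t bwd) (<⇒≤ (t-pos bwd)) ≤-refl

  opposite-shifts-agree : ∀ {k} (μ d : Fin k → ℚ) {t} → 0ℚ < t → ∀ j →
    shift μ t d j ≡ shift μ t (λ i → - d i) j → d j ≡ 0ℚ
  opposite-shifts-agree μ d {t} t>0 j agree = begin
    d j                              ≡⟨ sym (*-identityˡ (d j)) ⟩
    1ℚ * d j                         ≡⟨ cong (_* d j) (sym (recip-inverseˡ (t + t) 2t≢0)) ⟩
    recip (t + t) * (t + t) * d j    ≡⟨ *-assoc (recip (t + t)) (t + t) (d j) ⟩
    recip (t + t) * ((t + t) * d j)  ≡⟨ cong (recip (t + t) *_) 2td≡0 ⟩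
    recip (t + t) * 0ℚ               ≡⟨ *-zeroʳ (recip (t + t)) ⟩
    0ℚ                               ∎
    where
    open ≡-Reasoning
    2t≢0 : ¬ (t + t) ≡ 0ℚ
    2t≢0 e = <-irrefl (sym e) (+-pres-0< t>0 (<⇒≤ t>0))
    2td≡0 : (t + t) * d j ≡ 0ℚ
    2td≡0 = trans (solve 3 (λ x t d → (t :+ t) :* d := (x :+ t :* d) :- (x :+ t :* (:- d))) refl (μ j) t (d j))
              (trans (cong (_- shift μ t (λ i → - d i) j) agree) (+-inverseʳ (shift μ t (λ i → - d i) j)))

  vertex-interior-count : ∀ {m n} (A : Matrix m n) (b : Fin m → ℤ) (u : Fin n → ℕ) (x : Fin n → ℚ) →
    IsVertex A b u x → count (Interior? x (uℚ u)) ℕ.≤ m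
  vertex-interior-count {m} {n} A b u x ((Ax≡b , box) , extreme) = by-count (count (Interior? x (uℚ u)) ℕ.≤? m)
    where
    by-count : Dec (count (Interior? x (uℚ u)) ℕ.≤ m) → count (Interior? x (uℚ u)) ℕ.≤ m
    by-count (yes few) = few
    by-count (no many) = ⊥-elim (no-kernel-direction (kernel-vector m (λ j c → ℤtoℚ (A c j)) (Interior? x (uℚ u)) (ℕP.≰⇒> many)))
      where
      no-kernel-direction : KernelVector m n (λ j c → ℤtoℚ (A c j)) (Interior? x (uℚ u)) → ⊥
      no-kernel-direction (d , d-off , (j , dj≢0) , Ad≡0) = dj≢0 (opposite-shifts-agree x d t>0 j (extreme y w y-feasible w-feasible midpoint j))
        where
        moves : Σ ℚ λ t → 0ℚ < t × InBox (shift x t d) (uℚ u) × InBox (shift x t (λ i → - d i)) (uℚ u)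
        moves = step-both-ways x (uℚ u) d box (support-in (Interior? x (uℚ u)) d-off) (j , dj≢0)
        t : ℚ
        t = proj₁ moves
        t>0 : 0ℚ < t
        t>0 = proj₁ (proj₂ moves)
        y : Fin n → ℚ
        y = shift x t d
        w : Fin n → ℚ
        w = shift x t (λ i → - d i)
        A-d≡0 : ∀ c → sumℚ (λ j → - d j * ℤtoℚ (A c j)) ≡ 0ℚ
        A-d≡0 c = trans (sumℚ-cong (λ j → sym (neg-distribˡ-* (d j) (ℤtoℚ (A c j)))))
                    (trans (sumℚ-neg (λ j → d j * ℤtoℚ (A c j))) (cong -_ (Ad≡0 c)))
        y-feasible : LPFeasible A b u y
        y-feasible = LPFeasible-shift A b u x d t (Ax≡b , box) Ad≡0 (proj₁ (proj₂ (proj₂ moves)))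
        w-feasible : LPFeasible A b u w
        w-feasible = LPFeasible-shift A b u x (λ i → - d i) t (Ax≡b , box) A-d≡0 (proj₂ (proj₂ (proj₂ moves)))
        midpoint : ∀ j → y j + w j ≡ ℤtoℚ (ℤ.+ 2) * x j
        midpoint j = solve 3 (λ x t d → (x :+ t :* d) :+ (x :+ t :* (:- d)) := con (ℤtoℚ (ℤ.+ 2)) :* x) refl (x j) t (d j)

  -- The Steinitz lemma

  rescale-in-box : ∀ {k} (u μ : Fin k → ℚ) {s s' : ℚ} → InBox μ u → sumℚ μ ≡ s → 0ℚ < s → 0ℚ ≤ s' → s' ≤ s →
    InBox (λ i → s' * recip s * μ i) u × sumℚ (λ i → s' * recip s * μ i) ≡ s'
  rescale-in-box u μ {s} {s'} box Σμ≡s s>0 s'≥0 s'≤s = box' , Σcμ≡s'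
    where
    open ≡-Reasoning
    c : ℚ
    c = s' * recip s
    s⁻¹s≡1 : recip s * s ≡ 1ℚ
    s⁻¹s≡1 = recip-inverseˡ s (λ e → <-irrefl (sym e) s>0)
    1-c : 1ℚ - c ≡ (s - s') * recip s
    1-c = begin
      1ℚ - s' * recip s             ≡⟨ cong (_- s' * recip s) (sym s⁻¹s≡1) ⟩
      recip s * s - s' * recip s    ≡⟨ solve 3 (λ r s t → r :* s :- t :* r := (s :- t) :* r) refl (recip s) s s' ⟩
      (s - s') * recip s            ∎
    c≥0 : 0ℚ ≤ c
    c≥0 = *-pres-0≤ s'≥0 (<⇒≤ (recip-pos s>0))
    c≤1 : c ≤ 1ℚ
    c≤1 = ≤-by-diff ((s - s') * recip s) 1-c (*-pres-0≤ (p≤q⇒0≤q-p s'≤s) (<⇒≤ (recip-pos s>0)))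
    box' : InBox (λ i → c * μ i) u
    box' i = *-pres-0≤ c≥0 (proj₁ (box i)) ,
             ≤-trans (≤-by-diff ((1ℚ - c) * μ i) (solve 2 (λ x c → x :- c :* x := (con 1ℚ :- c) :* x) refl (μ i) c)
                        (*-pres-0≤ (p≤q⇒0≤q-p c≤1) (proj₁ (box i))))
                     (proj₂ (box i))
    Σcμ≡s' : sumℚ (λ i → c * μ i) ≡ s'
    Σcμ≡s' = begin
      sumℚ (λ i → c * μ i)    ≡⟨ sumℚ-*ˡ c μ ⟩
      c * sumℚ μ              ≡⟨ cong (c *_) Σμ≡s ⟩
      s' * recip s * s        ≡⟨ *-assoc s' (recip s) s ⟩
      s' * (recip s * s)      ≡⟨ cong (s' *_) s⁻¹s≡1 ⟩
      s' * 1ℚ                 ≡⟨ *-identityʳ s' ⟩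
      s'                      ∎

  χ≤μ+interior : ∀ {N} (W : Fin N → Bool) (μ : Fin N → ℚ) → InBox μ (χ W) → (∀ i → W i ≡ true → ¬ μ i ≡ 0ℚ) →
    ∀ i → χ W i ≤ μ i + indicatorℚ (Interior? μ (χ W) i)
  χ≤μ+interior W μ box nonzero i = by-membership (χ-cases W i)
    where
    ι : ℚ
    ι = indicatorℚ (Interior? μ (χ W) i)
    by-size : W i ≡ true → χ W i ≡ 1ℚ → Dec (μ i < 1ℚ) → 1ℚ ≤ μ i + ι
    by-size Wi χWi≡1 (yes μi<1) =
      subst (λ z → 1ℚ ≤ μ i + ℕtoℚ z)
            (sym (indicator-yes (Interior? μ (χ W) i)
                   (≤∧≢⇒< (proj₁ (box i)) (λ e → nonzero i Wi (sym e)) , subst (μ i <_) (sym χWi≡1) μi<1)))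
            (≤-by-diff (μ i) (solve 1 (λ x → x :+ con 1ℚ :- con 1ℚ := x) refl (μ i)) (proj₁ (box i)))
    by-size Wi χWi≡1 (no μi≮1) = ≤-trans (≮⇒≥ μi≮1)
      (≤-by-diff ι (solve 2 (λ x y → x :+ y :- x := y) refl (μ i) ι) (0≤indicatorℚ (Interior? μ (χ W) i)))
    by-membership : (W i ≡ true × χ W i ≡ 1ℚ) ⊎ (W i ≡ false × χ W i ≡ 0ℚ) → χ W i ≤ μ i + ι
    by-membership (inj₁ (Wi , χWi≡1)) = subst (_≤ μ i + ι) (sym χWi≡1) (by-size Wi χWi≡1 (μ i <? 1ℚ))
    by-membership (inj₂ (_ , χWi≡0)) = subst (_≤ μ i + ι) (sym χWi≡0) (+-pres-0≤ (proj₁ (box i)) (0≤indicatorℚ (Interior? μ (χ W) i)))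

  χ<μ+interior : ∀ {N} (W : Fin N → Bool) (μ : Fin N → ℚ) → ∀ i → Interior μ (χ W) i →
    χ W i < μ i + indicatorℚ (Interior? μ (χ W) i)
  χ<μ+interior W μ i interior@(μi>0 , _) = ≤-<-trans (χ≤1 W i)
    (subst (λ z → 1ℚ < μ i + ℕtoℚ z) (sym (indicator-yes (Interior? μ (χ W) i) interior))
      (<-by-diff (μ i) (solve 1 (λ x → x :+ con 1ℚ :- con 1ℚ := x) refl (μ i)) μi>0))

  few-interior⇒zero-coordinate : ∀ {N} (W : Fin N → Bool) (m k : ℕ) (μ : Fin N → ℚ) → InBox μ (χ W) →
    sumℚ (χ W) ≡ ℕtoℚ (suc k) → sumℚ μ ≡ ℕtoℚ k - ℕtoℚ m → count (Interior? μ (χ W)) ℕ.≤ suc m →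
    Σ (Fin N) λ i → W i ≡ true × μ i ≡ 0ℚ
  few-interior⇒zero-coordinate {N} W m k μ box |W|≡1+k Σμ≡k-m few =
    by-search (FinP.any? (λ i → (W i Data.Bool.≟ true) ×-dec (μ i ≟ 0ℚ)))
    where
    ι : Fin N → ℚ
    ι i = indicatorℚ (Interior? μ (χ W) i)
    Σ[μ+ι] : sumℚ (λ i → μ i + ι i) ≡ sumℚ μ + ℕtoℚ (count (Interior? μ (χ W)))
    Σ[μ+ι] = trans (sumℚ-+ μ ι) (cong (sumℚ μ +_) (sym (ℕtoℚ-sumℕ (λ i → indicator (Interior? μ (χ W) i)))))
    |W|≡Σμ+m+1 : sumℚ μ + ℕtoℚ (suc m) ≡ sumℚ (χ W)
    |W|≡Σμ+m+1 = trans (cong₂ _+_ Σμ≡k-m (ℕtoℚ-suc m))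
      (trans (solve 2 (λ k m → k :- m :+ (m :+ con 1ℚ) := k :+ con 1ℚ) refl (ℕtoℚ k) (ℕtoℚ m))
             (trans (sym (ℕtoℚ-suc k)) (sym |W|≡1+k)))
    |W|<Σμ+m+1 : (∀ i → W i ≡ true → ¬ μ i ≡ 0ℚ) → Dec (0 ℕ.< count (Interior? μ (χ W))) → sumℚ (χ W) < sumℚ μ + ℕtoℚ (suc m)
    |W|<Σμ+m+1 nonzero (yes some) = let (a , a-interior) = count>0⇒witness (Interior? μ (χ W)) some in
      <-≤-trans (subst (sumℚ (χ W) <_) Σ[μ+ι] (sumℚ-mono-< (χ≤μ+interior W μ box nonzero) a (χ<μ+interior W μ a a-interior)))
                (+-monoʳ-≤ (sumℚ μ) (ℕtoℚ-mono-≤ few))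
    |W|<Σμ+m+1 nonzero (no no-interior) = ≤-<-trans (subst (sumℚ (χ W) ≤_) Σ[μ+ι] (sumℚ-mono-≤ (χ≤μ+interior W μ box nonzero)))
      (+-monoʳ-< (sumℚ μ) (subst (λ z → ℕtoℚ z < ℕtoℚ (suc m)) (sym (ℕP.n≤0⇒n≡0 (ℕP.≮⇒≥ no-interior)))
                              (ℕtoℚ-mono-< {0} {suc m} (ℕ.s≤s ℕ.z≤n))))
    by-search : Dec (∃ λ i → W i ≡ true × μ i ≡ 0ℚ) → Σ (Fin N) λ i → W i ≡ true × μ i ≡ 0ℚ
    by-search (yes zero-coordinate) = zero-coordinate
    by-search (no none) = ⊥-elim (<-irrefl (sym |W|≡Σμ+m+1)
      (|W|<Σμ+m+1 (λ i Wi μi≡0 → none (i , Wi , μi≡0)) (0 ℕ.<? count (Interior? μ (χ W)))))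

  size-remove : ∀ {N} (W : Fin N → Bool) (k : ℕ) (i₀ : Fin N) → W i₀ ≡ true →
    sumℚ (χ W) ≡ ℕtoℚ (suc k) → sumℚ (χ (remove W i₀)) ≡ ℕtoℚ k
  size-remove W k i₀ Wi₀ |W|≡1+k = +-cancelʳ (sumℚ (χ (remove W i₀))) (ℕtoℚ k) 1ℚ
    (trans (cong (sumℚ (χ (remove W i₀)) +_) (sym Σδ≡1))
    (trans (sym (sumℚ-+ (χ (remove W i₀)) (δ i₀)))
    (trans (sym (sumℚ-cong (χ-remove W i₀ Wi₀))) (trans |W|≡1+k (ℕtoℚ-suc k)))))
    where
    Σδ≡1 : sumℚ (δ i₀) ≡ 1ℚ
    Σδ≡1 = trans (sumℚ-cong (λ j → sym (*-identityʳ (δ i₀ j)))) (sumℚ-δ i₀ (λ _ → 1ℚ))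

  -- Grinberg–Sevastyanov: the vectors are ordered from the back.  For each k > m the set W of the first k
  -- carries a point μ ∈ [0,1]^W with Σ μᵢ vᵢ = 0 and Σ μᵢ = k − m, so Σ_{i∈W} vᵢ = Σ (1 − μᵢ) vᵢ has norm at
  -- most m D.  Rescaling μ and passing to a vertex of the polytope leaves at most m + 1 fractional
  -- coordinates, hence a zero coordinate: that vector is put last and the recursion continues with k − 1.
  module Steinitz (m : ℕ) (D : ℚ) (D≥0 : 0ℚ ≤ D) {N : ℕ} (v : Fin N → Fin m → ℚ)
     (v-bounded : ∀ i c → ∣ v i c ∣ ≤ D) (Σv≡0 : ∀ c → sumℚ (λ i → v i c) ≡ 0ℚ) where

    R : ℚ
    R = ℕtoℚ m * D

    PrefixSumsBounded : List (Fin N) → Set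
    PrefixSumsBounded L = ∀ ℓ c → ∣ sumL (take ℓ L) (λ i → v i c) ∣ ≤ R

    Ordering : (Fin N → Bool) → Set
    Ordering W = Σ (List (Fin N)) λ L → (∀ g → sumL L g ≡ sumℚ (λ i → χ W i * g i)) × PrefixSumsBounded L

    Balanced : (Fin N → ℚ) → Set
    Balanced μ = ∀ c → sumℚ (λ i → μ i * v i c) ≡ 0ℚ

    Relaxation : (Fin N → Bool) → ℕ → (Fin N → ℚ) → Set
    Relaxation W k μ = InBox μ (χ W) × Balanced μ × sumℚ μ ≡ ℕtoℚ k - ℕtoℚ m

    short-sum-bounded : ∀ (P : List (Fin N)) → length P ℕ.≤ m → ∀ c → ∣ sumL P (λ i → v i c) ∣ ≤ R
    short-sum-bounded P |P|≤m c = ≤-trans (sumL-abs P (λ i → v i c)) (≤-trans (sumL-mono P (λ i → v-bounded i c))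
       (≤-trans (≤-reflexive (sumL-const P D)) (*-monoʳ-≤-nonNeg D {{ℚ.nonNegative D≥0}} (ℕtoℚ-mono-≤ |P|≤m))))

    relaxation-bounds-sum : ∀ W k μ → Relaxation W k μ → sumℚ (χ W) ≡ ℕtoℚ k → ∀ c →
      ∣ sumℚ (λ i → χ W i * v i c) ∣ ≤ R
    relaxation-bounds-sum W k μ (box , balanced , Σμ≡k-m) |W|≡k c = subst (_≤ R) (cong ∣_∣ (sym complement))
         (≤-trans (∣weighted-sum∣≤ (λ i → χ W i - μ i) (λ i → v i c) D (λ i → p≤q⇒0≤q-p (proj₂ (box i))) (λ i → v-bounded i c))
                  (≤-reflexive (cong (_* D) Σ[χ-μ]≡m)))
      where
      complement : sumℚ (λ i → χ W i * v i c) ≡ sumℚ (λ i → (χ W i - μ i) * v i c)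
      complement = sym (trans (sumℚ-cong (λ i → solve 3 (λ w u x → (w :- u) :* x := w :* x :- u :* x) refl (χ W i) (μ i) (v i c)))
               (trans (sumℚ-- (λ i → χ W i * v i c) (λ i → μ i * v i c))
               (trans (cong (λ z → sumℚ (λ i → χ W i * v i c) - z) (balanced c)) (+-identityʳ _))))
      Σ[χ-μ]≡m : sumℚ (λ i → χ W i - μ i) ≡ ℕtoℚ m
      Σ[χ-μ]≡m = trans (sumℚ-- (χ W) μ) (trans (cong₂ _-_ |W|≡k Σμ≡k-m) (solve 2 (λ k m → k :- (k :- m) := m) refl (ℕtoℚ k) (ℕtoℚ m)))

    order-small : ∀ k W → sumℚ (χ W) ≡ ℕtoℚ k → k ℕ.≤ m → Ordering W
    order-small k W |W|≡k k≤m = elements W , sumL-elements W ,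
      λ ℓ → short-sum-bounded (take ℓ (elements W)) (ℕP.≤-trans (length-take≤ ℓ (elements W)) (ℕP.≤-trans |elements|≤k k≤m))
      where
      |elements|≤k : length (elements W) ℕ.≤ k
      |elements|≤k = ℕtoℚ-cancel-≤ (≤-reflexive (trans (sym (*-identityʳ _)) (trans (sym (sumL-const (elements W) 1ℚ))
              (trans (sumL-elements W (λ _ → 1ℚ)) (trans (sumℚ-cong (λ i → *-identityʳ (χ W i))) |W|≡k)))))

    augmented : Fin N → Fin (suc m) → ℚ
    augmented i zero = 1ℚ
    augmented i (suc c) = v i c

    drop-coordinate : ∀ k W → sumℚ (χ W) ≡ ℕtoℚ (suc k) → m ℕ.< suc k → Σ (Fin N → ℚ) (Relaxation W (suc k)) →
      Σ (Fin N) λ i₀ → W i₀ ≡ true × Σ (Fin N → ℚ) (Relaxation (remove W i₀) k)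
    drop-coordinate k W |W|≡1+k m<1+k (μ , box , balanced , Σμ≡1+k-m) =
      remove-zero (few-interior⇒zero-coordinate W m k μ' box' |W|≡1+k Σμ'≡k-m (proj₂ (proj₂ (proj₂ vertex))))
      where
      c : ℚ
      c = (ℕtoℚ k - ℕtoℚ m) * recip (ℕtoℚ (suc k) - ℕtoℚ m)
      μ₀ : Fin N → ℚ
      μ₀ i = c * μ i
      scaled : InBox μ₀ (χ W) × sumℚ μ₀ ≡ ℕtoℚ k - ℕtoℚ m
      scaled = rescale-in-box (χ W) μ box Σμ≡1+k-m
                 (p<q⇒0<q-p (ℕtoℚ-mono-< m<1+k))
                 (p≤q⇒0≤q-p (ℕtoℚ-mono-≤ (ℕP.≤-pred m<1+k)))
                 (+-monoˡ-≤ (- ℕtoℚ m) (ℕtoℚ-mono-≤ (ℕP.n≤1+n k)))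
      vertex : Reduced (suc m) augmented (χ W) μ₀
      vertex = reduce (suc m) augmented (χ W) N μ₀ (proj₁ scaled) (count≤size (Interior? μ₀ (χ W)))
      μ' : Fin N → ℚ
      μ' = proj₁ vertex
      box' : InBox μ' (χ W)
      box' = proj₁ (proj₂ vertex)
      same : ∀ c → sumℚ (λ i → μ' i * augmented i c) ≡ sumℚ (λ i → μ₀ i * augmented i c)
      same = proj₁ (proj₂ (proj₂ vertex))
      Σμ'≡k-m : sumℚ μ' ≡ ℕtoℚ k - ℕtoℚ m
      Σμ'≡k-m = trans (sym (sumℚ-cong (λ i → *-identityʳ (μ' i))))
                  (trans (same zero) (trans (sumℚ-cong (λ i → *-identityʳ (μ₀ i))) (proj₂ scaled)))
      balanced' : Balanced μ'
      balanced' c' = trans (same (suc c')) (trans (sumℚ-cong (λ i → *-assoc c (μ i) (v i c')))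
                       (trans (sumℚ-*ˡ c (λ i → μ i * v i c')) (trans (cong (c *_) (balanced c')) (*-zeroʳ c))))
      remove-zero : Σ (Fin N) (λ i → W i ≡ true × μ' i ≡ 0ℚ) →
        Σ (Fin N) λ i₀ → W i₀ ≡ true × Σ (Fin N → ℚ) (Relaxation (remove W i₀) k)
      remove-zero (i₀ , Wi₀ , μ'i₀≡0) = i₀ , Wi₀ , μ' , box-removed , balanced' , Σμ'≡k-m
        where
        box-removed : InBox μ' (χ (remove W i₀))
        box-removed j = proj₁ (box' j) , upper (i₀ FinP.≟ j)
          where
          upper : Dec (i₀ ≡ j) → μ' j ≤ χ (remove W i₀) j
          upper (yes refl) = subst₂ _≤_ (sym μ'i₀≡0) (sym (χ-remove-≡ W i₀)) ≤-refl
          upper (no i₀≢j) = subst (μ' j ≤_) (sym (χ-remove-≢ W i₀ j i₀≢j)) (proj₂ (box' j))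

    extend-ordering : ∀ k W i₀ → W i₀ ≡ true → sumℚ (χ W) ≡ ℕtoℚ (suc k) → Σ (Fin N → ℚ) (Relaxation W (suc k)) →
      Ordering (remove W i₀) → Ordering W
    extend-ordering k W i₀ Wi₀ |W|≡1+k (μ , relaxation) (L , sums , bounded) = L ++ i₀ ∷ [] , sums' , bounded'
      where
      sums' : ∀ g → sumL (L ++ i₀ ∷ []) g ≡ sumℚ (λ i → χ W i * g i)
      sums' g = trans (sumL-++ L (i₀ ∷ []) g) (trans (cong₂ _+_ (sums g) (+-identityʳ (g i₀)))
                  (sym (trans (sumℚ-cong (λ j → trans (cong (_* g j) (χ-remove W i₀ Wi₀ j)) (*-distribʳ-+ (g j) (χ (remove W i₀) j) (δ i₀ j))))
                       (trans (sumℚ-+ (λ j → χ (remove W i₀) j * g j) (λ j → δ i₀ j * g j))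
                              (cong (sumℚ (λ j → χ (remove W i₀) j * g j) +_) (sumℚ-δ i₀ g))))))
      bounded' : PrefixSumsBounded (L ++ i₀ ∷ [])
      bounded' ℓ c = by-prefix (take-snoc ℓ L i₀)
        where
        by-prefix : take ℓ (L ++ i₀ ∷ []) ≡ take ℓ L ⊎ take ℓ (L ++ i₀ ∷ []) ≡ L ++ i₀ ∷ [] →
          ∣ sumL (take ℓ (L ++ i₀ ∷ [])) (λ i → v i c) ∣ ≤ R
        by-prefix (inj₁ e) = subst (λ P → ∣ sumL P (λ i → v i c) ∣ ≤ R) (sym e) (bounded ℓ c)
        by-prefix (inj₂ e) = subst (λ P → ∣ sumL P (λ i → v i c) ∣ ≤ R) (sym e)
          (subst (λ q → ∣ q ∣ ≤ R) (sym (sums' (λ i → v i c))) (relaxation-bounds-sum W (suc k) μ relaxation |W|≡1+k c))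

    order : ∀ k W → sumℚ (χ W) ≡ ℕtoℚ k → (m ℕ.< k → Σ (Fin N → ℚ) (Relaxation W k)) → Ordering W
    order k W |W|≡k relax = by-size k W |W|≡k relax (m ℕ.<? k)
      where
      by-size : ∀ k W → sumℚ (χ W) ≡ ℕtoℚ k → (m ℕ.< k → Σ (Fin N → ℚ) (Relaxation W k)) → Dec (m ℕ.< k) → Ordering W
      by-size k W |W|≡k relax (no m≮k) = order-small k W |W|≡k (ℕP.≮⇒≥ m≮k)
      by-size zero W |W|≡0 relax (yes ())
      by-size (suc k) W |W|≡1+k relax (yes m<1+k) =
        let (i₀ , Wi₀ , smaller) = drop-coordinate k W |W|≡1+k m<1+k (relax m<1+k) in
        extend-ordering k W i₀ Wi₀ |W|≡1+k (relax m<1+k)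
          (order k (remove W i₀) (size-remove W k i₀ Wi₀ |W|≡1+k) (λ _ → smaller))

    steinitz : Σ (List (Fin N)) λ L → (∀ g → sumL L g ≡ sumℚ g) × PrefixSumsBounded L
    steinitz = finish (order N everything |everything|≡N initial)
      where
      everything : Fin N → Bool
      everything _ = true
      |everything|≡N : sumℚ (χ everything) ≡ ℕtoℚ N
      |everything|≡N = trans (sumℚ-const {N} 1ℚ) (*-identityʳ _)
      initial : m ℕ.< N → Σ (Fin N → ℚ) (Relaxation everything N)
      initial m<N = (λ i → c * χ everything i) , proj₁ scaled , balanced , proj₂ scaled
        where
        c : ℚ
        c = (ℕtoℚ N - ℕtoℚ m) * recip (ℕtoℚ N)
        scaled : InBox (λ i → c * χ everything i) (χ everything) × sumℚ (λ i → c * χ everything i) ≡ ℕtoℚ N - ℕtoℚ m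
        scaled = rescale-in-box (χ everything) (χ everything) (λ _ → 0≤1 , ≤-refl) |everything|≡N
                   (ℕtoℚ-mono-< (ℕP.≤-trans (ℕ.s≤s ℕ.z≤n) m<N))
                   (p≤q⇒0≤q-p (ℕtoℚ-mono-≤ (ℕP.<⇒≤ m<N)))
                   (≤-by-diff (ℕtoℚ m) (solve 2 (λ n m → n :- (n :- m) := m) refl (ℕtoℚ N) (ℕtoℚ m)) (0≤ℕtoℚ m))
        balanced : Balanced (λ i → c * χ everything i)
        balanced c' = trans (sumℚ-cong (λ i → cong (_* v i c') (*-identityʳ c)))
                        (trans (sumℚ-*ˡ c (λ i → v i c')) (trans (cong (c *_) (Σv≡0 c')) (*-zeroʳ c)))
      finish : Ordering everything → Σ (List (Fin N)) λ L → (∀ g → sumL L g ≡ sumℚ g) × PrefixSumsBounded L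
      finish (L , sums , bounded) = L , (λ g → trans (sums g) (sumℚ-cong (λ i → *-identityˡ (g i)))) , bounded

  -- Zero-sum blocks of integral vectors

  equal-pair-in-window : ∀ {m} (w : ℕ) (P : Fin (suc (suc w ℕ.^ m)) → Fin m → ℤ) (lo : Fin m → ℤ) →
    (∀ ℓ c → ℤ.+ 0 ℤ.≤ P ℓ c ℤ.- lo c × P ℓ c ℤ.- lo c ℤ.≤ ℤ.+ w) →
    ∃ λ i → ∃ λ j → i F.< j × (∀ c → P i c ≡ P j c)
  equal-pair-in-window {m} w P lo window = pair (FinP.pigeonhole (ℕP.n<1+n (suc w ℕ.^ m)) (λ ℓ → funToFin (digit ℓ)))
    where
    offset-eq : ∀ ℓ c → ℤ.+ ℤ.∣ P ℓ c ℤ.- lo c ∣ ≡ P ℓ c ℤ.- lo c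
    offset-eq ℓ c = ℤP.0≤i⇒+∣i∣≡i (proj₁ (window ℓ c))
    offset<1+w : ∀ ℓ c → ℤ.∣ P ℓ c ℤ.- lo c ∣ ℕ.< suc w
    offset<1+w ℓ c = ℕ.s≤s (ℤP.drop‿+≤+ (subst (ℤ._≤ ℤ.+ w) (sym (offset-eq ℓ c)) (proj₂ (window ℓ c))))
    digit : Fin (suc (suc w ℕ.^ m)) → Fin m → Fin (suc w)
    digit ℓ c = fromℕ< (offset<1+w ℓ c)
    pair : (∃ λ i → ∃ λ j → i F.< j × funToFin (digit i) ≡ funToFin (digit j)) →
      ∃ λ i → ∃ λ j → i F.< j × (∀ c → P i c ≡ P j c)
    pair (i , j , i<j , same-code) = i , j , i<j , λ c → i-k≡j-k⇒i≡j (lo c) (same-offset c)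
      where
      same-digit : ∀ c → digit i c ≡ digit j c
      same-digit c = trans (sym (FinP.finToFun-funToFin (digit i) c))
                       (trans (cong (λ code → finToFun code c) same-code) (FinP.finToFun-funToFin (digit j) c))
      same-offset : ∀ c → P i c ℤ.- lo c ≡ P j c ℤ.- lo c
      same-offset c = trans (sym (offset-eq i c)) (trans (cong ℤ.+_ (trans (sym (FinP.toℕ-fromℕ< (offset<1+w i c)))
                        (trans (cong toℕ (same-digit c)) (FinP.toℕ-fromℕ< (offset<1+w j c))))) (offset-eq j c))

  b2n : Bool → ℕ
  b2n true = 1
  b2n false = 0

  K*[1+f]<1+a+l⇒K*f<l : ∀ K a f l → suc a ℕ.≤ K → K ℕ.* suc f ℕ.< suc a ℕ.+ l → K ℕ.* f ℕ.< l
  K*[1+f]<1+a+l⇒K*f<l K a f l 1+a≤K bound = ℕP.+-cancelˡ-< K (K ℕ.* f) l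
    (ℕP.<-≤-trans (subst (ℕ._< suc a ℕ.+ l) (ℕP.*-suc K f) bound) (ℕP.+-monoˡ-≤ l 1+a≤K))

  b^k*k<l⇒b^k≤l : ∀ b k l → (b ℕ.^ k) ℕ.* k ℕ.< l → b ℕ.^ k ℕ.≤ l
  b^k*k<l⇒b^k≤l b zero l bound = bound
  b^k*k<l⇒b^k≤l b (suc k) l bound = ℕP.≤-trans (ℕP.m≤m*n (b ℕ.^ suc k) (suc k)) (ℕP.<⇒≤ bound)

  -- Tags index a list of vectors in ℚᵐ; the non-fractional ones, called units, are integral.
  -- A run of K = (2R + 1)ᵐ consecutive units whose partial sums stay within R of a fixed point has two
  -- equal integral partial sums (pigeonhole), i.e. a nonempty zero-sum block.  With at most m fractional
  -- entries and more than K m entries in total, some cyclic run of units is that long.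
  module ZeroSumBlock (m : ℕ) {Tag : Set} (vec : Tag → Fin m → ℚ) (fractional : Tag → Bool)
    (ivec : Tag → Fin m → ℤ) (ivec-ok : ∀ t → fractional t ≡ false → ∀ c → vec t c ≡ ℤtoℚ (ivec t c)) (Rn : ℕ) where

    IsUnit : Tag → Set
    IsUnit t = fractional t ≡ false

    K : ℕ
    K = suc (2 ℕ.* Rn) ℕ.^ m

    R : ℚ
    R = ℕtoℚ Rn

    vecΣ : List Tag → Fin m → ℚ
    vecΣ X c = sumL X (λ t → vec t c)

    Block : List Tag → Set
    Block Q = Σ (List Tag) λ X → Σ (List Tag) λ B → Σ (List Tag) λ Y →
       Q ≡ X ++ B ++ Y × ¬ B ≡ [] × All IsUnit B × (∀ c → vecΣ B c ≡ 0ℚ)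

    PrefixesNear : (s cv : Fin m → ℚ) → List Tag → Set
    PrefixesNear s cv Q = ∀ ℓ c → ∣ s c + vecΣ (take ℓ Q) c - cv c ∣ ≤ R

    vecΣ-integral : ∀ (X : List Tag) → All IsUnit X → ∀ c → vecΣ X c ≡ ℤtoℚ (sumLℤ X (λ t → ivec t c))
    vecΣ-integral [] [] c = refl
    vecΣ-integral (x ∷ X) (ux ∷ uX) c = trans (cong₂ _+_ (ivec-ok x ux c) (vecΣ-integral X uX c)) (sym (ℤtoℚ-homo-+ (ivec x c) _))

    equal-prefix-sums⇒block : ∀ (U : List Tag) → All IsUnit U → ∀ i j → i ℕ.< j → j ℕ.≤ length U →
      (∀ c → vecΣ (take i U) c ≡ vecΣ (take j U) c) → Block U
    equal-prefix-sums⇒block U units i j i<j j≤|U| same =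
      X , B , Y , split , B≢[] , AllP.++⁻ˡ B (AllP.++⁻ʳ X (subst (All IsUnit) split units)) , B-sum
      where
      X : List Tag
      X = take i U
      B : List Tag
      B = drop i (take j U)
      Y : List Tag
      Y = drop j U
      prefix-j : take j U ≡ X ++ B
      prefix-j = take-le i j U (ℕP.<⇒≤ i<j)
      split : U ≡ X ++ B ++ Y
      split = trans (sym (LP.take++drop≡id j U)) (trans (cong (_++ Y) prefix-j) (LP.++-assoc X B Y))
      B≢[] : ¬ B ≡ []
      B≢[] B≡[] = ℕP.<-irrefl (sym j≡i) i<j
        where
        j≡i : j ≡ i
        j≡i = trans (sym (length-take-le j U j≤|U|))
                (trans (cong length (trans prefix-j (trans (cong (X ++_) B≡[]) (LP.++-identityʳ X))))
                       (length-take-le i U (ℕP.≤-trans (ℕP.<⇒≤ i<j) j≤|U|)))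
      B-sum : ∀ c → vecΣ B c ≡ 0ℚ
      B-sum c = trans (solve 2 (λ a b → b := a :+ b :- a) refl (vecΣ X c) (vecΣ B c))
        (trans (cong (_- vecΣ X c) (trans (sym (sumL-++ X B (λ t → vec t c)))
                                          (trans (cong (λ P → vecΣ P c) (sym prefix-j)) (sym (same c)))))
               (+-inverseʳ (vecΣ X c)))

    long-unit-run⇒block : (U : List Tag) → All IsUnit U → K ℕ.≤ length U → (s cv : Fin m → ℚ) →
      PrefixesNear s cv U → Block U
    long-unit-run⇒block U units K≤|U| s cv near =
      pair (equal-pair-in-window (2 ℕ.* Rn) P lo window)
      where
      P : Fin (suc K) → Fin m → ℤ
      P ℓ c = sumLℤ (take (toℕ ℓ) U) (λ t → ivec t c)
      Pℚ : ∀ ℓ c → vecΣ (take (toℕ ℓ) U) c ≡ ℤtoℚ (P ℓ c)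
      Pℚ ℓ c = vecΣ-integral (take (toℕ ℓ) U) (AllP.take⁺ (toℕ ℓ) units) c
      near-P : ∀ ℓ c → ∣ s c + ℤtoℚ (P ℓ c) - cv c ∣ ≤ R
      near-P ℓ c = subst (λ z → ∣ s c + z - cv c ∣ ≤ R) (Pℚ ℓ c) (near (toℕ ℓ) c)
      lowest : ∀ c → Σ (Fin (suc K)) λ a → ⊤ × (∀ j → ⊤ → ℤtoℚ (P a c) ≤ ℤtoℚ (P j c))
      lowest c = argmin (λ _ → yes tt) (λ ℓ → ℤtoℚ (P ℓ c)) (zero , tt)
      lo : Fin m → ℤ
      lo c = P (proj₁ (lowest c)) c
      difference : ∀ ℓ c → ℤtoℚ (P ℓ c ℤ.- lo c) ≡ ℤtoℚ (P ℓ c) - ℤtoℚ (lo c)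
      difference ℓ c = trans (ℤtoℚ-homo-+ (P ℓ c) (ℤ.- lo c)) (cong (ℤtoℚ (P ℓ c) +_) (ℤtoℚ-homo-neg (lo c)))
      window : ∀ ℓ c → ℤ.+ 0 ℤ.≤ P ℓ c ℤ.- lo c × P ℓ c ℤ.- lo c ℤ.≤ ℤ.+ (2 ℕ.* Rn)
      window ℓ c =
        ℤtoℚ-cancel-≤ (subst (0ℚ ≤_) (sym (difference ℓ c)) (p≤q⇒0≤q-p (proj₂ (proj₂ (lowest c)) ℓ tt))) ,
        ℤtoℚ-cancel-≤ (subst₂ _≤_ (sym (difference ℓ c)) (sym 2R)
          (≤-trans (≤-reflexive (solve 4 (λ s p q w → p :- q := (s :+ p :- w) :+ (:- (s :+ q :- w))) refl
                                   (s c) (ℤtoℚ (P ℓ c)) (ℤtoℚ (lo c)) (cv c)))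
                   (+-mono-≤ (proj₁ (∣p∣≤r⇒±p≤r (near-P ℓ c))) (proj₂ (∣p∣≤r⇒±p≤r (near-P (proj₁ (lowest c)) c))))))
        where
        2R : ℤtoℚ (ℤ.+ (2 ℕ.* Rn)) ≡ R + R
        2R = trans (ℕtoℚ-homo-* 2 Rn) (solve 1 (λ r → con (ℕtoℚ 2) :* r := r :+ r) refl R)
      pair : (∃ λ i → ∃ λ j → i F.< j × (∀ c → P i c ≡ P j c)) → Block U
      pair (i , j , i<j , same) = equal-prefix-sums⇒block U units (toℕ i) (toℕ j) i<j
        (ℕP.≤-trans (ℕP.≤-pred (FinP.toℕ<n j)) K≤|U|)
        (λ c → trans (Pℚ i c) (trans (cong ℤtoℚ (same c)) (sym (Pℚ j c))))

    EndsFractional : List Tag → Set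
    EndsFractional [] = ⊤
    EndsFractional (x ∷ []) = fractional x ≡ true
    EndsFractional (x ∷ y ∷ r) = EndsFractional (y ∷ r)

    EndsFractional-++ : ∀ xs ys → EndsFractional (xs ++ ys) → EndsFractional ys
    EndsFractional-++ [] ys ends = ends
    EndsFractional-++ (x ∷ []) [] ends = tt
    EndsFractional-++ (x ∷ []) (y ∷ ys) ends = ends
    EndsFractional-++ (x ∷ x' ∷ xs) ys ends = EndsFractional-++ (x' ∷ xs) ys ends

    EndsFractional-tail : ∀ q xs → EndsFractional (q ∷ xs) → EndsFractional xs
    EndsFractional-tail q [] ends = tt
    EndsFractional-tail q (x ∷ xs) ends = ends

    EndsFractional-snoc : ∀ zs q → fractional q ≡ true → EndsFractional (zs ++ q ∷ [])
    EndsFractional-snoc [] q fq = fq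
    EndsFractional-snoc (z ∷ []) q fq = fq
    EndsFractional-snoc (z ∷ z' ∷ zs) q fq = EndsFractional-snoc (z' ∷ zs) q fq

    units-ending-fractional : ∀ xs → All IsUnit xs → EndsFractional xs → xs ≡ []
    units-ending-fractional [] _ _ = refl
    units-ending-fractional (x ∷ []) (ux ∷ _) fx with trans (sym ux) fx
    ... | ()
    units-ending-fractional (x ∷ y ∷ r) (_ ∷ units) ends with units-ending-fractional (y ∷ r) units ends
    ... | ()

    #fractional : List Tag → ℕ
    #fractional [] = 0
    #fractional (x ∷ xs) = b2n (fractional x) ℕ.+ #fractional xs

    #fractional-++ : ∀ xs ys → #fractional (xs ++ ys) ≡ #fractional xs ℕ.+ #fractional ys
    #fractional-++ [] ys = refl
    #fractional-++ (x ∷ xs) ys = trans (cong (_ ℕ.+_) (#fractional-++ xs ys)) (sym (ℕP.+-assoc _ (#fractional xs) (#fractional ys)))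

    #fractional-units : ∀ xs → All IsUnit xs → #fractional xs ≡ 0
    #fractional-units [] _ = refl
    #fractional-units (x ∷ xs) (ux ∷ units) rewrite ux = #fractional-units xs units

    #fractional-∷ : ∀ q xs → fractional q ≡ true → #fractional (q ∷ xs) ≡ suc (#fractional xs)
    #fractional-∷ q xs fq rewrite fq = refl

    UnitPrefix : List Tag → Set
    UnitPrefix Q = Σ (List Tag) λ U → Σ (List Tag) λ rest → Q ≡ U ++ rest × All IsUnit U ×
       (rest ≡ [] ⊎ Σ Tag λ q → Σ (List Tag) λ Q' → rest ≡ q ∷ Q' × fractional q ≡ true)

    unit-prefix : (Q : List Tag) → UnitPrefix Q
    unit-prefix [] = [] , [] , refl , [] , inj₁ refl
    unit-prefix (x ∷ Q) = by-head (fractional x) refl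
      where
      by-head : ∀ f → fractional x ≡ f → UnitPrefix (x ∷ Q)
      by-head true fx = [] , x ∷ Q , refl , [] , inj₂ (x , Q , refl , fx)
      by-head false ux = let (U , rest , eq , units , r) = unit-prefix Q in x ∷ U , rest , cong (x ∷_) eq , ux ∷ units , r

    PrefixesNear-++ˡ : ∀ {s cv} U rest → PrefixesNear s cv (U ++ rest) → PrefixesNear s cv U
    PrefixesNear-++ˡ {s} {cv} U rest near ℓ c = let (ℓ' , e) = take-pre ℓ U rest in
      subst (λ P → ∣ s c + vecΣ P c - cv c ∣ ≤ R) (sym e) (near ℓ' c)

    PrefixesNear-++ʳ : ∀ {s cv} W Q' → PrefixesNear s cv (W ++ Q') → PrefixesNear (λ c → s c + vecΣ W c) cv Q'
    PrefixesNear-++ʳ {s} {cv} W Q' near ℓ c = subst (λ z → ∣ z - cv c ∣ ≤ R) shifted (near (length W ℕ.+ ℓ) c)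
      where
      shifted : s c + vecΣ (take (length W ℕ.+ ℓ) (W ++ Q')) c ≡ s c + vecΣ W c + vecΣ (take ℓ Q') c
      shifted = trans (cong (λ P → s c + vecΣ P c) (take-len-++ W Q' ℓ))
                  (trans (cong (s c +_) (sumL-++ W (take ℓ Q') (λ t → vec t c))) (sym (+-assoc (s c) _ _)))

    Block-++ʳ : ∀ U rest → Block U → Block (U ++ rest)
    Block-++ʳ U rest (X , B , Y , U≡XBY , B≢[] , unitsB , sumB) = X , B , Y ++ rest ,
      trans (cong (_++ rest) U≡XBY) (trans (LP.++-assoc X (B ++ Y) rest) (cong (X ++_) (LP.++-assoc B Y rest))) ,
      B≢[] , unitsB , sumB

    Block-++ˡ : ∀ W Q' → Block Q' → Block (W ++ Q')
    Block-++ˡ W Q' (X , B , Y , Q'≡XBY , B≢[] , unitsB , sumB) =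
      W ++ X , B , Y , trans (cong (W ++_) Q'≡XBY) (sym (LP.++-assoc W X (B ++ Y))) , B≢[] , unitsB , sumB

    #fractional-run : ∀ U q Q' → All IsUnit U → fractional q ≡ true → #fractional (U ++ q ∷ Q') ≡ suc (#fractional Q')
    #fractional-run U q Q' units fq = trans (#fractional-++ U (q ∷ Q'))
      (trans (cong (ℕ._+ #fractional (q ∷ Q')) (#fractional-units U units)) (#fractional-∷ q Q' fq))

    block-in-runs : ∀ fuel (Q : List Tag) (s cv : Fin m → ℚ) → PrefixesNear s cv Q → EndsFractional Q →
      K ℕ.* #fractional Q ℕ.< length Q → length Q ℕ.≤ fuel → Block Q
    block-in-runs zero Q s cv near ends long |Q|≤0 = ⊥-elim (ℕP.<-irrefl refl (ℕP.<-≤-trans (ℕP.≤-<-trans ℕ.z≤n long) |Q|≤0))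
    block-in-runs (suc fuel) Q s cv near ends long |Q|≤1+fuel = by-first-run (unit-prefix Q)
      where
      by-first-run : UnitPrefix Q → Block Q
      by-first-run (U , rest , Q≡U++rest , units , inj₁ refl) = ⊥-elim (ℕP.<-irrefl (sym (cong length Q≡[])) (ℕP.≤-<-trans ℕ.z≤n long))
        where
        Q≡[] : Q ≡ []
        Q≡[] = units-ending-fractional Q (subst (All IsUnit) (sym (trans Q≡U++rest (LP.++-identityʳ U))) units) ends
      by-first-run (U , rest , Q≡U++rest , units , inj₂ (q , Q' , refl , fq)) = by-length (K ℕ.≤? length U)
        where
        by-length : Dec (K ℕ.≤ length U) → Block Q
        by-length (yes K≤|U|) = subst Block (sym Q≡U++rest) (Block-++ʳ U rest
          (long-unit-run⇒block U units K≤|U| s cv (PrefixesNear-++ˡ {s} {cv} U rest (subst (PrefixesNear s cv) Q≡U++rest near))))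
        by-length (no K≰|U|) = subst Block (sym Q≡W++Q') (Block-++ˡ W Q'
          (block-in-runs fuel Q' (λ c → s c + vecΣ W c) cv (PrefixesNear-++ʳ {s} {cv} W Q' (subst (PrefixesNear s cv) Q≡W++Q' near))
                         ends' long' (ℕP.≤-pred |Q'|<1+fuel)))
          where
          W : List Tag
          W = U ++ q ∷ []
          Q≡W++Q' : Q ≡ W ++ Q'
          Q≡W++Q' = trans Q≡U++rest (sym (LP.++-assoc U (q ∷ []) Q'))
          |Q|≡1+|U|+|Q'| : length Q ≡ suc (length U) ℕ.+ length Q'
          |Q|≡1+|U|+|Q'| = trans (cong length Q≡U++rest) (trans (LP.length-++ U {q ∷ Q'}) (ℕP.+-suc (length U) (length Q')))
          |Q'|<1+fuel : suc (length Q') ℕ.≤ suc fuel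
          |Q'|<1+fuel = ℕP.≤-trans (ℕP.m≤n+m (suc (length Q')) (length U))
                          (ℕP.≤-trans (ℕP.≤-reflexive (trans (ℕP.+-suc (length U) (length Q')) (sym |Q|≡1+|U|+|Q'|))) |Q|≤1+fuel)
          ends' : EndsFractional Q'
          ends' = EndsFractional-tail q Q' (EndsFractional-++ U (q ∷ Q') (subst EndsFractional Q≡U++rest ends))
          long' : K ℕ.* #fractional Q' ℕ.< length Q'
          long' = K*[1+f]<1+a+l⇒K*f<l K (length U) (#fractional Q') (length Q') (ℕP.≰⇒> K≰|U|)
                    (subst₂ ℕ._<_ (cong (K ℕ.*_) (trans (cong #fractional Q≡U++rest) (#fractional-run U q Q' units fq)))
                            |Q|≡1+|U|+|Q'| long)

    LastFractional : List Tag → Set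
    LastFractional L = Σ (List Tag) λ X → Σ Tag λ q → Σ (List Tag) λ Y → L ≡ X ++ q ∷ Y × fractional q ≡ true × All IsUnit Y

    last-fractional : (L : List Tag) → All IsUnit L ⊎ LastFractional L
    last-fractional [] = inj₁ []
    last-fractional (x ∷ L) = extend (last-fractional L)
      where
      by-head : ∀ f → fractional x ≡ f → All IsUnit L → All IsUnit (x ∷ L) ⊎ LastFractional (x ∷ L)
      by-head true fx units = inj₂ ([] , x , L , refl , fx , units)
      by-head false ux units = inj₁ (ux ∷ units)
      extend : All IsUnit L ⊎ LastFractional L → All IsUnit (x ∷ L) ⊎ LastFractional (x ∷ L)
      extend (inj₁ units) = by-head (fractional x) refl units
      extend (inj₂ (X , q , Y , e , fq , units)) = inj₂ (x ∷ X , q , Y , cong (x ∷_) e , fq , units)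

    rotated-prefixes-near : ∀ X' Y → (∀ c → vecΣ (X' ++ Y) c ≡ 0ℚ) → (∀ ℓ c → ∣ vecΣ (take ℓ (X' ++ Y)) c ∣ ≤ R) →
      PrefixesNear (λ _ → 0ℚ) (λ c → - vecΣ X' c) (Y ++ X')
    rotated-prefixes-near X' Y Σ≡0 bounded ℓ c = subst (λ z → ∣ z ∣ ≤ R)
      (solve 2 (λ a b → a :+ b := con 0ℚ :+ a :- (:- b)) refl (vecΣ (take ℓ (Y ++ X')) c) (vecΣ X' c))
      (by-prefix (take-++-cases ℓ Y X'))
      where
      YX'≡0 : vecΣ Y c + vecΣ X' c ≡ 0ℚ
      YX'≡0 = trans (sym (sumL-++ Y X' (λ t → vec t c))) (trans (sumL-comm Y X' (λ t → vec t c)) (Σ≡0 c))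
      by-prefix : take ℓ (Y ++ X') ≡ take ℓ Y ⊎ Σ ℕ (λ ℓ' → take ℓ (Y ++ X') ≡ Y ++ take ℓ' X') →
        ∣ vecΣ (take ℓ (Y ++ X')) c + vecΣ X' c ∣ ≤ R
      by-prefix (inj₁ e) = subst (λ z → ∣ z ∣ ≤ R) rotated (bounded (length X' ℕ.+ ℓ) c)
        where
        rotated : vecΣ (take (length X' ℕ.+ ℓ) (X' ++ Y)) c ≡ vecΣ (take ℓ (Y ++ X')) c + vecΣ X' c
        rotated = trans (cong (λ P → vecΣ P c) (take-len-++ X' Y ℓ))
          (trans (sumL-++ X' (take ℓ Y) (λ t → vec t c))
          (trans (+-comm (vecΣ X' c) (vecΣ (take ℓ Y) c)) (cong (λ P → vecΣ P c + vecΣ X' c) (sym e))))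
      by-prefix (inj₂ (ℓ' , e)) = subst (λ z → ∣ z ∣ ≤ R) rotated (bounded ℓ'' c)
        where
        ℓ'' : ℕ
        ℓ'' = proj₁ (take-pre ℓ' X' Y)
        rotated : vecΣ (take ℓ'' (X' ++ Y)) c ≡ vecΣ (take ℓ (Y ++ X')) c + vecΣ X' c
        rotated = trans (cong (λ P → vecΣ P c) (sym (proj₂ (take-pre ℓ' X' Y))))
          (sym (trans (cong (λ P → vecΣ P c + vecΣ X' c) e)
               (trans (cong (_+ vecΣ X' c) (sumL-++ Y (take ℓ' X') (λ t → vec t c)))
               (trans (solve 3 (λ t y x → (y :+ t) :+ x := t :+ (y :+ x)) refl (vecΣ (take ℓ' X') c) (vecΣ Y c) (vecΣ X' c))
               (trans (cong (vecΣ (take ℓ' X') c +_) YX'≡0) (+-identityʳ _))))))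

    -- Rotating L so that it ends with its last fractional entry merges the first and the last run of units;
    -- the rotated prefix sums are those of L shifted by the constant −Σ X', as Σ L = 0.
    cyclic-zero-sum-block : (L : List Tag) → (∀ c → vecΣ L c ≡ 0ℚ) → (∀ ℓ c → ∣ vecΣ (take ℓ L) c ∣ ≤ R) →
      #fractional L ℕ.≤ m → K ℕ.* m ℕ.< length L →
      Σ (List Tag) λ X' → Σ (List Tag) λ Y' → L ≡ X' ++ Y' × Block (Y' ++ X')
    cyclic-zero-sum-block L ΣL≡0 bounded few long = by-last (last-fractional L)
      where
      by-last : All IsUnit L ⊎ LastFractional L → Σ (List Tag) λ X' → Σ (List Tag) λ Y' → L ≡ X' ++ Y' × Block (Y' ++ X')
      by-last (inj₁ units) = L , [] , sym (LP.++-identityʳ L) ,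
        long-unit-run⇒block L units (b^k*k<l⇒b^k≤l (suc (2 ℕ.* Rn)) m (length L) long) (λ _ → 0ℚ) (λ _ → 0ℚ)
          (λ ℓ c → subst (λ z → ∣ z ∣ ≤ R) (solve 1 (λ a → a := con 0ℚ :+ a :- con 0ℚ) refl (vecΣ (take ℓ L) c)) (bounded ℓ c))
      by-last (inj₂ (X , q , Y , L≡X++q∷Y , fq , _)) =
        X' , Y , L≡X'++Y , block-in-runs (length Q) Q (λ _ → 0ℚ) cv near ends long' ℕP.≤-refl
        where
        X' : List Tag
        X' = X ++ q ∷ []
        L≡X'++Y : L ≡ X' ++ Y
        L≡X'++Y = trans L≡X++q∷Y (sym (LP.++-assoc X (q ∷ []) Y))
        Q : List Tag
        Q = Y ++ X'
        cv : Fin m → ℚ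
        cv c = - vecΣ X' c
        near : PrefixesNear (λ _ → 0ℚ) cv Q
        near = rotated-prefixes-near X' Y (λ c → trans (cong (λ P → vecΣ P c) (sym L≡X'++Y)) (ΣL≡0 c))
                 (λ ℓ c → subst (λ P → ∣ vecΣ (take ℓ P) c ∣ ≤ R) L≡X'++Y (bounded ℓ c))
        ends : EndsFractional Q
        ends = subst EndsFractional (LP.++-assoc Y X (q ∷ [])) (EndsFractional-snoc (Y ++ X) q fq)
        #Q≡#L : #fractional Q ≡ #fractional L
        #Q≡#L = trans (#fractional-++ Y X') (trans (ℕP.+-comm (#fractional Y) (#fractional X'))
                  (trans (sym (#fractional-++ X' Y)) (cong #fractional (sym L≡X'++Y))))
        |Q|≡|L| : length Q ≡ length L
        |Q|≡|L| = trans (LP.length-++ Y {X'}) (trans (ℕP.+-comm (length Y) (length X'))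
                    (trans (sym (LP.length-++ X' {Y})) (cong length (sym L≡X'++Y))))
        long' : K ℕ.* #fractional Q ℕ.< length Q
        long' = subst₂ (λ a b → K ℕ.* a ℕ.< b) (sym #Q≡#L) (sym |Q|≡|L|) (ℕP.≤-<-trans (ℕP.*-monoʳ-≤ K few) long)

  -- Existence of an optimal integer solution

  InBoxZ : ∀ {n} → (Fin n → ℕ) → (Fin n → ℤ) → Set
  InBoxZ u w = ∀ j → (ℤ.+ 0 ℤ.≤ w j) × (w j ℤ.≤ ℤ.+ u j)

  infixr 5 _◂_
  _◂_ : ∀ {n} → ℤ → (Fin n → ℤ) → Fin (suc n) → ℤ
  (k ◂ w) zero = k
  (k ◂ w) (suc j) = w j

  Extensional : ∀ {n} → ((Fin n → ℤ) → Set) → Set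
  Extensional {n} P = ∀ w w' → (∀ j → w j ≡ w' j) → P w → P w'

  BoxSearch : ∀ {n} → (Fin n → ℕ) → ((Fin n → ℤ) → Set) → Set
  BoxSearch {n} u P = (Σ (Fin n → ℤ) λ w → InBoxZ u w × P w) ⊎ (∀ w → InBoxZ u w → ¬ P w)

  search-box : ∀ n (u : Fin n → ℕ) (P : (Fin n → ℤ) → Set) → Extensional P → (∀ w → Dec (P w)) → BoxSearch u P
  search-box zero u P ext P? with P? (λ ())
  ... | yes p = inj₁ ((λ ()) , (λ ()) , p)
  ... | no ¬p = inj₂ (λ w _ pw → ¬p (ext w (λ ()) (λ ()) pw))
  search-box (suc n) u P ext P? = all-heads (search-up-to (u zero) ℕP.≤-refl)
    where
    SearchedUpTo : ℕ → Set
    SearchedUpTo K = (Σ (Fin (suc n) → ℤ) λ w → InBoxZ u w × P w) ⊎ (∀ w → InBoxZ u w → ℤ.∣ w zero ∣ ℕ.≤ K → ¬ P w)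
    head≡ : ∀ w {k} → ℤ.+ 0 ℤ.≤ w zero → ℤ.∣ w zero ∣ ≡ k → ∀ j → w j ≡ (ℤ.+ k ◂ (λ j → w (suc j))) j
    head≡ w 0≤w₀ ∣w₀∣≡k zero = trans (sym (ℤP.0≤i⇒+∣i∣≡i 0≤w₀)) (cong ℤ.+_ ∣w₀∣≡k)
    head≡ w 0≤w₀ ∣w₀∣≡k (suc j) = refl
    all-heads : SearchedUpTo (u zero) → BoxSearch u P
    all-heads (inj₁ found) = inj₁ found
    all-heads (inj₂ none) = inj₂ (λ w w-box → none w w-box (ℤP.drop‿+≤+
      (subst (ℤ._≤ ℤ.+ u zero) (sym (ℤP.0≤i⇒+∣i∣≡i (proj₁ (w-box zero)))) (proj₂ (w-box zero)))))
    with-head : ℕ → (Fin n → ℤ) → Set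
    with-head k w' = P (ℤ.+ k ◂ w')
    search-tail : ∀ k → BoxSearch (λ j → u (suc j)) (with-head k)
    search-tail k = search-box n (λ j → u (suc j)) (with-head k)
      (λ w w' e → ext (ℤ.+ k ◂ w) (ℤ.+ k ◂ w') (λ { zero → refl ; (suc j) → e j })) (λ w' → P? (ℤ.+ k ◂ w'))
    by-tail : ∀ k → k ℕ.≤ u zero → (∀ w → InBoxZ u w → ℤ.∣ w zero ∣ ℕ.< k → ¬ P w) →
      BoxSearch (λ j → u (suc j)) (with-head k) → SearchedUpTo k
    by-tail k k≤u₀ below (inj₁ (w' , w'-box , pw)) =
      inj₁ ((ℤ.+ k ◂ w') , (λ { zero → ℤ.+≤+ ℕ.z≤n , ℤ.+≤+ k≤u₀ ; (suc j) → w'-box j }) , pw)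
    by-tail k k≤u₀ below (inj₂ none) = inj₂ λ w w-box ∣w₀∣≤k pw → by-head w w-box pw (ℕP.m≤n⇒m<n∨m≡n ∣w₀∣≤k)
      where
      by-head : ∀ w → InBoxZ u w → P w → (ℤ.∣ w zero ∣ ℕ.< k ⊎ ℤ.∣ w zero ∣ ≡ k) → ⊥
      by-head w w-box pw (inj₁ ∣w₀∣<k) = below w w-box ∣w₀∣<k pw
      by-head w w-box pw (inj₂ ∣w₀∣≡k) = none (λ j → w (suc j)) (λ j → w-box (suc j))
        (ext w (ℤ.+ k ◂ (λ j → w (suc j))) (head≡ w (proj₁ (w-box zero)) ∣w₀∣≡k) pw)
    search-up-to : ∀ K → K ℕ.≤ u zero → SearchedUpTo K
    search-up-to zero 0≤u₀ = by-tail 0 0≤u₀ (λ _ _ ()) (search-tail 0)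
    search-up-to (suc K) 1+K≤u₀ with search-up-to K (ℕP.≤-trans (ℕP.n≤1+n K) 1+K≤u₀)
    ... | inj₁ found = inj₁ found
    ... | inj₂ none = by-tail (suc K) 1+K≤u₀ (λ w w-box ∣w₀∣<1+K → none w w-box (ℕP.≤-pred ∣w₀∣<1+K)) (search-tail (suc K))

  module IntegerOptimum {m n : ℕ} (A : Matrix m n) (b : Fin m → ℤ) (c : Fin n → ℤ) (u : Fin n → ℕ) where

    Ax≡b : (Fin n → ℤ) → Set
    Ax≡b w = ∀ i → sumℤ (λ j → A i j ℤ.* w j) ≡ b i

    Ax≡b? : ∀ w → Dec (Ax≡b w)
    Ax≡b? w = FinP.all? (λ i → sumℤ (λ j → A i j ℤ.* w j) ℤP.≟ b i)

    Ax≡b-extensional : Extensional Ax≡b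
    Ax≡b-extensional w w' e by-search i = trans (sumℤ-cong (λ j → cong (A i j ℤ.*_) (sym (e j)))) (by-search i)

    objective-extensional : ∀ w w' → (∀ j → w j ≡ w' j) → objℤ c w ≡ objℤ c w'
    objective-extensional w w' e = sumℤ-cong (λ j → cong (c j ℤ.*_) (e j))

    climb : ∀ F z → IPFeasible A b u z → (∀ w → IPFeasible A b u w → objℤ c w ℤ.≤ objℤ c z ℤ.+ ℤ.+ F) →
      Σ (Fin n → ℤ) (IsOptimalIP A b c u)
    climb F z z-feasible bound = by-search (search-box n u P P-extensional P?)
      where
      P : (Fin n → ℤ) → Set
      P w = Ax≡b w × objℤ c z ℤ.< objℤ c w
      P-extensional : Extensional P
      P-extensional w w' e (Aw≡b , better) = Ax≡b-extensional w w' e Aw≡b , subst (objℤ c z ℤ.<_) (objective-extensional w w' e) better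
      P? : ∀ w → Dec (P w)
      P? w = Ax≡b? w ×-dec (objℤ c z ℤ.<? objℤ c w)
      by-search : BoxSearch u P → Σ (Fin n → ℤ) (IsOptimalIP A b c u)
      by-search (inj₂ none) = z , z-feasible , λ w w-feasible → ℤP.≮⇒≥ (λ better → none w (proj₂ w-feasible) (proj₁ w-feasible , better))
      by-search (inj₁ (w , w-box , (Aw≡b , better))) = by-gap F bound
        where
        by-gap : ∀ F → (∀ w → IPFeasible A b u w → objℤ c w ℤ.≤ objℤ c z ℤ.+ ℤ.+ F) → Σ (Fin n → ℤ) (IsOptimalIP A b c u)
        by-gap zero bound' = ⊥-elim (ℤP.<-irrefl refl (ℤP.<-≤-trans better (subst (objℤ c w ℤ.≤_) (ℤP.+-identityʳ _) (bound' w (Aw≡b , w-box)))))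
        by-gap (suc F') bound' = climb F' w (Aw≡b , w-box) (λ w' w'-feasible → ℤtoℚ-cancel-≤ (gap w' w'-feasible))
          where
          gap : ∀ w' → IPFeasible A b u w' → ℤtoℚ (objℤ c w') ≤ ℤtoℚ (objℤ c w ℤ.+ ℤ.+ F')
          gap w' w'-feasible = ≤-trans (ℤtoℚ-mono-≤ (bound' w' w'-feasible))
            (subst₂ _≤_ (sym (trans (ℤtoℚ-homo-+ (objℤ c z) (ℤ.+ suc F')) (cong (ℤtoℚ (objℤ c z) +_) (ℕtoℚ-suc F'))))
                        (sym (ℤtoℚ-homo-+ (objℤ c w) (ℤ.+ F')))
              (≤-trans (≤-reflexive (solve 2 (λ a f → a :+ (f :+ con 1ℚ) := (con 1ℚ :+ a) :+ f) refl (ℤtoℚ (objℤ c z)) (ℕtoℚ F')))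
                 (+-monoˡ-≤ (ℕtoℚ F') (subst (_≤ ℤtoℚ (objℤ c w)) (ℤtoℚ-homo-+ (ℤ.+ 1) (objℤ c z)) (ℤtoℚ-mono-≤ (ℤP.i<j⇒suc[i]≤j better))))))

    S : ℕ
    S = sumℕ (λ j → ℤ.∣ c j ∣ ℕ.* u j)

    ∣objective∣≤S : ∀ w → (∀ j → (ℤ.+ 0 ℤ.≤ w j) × (w j ℤ.≤ ℤ.+ u j)) → ∣ ℤtoℚ (objℤ c w) ∣ ≤ ℕtoℚ S
    ∣objective∣≤S w w-box = subst (λ q → ∣ q ∣ ≤ ℕtoℚ S) (sym (sumℤ-as-ℚ c w))
      (≤-trans (∣sumℚ∣≤sumℚ∣∣ (λ j → ℤtoℚ (c j) * ℤtoℚ (w j)))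
      (≤-trans (sumℚ-mono-≤ (λ j → ≤-trans (≤-reflexive (∣p*q∣≡∣p∣*∣q∣ (ℤtoℚ (c j)) (ℤtoℚ (w j))))
                   (*-monoˡ-≤-nonNeg ∣ ℤtoℚ (c j) ∣ {{ℚ.nonNegative (0≤∣p∣ (ℤtoℚ (c j)))}} (∣w∣≤u j))))
      (≤-reflexive (sym (trans (ℕtoℚ-sumℕ (λ j → ℤ.∣ c j ∣ ℕ.* u j))
         (sumℚ-cong (λ j → trans (ℕtoℚ-homo-* ℤ.∣ c j ∣ (u j)) (cong (_* ℕtoℚ (u j)) (ℤtoℚ-homo-∣∣ (c j))))))))))
      where
      ∣w∣≤u : ∀ j → ∣ ℤtoℚ (w j) ∣ ≤ ℕtoℚ (u j)
      ∣w∣≤u j = ±p≤r⇒∣p∣≤r (ℤtoℚ-mono-≤ (proj₂ (w-box j)))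
        (≤-trans (neg-antimono-≤ (ℤtoℚ-mono-≤ (proj₁ (w-box j)))) (0≤ℕtoℚ (u j)))

    optimal-solution-exists : Σ (Fin n → ℤ) (IPFeasible A b u) → Σ (Fin n → ℤ) (IsOptimalIP A b c u)
    optimal-solution-exists (z₀ , z₀-feasible) = climb (S ℕ.+ S) z₀ z₀-feasible (λ w w-feasible → ℤtoℚ-cancel-≤ (bounded w w-feasible))
      where
      bounded : ∀ w → IPFeasible A b u w → ℤtoℚ (objℤ c w) ≤ ℤtoℚ (objℤ c z₀ ℤ.+ ℤ.+ (S ℕ.+ S))
      bounded w w-feasible = subst (ℤtoℚ (objℤ c w) ≤_) (sym (trans (ℤtoℚ-homo-+ (objℤ c z₀) (ℤ.+ (S ℕ.+ S))) (cong (ℤtoℚ (objℤ c z₀) +_) (ℕtoℚ-homo-+ S S))))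
        (≤-by-diff (ℕtoℚ S - ℤtoℚ (objℤ c w) + (ℤtoℚ (objℤ c z₀) + ℕtoℚ S))
          (solve 3 (λ a z s → z :+ (s :+ s) :- a := s :- a :+ (z :+ s)) refl (ℤtoℚ (objℤ c w)) (ℤtoℚ (objℤ c z₀)) (ℕtoℚ S))
          (+-pres-0≤ (p≤q⇒0≤q-p (proj₁ (∣p∣≤r⇒±p≤r (∣objective∣≤S w (proj₂ w-feasible)))))
               (subst (0ℚ ≤_) (solve 2 (λ z s → z :- (:- s) := z :+ s) refl (ℤtoℚ (objℤ c z₀)) (ℕtoℚ S))
                 (p≤q⇒0≤q-p (subst (_≤ ℤtoℚ (objℤ c z₀)) refl (-S≤objective z₀ (proj₂ z₀-feasible)))))))
        where
        -S≤objective : ∀ w → (∀ j → (ℤ.+ 0 ℤ.≤ w j) × (w j ℤ.≤ ℤ.+ u j)) → - ℕtoℚ S ≤ ℤtoℚ (objℤ c w)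
        -S≤objective w w-box = subst (- ℕtoℚ S ≤_) (solve 1 (λ x → :- (:- x) := x) refl (ℤtoℚ (objℤ c w)))
                        (neg-antimono-≤ (proj₂ (∣p∣≤r⇒±p≤r (∣objective∣≤S w w-box))))

  -- Proximity

  module Decomposition {m n : ℕ} (A : Matrix m n) (Δ : ℕ) (bounded : ∀ i j → ℤ.∣ A i j ∣ ℕ.≤ Δ) (u : Fin n → ℕ)
    (x : Fin n → ℚ) (x-box : InBox x (uℚ u)) (x-few-interior : count (Interior? x (uℚ u)) ℕ.≤ m)
    (z : Fin n → ℤ) (z-box-ℤ : InBoxZ u z)
    (Av≡0 : ∀ c → sumℚ (λ j → ℤtoℚ (A c j) * (x j - ℤtoℚ (z j))) ≡ 0ℚ) where

    v : Fin n → ℚ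
    v j = x j - ℤtoℚ (z j)

    σᶻ : Fin n → ℤ
    σᶻ j = sgn (v j)

    σ : Fin n → ℚ
    σ j = ℤtoℚ (σᶻ j)


    ℤz : Fin n → ℚ
    ℤz j = ℤtoℚ (z j)

    z-box : ∀ j → 0ℚ ≤ ℤz j × ℤz j ≤ uℚ u j
    z-box j = ℤtoℚ-mono-≤ (proj₁ (z-box-ℤ j)) , ℤtoℚ-mono-≤ (proj₂ (z-box-ℤ j))

    ∣v∣≤u : ∀ j → ∣ v j ∣ ≤ uℚ u j
    ∣v∣≤u j = ±p≤r⇒∣p∣≤r (≤-by-diff (uℚ u j - x j + ℤz j) (solve 3 (λ u x z → u :- (x :- z) := u :- x :+ z) refl (uℚ u j) (x j) (ℤz j))
                           (+-pres-0≤ (p≤q⇒0≤q-p (proj₂ (x-box j))) (proj₁ (z-box j))))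
                        (≤-by-diff (uℚ u j - ℤz j + x j) (solve 3 (λ u x z → u :- (:- (x :- z)) := u :- z :+ x) refl (uℚ u j) (x j) (ℤz j))
                           (+-pres-0≤ (p≤q⇒0≤q-p (proj₂ (z-box j))) (proj₁ (x-box j))))

    fraction-value : Maybe ℚ → ℚ
    fraction-value nothing = 0ℚ
    fraction-value (just f) = f

    FractionOK : Fin n → Maybe ℚ → Set
    FractionOK j nothing = ⊤
    FractionOK j (just f) = (0ℚ ≤ σ j * f) × (σ j * f ≤ 1ℚ) × Interior x (uℚ u) j

    Splitting : Fin n → Set
    Splitting j = Σ ℕ λ g → Σ (Maybe ℚ) λ fm → (σ j * ℕtoℚ g + fraction-value fm ≡ v j) × FractionOK j fm

    σ²≡1 : ∀ j → σ j * σ j ≡ 1ℚ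
    σ²≡1 j = ±1⇒s*s≡1 (sgnℚ-±1 (v j))

    split-interior : ∀ j → Interior x (uℚ u) j → Splitting j
    split-interior j interior = g , just f , whole+f≡v , 0≤σf , σf≤1 , interior
      where
      parts : Σ ℕ λ g → ℕtoℚ g ≤ ∣ v j ∣ × ∣ v j ∣ ≤ ℕtoℚ g + 1ℚ
      parts = integer-part ∣ v j ∣ (u j) (0≤∣p∣ (v j)) (∣v∣≤u j)
      g : ℕ
      g = proj₁ parts
      f : ℚ
      f = v j - σ j * ℕtoℚ g
      whole+f≡v : σ j * ℕtoℚ g + f ≡ v j
      whole+f≡v = solve 2 (λ a b → a :+ (b :- a) := b) refl (σ j * ℕtoℚ g) (v j)
      σf≡∣v∣-g : σ j * f ≡ ∣ v j ∣ - ℕtoℚ g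
      σf≡∣v∣-g = trans (solve 3 (λ s v g → s :* (v :- s :* g) := s :* v :- (s :* s) :* g) refl (σ j) (v j) (ℕtoℚ g))
        (trans (cong₂ (λ a b → a - b * ℕtoℚ g) (sgnℚ*p≡∣p∣ (v j)) (σ²≡1 j)) (cong (λ y → ∣ v j ∣ - y) (*-identityˡ (ℕtoℚ g))))
      0≤σf : 0ℚ ≤ σ j * f
      0≤σf = subst (0ℚ ≤_) (sym σf≡∣v∣-g) (p≤q⇒0≤q-p (proj₁ (proj₂ parts)))
      σf≤1 : σ j * f ≤ 1ℚ
      σf≤1 = subst (_≤ 1ℚ) (sym σf≡∣v∣-g) (≤-by-diff (ℕtoℚ g + 1ℚ - ∣ v j ∣)
        (solve 3 (λ o a g → o :- (a :- g) := g :+ o :- a) refl 1ℚ ∣ v j ∣ (ℕtoℚ g)) (p≤q⇒0≤q-p (proj₂ (proj₂ parts))))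

    boundary-integral : ∀ j → ¬ Interior x (uℚ u) j → Σ ℤ λ w → x j ≡ ℤtoℚ w
    boundary-integral j not-interior = by-position (0ℚ <? x j)
      where
      by-position : Dec (0ℚ < x j) → Σ ℤ λ w → x j ≡ ℤtoℚ w
      by-position (no x≯0) = ℤ.+ 0 , ≤-antisym (≮⇒≥ x≯0) (proj₁ (x-box j))
      by-position (yes x>0) = ℤ.+ u j , ≤-antisym (proj₂ (x-box j)) (≮⇒≥ (λ x<u → not-interior (x>0 , x<u)))

    split-boundary : ∀ j → ¬ Interior x (uℚ u) j → Splitting j
    split-boundary j not-interior = ℤ.∣ w ∣ , nothing , σ∣w∣≡v , tt
      where
      xj : Σ ℤ λ w → x j ≡ ℤtoℚ w
      xj = boundary-integral j not-interior
      w : ℤ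
      w = proj₁ xj ℤ.- z j
      v≡w : v j ≡ ℤtoℚ w
      v≡w = trans (cong (_- ℤz j) (proj₂ xj))
        (sym (trans (ℤtoℚ-homo-+ (proj₁ xj) (ℤ.- z j)) (cong (ℤtoℚ (proj₁ xj) +_) (ℤtoℚ-homo-neg (z j)))))
      σ∣w∣≡v : σ j * ℕtoℚ ℤ.∣ w ∣ + 0ℚ ≡ v j
      σ∣w∣≡v = begin
        σ j * ℕtoℚ ℤ.∣ w ∣ + 0ℚ   ≡⟨ +-identityʳ _ ⟩
        σ j * ℕtoℚ ℤ.∣ w ∣        ≡⟨ cong (σ j *_) (trans (ℤtoℚ-homo-∣∣ w) (cong ∣_∣ (sym v≡w))) ⟩
        σ j * ∣ v j ∣             ≡⟨ cong (σ j *_) (sym (sgnℚ*p≡∣p∣ (v j))) ⟩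
        σ j * (σ j * v j)         ≡⟨ sym (*-assoc (σ j) (σ j) (v j)) ⟩
        σ j * σ j * v j           ≡⟨ cong (_* v j) (σ²≡1 j) ⟩
        1ℚ * v j                  ≡⟨ *-identityˡ (v j) ⟩
        v j                       ∎
        where open ≡-Reasoning

    splitting : ∀ j → Splitting j
    splitting j with Interior? x (uℚ u) j
    ... | yes interior = split-interior j interior
    ... | no not-interior = split-boundary j not-interior

    -- A tag (j , nothing) stands for the integral vector sign(vⱼ) Aⱼ and (j , just f) for f Aⱼ, the
    -- fractional remainder of an interior coordinate.
    module Tags (split : ∀ j → Splitting j) where

      whole : Fin n → ℕ
      whole j = proj₁ (split j)

      fraction : Fin n → Maybe ℚ
      fraction j = proj₁ (proj₂ (split j))

      Tag : Set
      Tag = Fin n × Maybe ℚ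

      column : Tag → Fin n
      column = proj₁

      coefficient : Tag → ℚ
      coefficient (j , nothing) = σ j
      coefficient (j , just f) = f

      fractional : Tag → Bool
      fractional (_ , nothing) = false
      fractional (_ , just _) = true

      vec : Tag → Fin m → ℚ
      vec t c = coefficient t * ℤtoℚ (A c (column t))

      integral-vec : Tag → Fin m → ℤ
      integral-vec t c = σᶻ (column t) ℤ.* A c (column t)

      vec-integral : ∀ t → fractional t ≡ false → ∀ c → vec t c ≡ ℤtoℚ (integral-vec t c)
      vec-integral (j , nothing) _ c = sym (ℤtoℚ-homo-* (σᶻ j) (A c j))
      vec-integral (j , just f) () c

      fraction-tag : Fin n → Maybe ℚ → List Tag
      fraction-tag j nothing = []
      fraction-tag j (just f) = (j , just f) ∷ []

      column-tags : Fin n → List Tag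
      column-tags j = replicate (whole j) (j , nothing) ++ fraction-tag j (fraction j)

      tags : List Tag
      tags = concatF column-tags

      sum-over-tags : (F : Fin n → ℚ) → sumL tags (λ t → coefficient t * F (column t)) ≡ sumℚ (λ j → v j * F j)
      sum-over-tags F = trans (sumL-concatF column-tags term) (sumℚ-cong column-sum)
        where
        term : Tag → ℚ
        term t = coefficient t * F (column t)
        fraction-sum : ∀ j fm → sumL (fraction-tag j fm) term ≡ fraction-value fm * F j
        fraction-sum j nothing = sym (*-zeroˡ (F j))
        fraction-sum j (just f) = +-identityʳ _
        column-sum : ∀ j → sumL (column-tags j) term ≡ v j * F j
        column-sum j = trans (sumL-++ (replicate (whole j) (j , nothing)) (fraction-tag j (fraction j)) term)
          (trans (cong₂ _+_ (sumL-rep (whole j) (j , nothing) term) (fraction-sum j (fraction j)))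
          (trans (solve 4 (λ g s f c → g :* (s :* f) :+ c :* f := (s :* g :+ c) :* f) refl (ℕtoℚ (whole j)) (σ j) (F j) (fraction-value (fraction j)))
                 (cong (_* F j) (proj₁ (proj₂ (proj₂ (split j)))))))

      Conformal : Tag → Set
      Conformal t = (0ℚ ≤ coefficient t * σ (column t)) × ∣ coefficient t ∣ ≤ 1ℚ

      tags-conformal : All Conformal tags
      tags-conformal = all-concatF column-tags (λ j → AllP.++⁺ (AllP.replicate⁺ (whole j) (unit-conformal {j})) (fraction-conformal j (fraction j) (proj₂ (proj₂ (proj₂ (split j))))))
        where
        unit-conformal : ∀ {j} → Conformal (j , nothing)
        unit-conformal {j} = subst (0ℚ ≤_) (sym (±1⇒s*s≡1 (sgnℚ-±1 (v j)))) 0≤1 , ≤-reflexive (±1⇒∣s∣≡1 (sgnℚ-±1 (v j)))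
        fraction-conformal : ∀ j fm → FractionOK j fm → All Conformal (fraction-tag j fm)
        fraction-conformal j nothing _ = []
        fraction-conformal j (just f) (p0 , p1 , _) = (subst (0ℚ ≤_) (*-comm (σ j) f) p0 ,
            subst (_≤ 1ℚ) (trans (∣p*q∣≡∣p∣*∣q∣ (σ j) f) (trans (cong (_* ∣ f ∣) (±1⇒∣s∣≡1 (sgnℚ-±1 (v j)))) (*-identityˡ ∣ f ∣)))
              (±p≤r⇒∣p∣≤r p1 (≤-trans (neg-antimono-≤ p0) 0≤1))) ∷ []

      vec-bound : ∀ t → Conformal t → ∀ c → ∣ vec t c ∣ ≤ ℕtoℚ Δ
      vec-bound t (_ , cb) c = ≤-trans (≤-reflexive (∣p*q∣≡∣p∣*∣q∣ (coefficient t) (ℤtoℚ (A c (column t)))))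
         (≤-trans (*-monoʳ-≤-nonNeg ∣ ℤtoℚ (A c (column t)) ∣ {{ℚ.nonNegative (0≤∣p∣ (ℤtoℚ (A c (column t))))}} cb)
         (≤-trans (≤-reflexive (*-identityˡ _)) (subst (_≤ ℕtoℚ Δ) (ℤtoℚ-homo-∣∣ (A c (column t))) (ℕtoℚ-mono-≤ (bounded c (column t))))))

      tags-sum-to-zero : ∀ c → sumL tags (λ t → vec t c) ≡ 0ℚ
      tags-sum-to-zero c = trans (sum-over-tags (λ j → ℤtoℚ (A c j))) (trans (sumℚ-cong (λ j → *-comm (v j) _)) (Av≡0 c))

      open ZeroSumBlock m vec fractional integral-vec vec-integral (m ℕ.* Δ) renaming (R to Rc)

      sumℕ-mono : ∀ {k} {f g : Fin k → ℕ} → (∀ i → f i ℕ.≤ g i) → sumℕ f ℕ.≤ sumℕ g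
      sumℕ-mono {zero} h = ℕ.z≤n
      sumℕ-mono {suc k} h = ℕP.+-mono-≤ (h zero) (sumℕ-mono (λ i → h (suc i)))

      #fractional-concat : ∀ {k} (f : Fin k → List Tag) → #fractional (concatF f) ≡ sumℕ (λ j → #fractional (f j))
      #fractional-concat {zero} f = refl
      #fractional-concat {suc k} f = trans (#fractional-++ (f zero) _) (cong (#fractional (f zero) ℕ.+_) (#fractional-concat (λ j → f (suc j))))

      #fractional-replicate : ∀ k j → #fractional (replicate k (j , nothing)) ≡ 0
      #fractional-replicate zero j = refl
      #fractional-replicate (suc k) j = #fractional-replicate k j

      #fractional-tags : #fractional tags ℕ.≤ m
      #fractional-tags = ℕP.≤-trans (ℕP.≤-reflexive (#fractional-concat column-tags)) (ℕP.≤-trans (sumℕ-mono column-count) x-few-interior)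
        where
        fraction-count : ∀ j fm → FractionOK j fm → #fractional (fraction-tag j fm) ℕ.≤ indicator (Interior? x (uℚ u) j)
        fraction-count j nothing _ = ℕ.z≤n
        fraction-count j (just f) (_ , _ , it) = ℕP.≤-reflexive (sym (indicator-yes (Interior? x (uℚ u) j) it))
        column-count : ∀ j → #fractional (column-tags j) ℕ.≤ indicator (Interior? x (uℚ u) j)
        column-count j = ℕP.≤-trans (ℕP.≤-reflexive (trans (#fractional-++ (replicate (whole j) (j , nothing)) (fraction-tag j (fraction j)))
                                             (cong (ℕ._+ #fractional (fraction-tag j (fraction j))) (#fractional-replicate (whole j) j))))
                           (fraction-count j (fraction j) (proj₂ (proj₂ (proj₂ (split j)))))

      ∣v∣₁≤#tags : sumℚ (λ j → ∣ v j ∣) ≤ ℕtoℚ (length tags)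
      ∣v∣₁≤#tags = subst (sumℚ (λ j → ∣ v j ∣) ≤_) (trans (sym (sumL-concatF column-tags (λ _ → 1ℚ))) (sumL-len tags)) (sumℚ-mono-≤ column-size)
        where
        fraction-size : ∀ j fm → FractionOK j fm → σ j * fraction-value fm ≤ sumL (fraction-tag j fm) (λ _ → 1ℚ)
        fraction-size j nothing _ = ≤-reflexive (*-zeroʳ (σ j))
        fraction-size j (just f) (_ , p1 , _) = ≤-trans p1 (≤-reflexive (sym (+-identityʳ 1ℚ)))
        column-size : ∀ j → ∣ v j ∣ ≤ sumL (column-tags j) (λ _ → 1ℚ)
        column-size j = subst₂ _≤_ whole+fraction≡∣v∣ (sym column-length) (+-monoʳ-≤ (ℕtoℚ (whole j)) (fraction-size j (fraction j) (proj₂ (proj₂ (proj₂ (split j))))))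
          where
          whole+fraction≡∣v∣ : ℕtoℚ (whole j) + σ j * fraction-value (fraction j) ≡ ∣ v j ∣
          whole+fraction≡∣v∣ = sym (trans (sym (sgnℚ*p≡∣p∣ (v j))) (trans (cong (σ j *_) (sym (proj₁ (proj₂ (proj₂ (split j))))))
                 (trans (solve 3 (λ g s c → s :* (s :* g :+ c) := (s :* s) :* g :+ s :* c) refl (ℕtoℚ (whole j)) (σ j) (fraction-value (fraction j)))
                 (trans (cong (λ w → w * ℕtoℚ (whole j) + σ j * fraction-value (fraction j)) (±1⇒s*s≡1 (sgnℚ-±1 (v j))))
                        (cong (_+ σ j * fraction-value (fraction j)) (*-identityˡ (ℕtoℚ (whole j))))))))
          column-length : sumL (column-tags j) (λ _ → 1ℚ) ≡ ℕtoℚ (whole j) + sumL (fraction-tag j (fraction j)) (λ _ → 1ℚ)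
          column-length = trans (sumL-++ (replicate (whole j) (j , nothing)) (fraction-tag j (fraction j)) (λ _ → 1ℚ))
                 (cong (_+ sumL (fraction-tag j (fraction j)) (λ _ → 1ℚ)) (trans (sumL-rep (whole j) (j , nothing) (λ _ → 1ℚ)) (*-identityʳ (ℕtoℚ (whole j)))))

      N : ℕ
      N = length tags

      tag-vector : Fin N → Fin m → ℚ
      tag-vector i c = vec (lookup tags i) c

      steinitz : Σ (List (Fin N)) λ L → (∀ g → sumL L g ≡ sumℚ g) ×
                   (∀ ℓ c → ∣ sumL (take ℓ L) (λ i → tag-vector i c) ∣ ≤ ℕtoℚ m * ℕtoℚ Δ)
      steinitz = Steinitz.steinitz m (ℕtoℚ Δ) (0≤ℕtoℚ Δ) tag-vector (λ i c → vec-bound (lookup tags i) (all-lookup tags tags-conformal i) c)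
                    (λ c → trans (sumℚ-lookup tags (λ t → vec t c)) (tags-sum-to-zero c))

      order : List (Fin N)
      order = proj₁ steinitz

      ordered : List Tag
      ordered = map (lookup tags) order

      sum-ordered : ∀ h → sumL ordered h ≡ sumL tags h
      sum-ordered h = trans (sumL-map (lookup tags) order h) (trans (proj₁ (proj₂ steinitz) (λ i → h (lookup tags i))) (sumℚ-lookup tags h))

      ordered-prefixes-bounded : ∀ ℓ c → ∣ sumL (take ℓ ordered) (λ t → vec t c) ∣ ≤ Rc
      ordered-prefixes-bounded ℓ c = subst₂ (λ P r → ∣ P ∣ ≤ r)
         (sym (trans (cong (λ P → sumL P (λ t → vec t c)) (LP.take-map ℓ order)) (sumL-map (lookup tags) (take ℓ order) (λ t → vec t c))))
         (sym (ℕtoℚ-homo-* m Δ))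
         (proj₂ (proj₂ steinitz) ℓ c)

      ordered-conformal : All Conformal ordered
      ordered-conformal = AllP.map⁺ (All.universal (all-lookup tags tags-conformal) order)

      #fractional-as-sum : ∀ X → ℕtoℚ (#fractional X) ≡ sumL X (λ t → ℕtoℚ (b2n (fractional t)))
      #fractional-as-sum [] = refl
      #fractional-as-sum (t ∷ X) = trans (ℕtoℚ-homo-+ (b2n (fractional t)) (#fractional X)) (cong (ℕtoℚ (b2n (fractional t)) +_) (#fractional-as-sum X))

      #fractional-ordered : #fractional ordered ℕ.≤ m
      #fractional-ordered = ℕP.≤-trans (ℕtoℚ-cancel-≤ (≤-reflexive (trans (#fractional-as-sum ordered) (trans (sum-ordered _) (sym (#fractional-as-sum tags)))))) #fractional-tags

      length-ordered : ℕtoℚ (length ordered) ≡ ℕtoℚ (length tags)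
      length-ordered = trans (sym (sumL-len ordered)) (trans (sum-ordered (λ _ → 1ℚ)) (sumL-len tags))

      module Cycle (long : K ℕ.* m ℕ.< length ordered) where

        rotation : Σ (List Tag) λ X' → Σ (List Tag) λ Y' → ordered ≡ X' ++ Y' × Block (Y' ++ X')
        rotation = cyclic-zero-sum-block ordered (λ c → trans (sum-ordered (λ t → vec t c)) (tags-sum-to-zero c)) ordered-prefixes-bounded #fractional-ordered long

        X' : List Tag
        X' = proj₁ rotation
        Y' : List Tag
        Y' = proj₁ (proj₂ rotation)
        ordered≡X'++Y' : ordered ≡ X' ++ Y'
        ordered≡X'++Y' = proj₁ (proj₂ (proj₂ rotation))
        block : Block (Y' ++ X')
        block = proj₂ (proj₂ (proj₂ rotation))
        X : List Tag
        X = proj₁ block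
        B : List Tag
        B = proj₁ (proj₂ block)
        Y : List Tag
        Y = proj₁ (proj₂ (proj₂ block))
        Y'++X'≡X++B++Y : Y' ++ X' ≡ X ++ B ++ Y
        Y'++X'≡X++B++Y = proj₁ (proj₂ (proj₂ (proj₂ block)))
        B≢[] : ¬ B ≡ []
        B≢[] = proj₁ (proj₂ (proj₂ (proj₂ (proj₂ block))))
        B-units : All IsUnit B
        B-units = proj₁ (proj₂ (proj₂ (proj₂ (proj₂ (proj₂ block)))))
        B-sum : ∀ c → sumL B (λ t → vec t c) ≡ 0ℚ
        B-sum = proj₂ (proj₂ (proj₂ (proj₂ (proj₂ (proj₂ block)))))

        sum-rotation : ∀ h → sumL (X ++ B ++ Y) h ≡ sumL tags h
        sum-rotation h = trans (cong (λ P → sumL P h) (sym Y'++X'≡X++B++Y)) (trans (sumL-comm Y' X' h) (trans (cong (λ P → sumL P h) (sym ordered≡X'++Y')) (sum-ordered h)))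

        rotation-conformal : All Conformal (X ++ B ++ Y)
        rotation-conformal = subst (All Conformal) Y'++X'≡X++B++Y (AllP.++⁺ (AllP.++⁻ʳ X' (subst (All Conformal) ordered≡X'++Y' ordered-conformal)) (AllP.++⁻ˡ X' (subst (All Conformal) ordered≡X'++Y' ordered-conformal)))

        X-conformal : All Conformal X
        X-conformal = AllP.++⁻ˡ X rotation-conformal
        Y-conformal : All Conformal Y
        Y-conformal = AllP.++⁻ʳ B (AllP.++⁻ʳ X rotation-conformal)

        unit-coefficient : ∀ t → fractional t ≡ false → coefficient t ≡ σ (column t)
        unit-coefficient (j , nothing) _ = refl
        unit-coefficient (j , just f) ()

        sumL-cong-All : ∀ (xs : List Tag) {g h : Tag → ℚ} → All (λ t → g t ≡ h t) xs → sumL xs g ≡ sumL xs h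
        sumL-cong-All [] [] = refl
        sumL-cong-All (x ∷ xs) (p ∷ ps) = cong₂ _+_ p (sumL-cong-All xs ps)

        y : Fin n → ℤ
        y j = sumLℤ B (λ t → δz (column t) j ℤ.* σᶻ (column t))

        yℚ : Fin n → ℚ
        yℚ j = ℤtoℚ (y j)

        yℚ-as-sum : ∀ j → yℚ j ≡ sumL B (λ t → coefficient t * δ (column t) j)
        yℚ-as-sum j = trans (ℤtoℚ-sumLℤ B (λ t → δz (column t) j ℤ.* σᶻ (column t)))
          (sumL-cong-All B (All.map (λ {t} ut → trans (ℤtoℚ-homo-* (δz (column t) j) (σᶻ (column t)))
              (trans (cong₂ _*_ (δz-ℚ (column t) j) (sym (unit-coefficient t ut))) (*-comm (δ (column t) j) (coefficient t)))) B-units))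

        Ay≡0 : ∀ c → sumℤ (λ j → A c j ℤ.* y j) ≡ ℤ.+ 0
        Ay≡0 c = ℤtoℚ-injective (trans (ℤtoℚ-sumℤ (λ j → A c j ℤ.* y j))
          (trans (sumℚ-cong (λ j → trans (ℤtoℚ-homo-* (A c j) (y j)) (trans (cong (ℤtoℚ (A c j) *_) (yℚ-as-sum j))
                     (sym (sumL-*ˡ B (ℤtoℚ (A c j)) (λ t → coefficient t * δ (column t) j))))))
          (trans (sym (sumL-sumℚ B (λ t j → ℤtoℚ (A c j) * (coefficient t * δ (column t) j))))
          (trans (sumL-cong B (λ t → trans (sumℚ-cong (λ j → solve 3 (λ a c d → a :* (c :* d) := d :* (c :* a)) refl (ℤtoℚ (A c j)) (coefficient t) (δ (column t) j)))
                     (sumℚ-δ (column t) (λ j → coefficient t * ℤtoℚ (A c j)))))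
          (B-sum c)))))

        weight : Fin n → Tag → ℚ
        weight j t = coefficient t * (δ (column t) j * σ j)

        weight-nonneg : ∀ j t → Conformal t → 0ℚ ≤ weight j t
        weight-nonneg j t (g0 , _) = subst (0ℚ ≤_) rearranged (*-pres-0≤ (δ≥0 (column t) j) g0)
          where rearranged : δ (column t) j * (coefficient t * σ (column t)) ≡ weight j t
                rearranged = trans (solve 3 (λ d c s → d :* (c :* s) := c :* (d :* s)) refl (δ (column t) j) (coefficient t) (σ (column t)))
                          (cong (coefficient t *_) (sym (δ-swap (column t) j σ)))

        B-weight : ∀ j → sumL B (weight j) ≡ σ j * yℚ j
        B-weight j = trans (sumL-cong B (λ t → solve 3 (λ c d s → c :* (d :* s) := s :* (c :* d)) refl (coefficient t) (δ (column t) j) (σ j)))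
                  (trans (sumL-*ˡ B (σ j) (λ t → coefficient t * δ (column t) j)) (cong (σ j *_) (sym (yℚ-as-sum j))))

        tags-weight : ∀ j → sumL tags (weight j) ≡ σ j * v j
        tags-weight j = trans (sum-over-tags (λ k → δ k j * σ j))
          (trans (sumℚ-cong (λ k → solve 3 (λ v d s → v :* (d :* s) := d :* (v :* s)) refl (v k) (δ k j) (σ j)))
          (trans (sumℚ-δ′ j (λ k → v k * σ j)) (*-comm (v j) (σ j))))

        conformal : ∀ j → 0ℚ ≤ σ j * yℚ j × σ j * yℚ j ≤ σ j * v j
        conformal j = subst (0ℚ ≤_) (B-weight j) (sumL-nonNeg B (weight j) (All.map (λ {t} → weight-nonneg j t) B-conformal)) ,
                 subst₂ _≤_ (B-weight j) (trans (sum-rotation (weight j)) (tags-weight j))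
                   (sumL-sub X B Y (weight j) (All.map (λ {t} → weight-nonneg j t) X-conformal) (All.map (λ {t} → weight-nonneg j t) Y-conformal))
          where
          B-conformal : All Conformal B
          B-conformal = AllP.++⁻ˡ B (AllP.++⁻ʳ X rotation-conformal)

        1≤∣y∣₁ : 1ℚ ≤ sumℚ (λ j → σ j * yℚ j)
        1≤∣y∣₁ = subst (1ℚ ≤_) |B|≡Σσy (ℕtoℚ-mono-≤ (nonempty-length B B≢[]))
          where
          nonempty-length : ∀ (Z : List Tag) → ¬ Z ≡ [] → 1 ℕ.≤ length Z
          nonempty-length [] ne = ⊥-elim (ne refl)
          nonempty-length (_ ∷ _) ne = ℕ.s≤s ℕ.z≤n
          |B|≡Σσy : ℕtoℚ (length B) ≡ sumℚ (λ j → σ j * yℚ j)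
          |B|≡Σσy = trans (sym (sumL-len B)) (trans (sumL-cong-All B (All.map (λ {t} ut → sym (trans
                   (sumℚ-cong (λ j → trans (sym (*-assoc (coefficient t) (δ (column t) j) (σ j))) (trans (cong (_* σ j) (*-comm (coefficient t) (δ (column t) j))) (*-assoc (δ (column t) j) (coefficient t) (σ j)))))
                   (trans (sumℚ-δ (column t) (λ j → coefficient t * σ j)) (trans (cong (_* σ (column t)) (unit-coefficient t ut)) (±1⇒s*s≡1 (sgnℚ-±1 (v (column t)))))))) B-units))
              (trans (sumL-sumℚ B (λ t j → weight j t)) (sumℚ-cong B-weight)))

  conformal-shift-in-box : ∀ {s a b y lo hi : ℚ} → (s ≡ 1ℚ ⊎ s ≡ - 1ℚ) → 0ℚ ≤ s * y → s * y ≤ s * (b - a) →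
    lo ≤ a → lo ≤ b → a ≤ hi → b ≤ hi → lo ≤ a + y × a + y ≤ hi
  conformal-shift-in-box {s} {a} {b} {y} (inj₁ refl) 0≤y y≤b-a lo≤a lo≤b a≤hi b≤hi =
    ≤-trans lo≤a (≤-by-diff y (solve 2 (λ a y → a :+ y :- a := y) refl a y) (subst (0ℚ ≤_) (*-identityˡ y) 0≤y)) ,
    ≤-trans (≤-by-diff (b - a - y) (solve 3 (λ a b y → b :- (a :+ y) := b :- a :- y) refl a b y)
               (p≤q⇒0≤q-p (subst₂ _≤_ (*-identityˡ y) (*-identityˡ (b - a)) y≤b-a)))
            b≤hi
  conformal-shift-in-box {s} {a} {b} {y} (inj₂ refl) 0≤-y -y≤a-b lo≤a lo≤b a≤hi b≤hi =
    ≤-trans lo≤b (≤-by-diff (s * (b - a) - s * y)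
                    (solve 3 (λ a b y → a :+ y :- b := (:- con 1ℚ) :* (b :- a) :- (:- con 1ℚ) :* y) refl a b y) (p≤q⇒0≤q-p -y≤a-b)) ,
    ≤-trans (≤-by-diff (s * y) (solve 2 (λ a y → a :- (a :+ y) := (:- con 1ℚ) :* y) refl a y) 0≤-y) a≤hi

  record ConformalKernelVector {m n} (A : Matrix m n) (v : Fin n → ℚ) : Set where
    field
      y : Fin n → ℤ
      sign : Fin n → ℚ
      sign±1 : ∀ j → sign j ≡ 1ℚ ⊎ sign j ≡ - 1ℚ
      sign-abs : ∀ j → sign j * v j ≡ ∣ v j ∣
      Ay≡0 : ∀ i → sumℤ (λ j → A i j ℤ.* y j) ≡ ℤ.+ 0
      conformal : ∀ j → 0ℚ ≤ sign j * ℤtoℚ (y j) × sign j * ℤtoℚ (y j) ≤ sign j * v j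
      1≤∣y∣₁ : 1ℚ ≤ sumℚ (λ j → sign j * ℤtoℚ (y j))

  module Exchange {m n : ℕ} (A : Matrix m n) (b : Fin m → ℤ) (u : Fin n → ℕ) (x : Fin n → ℚ) (z : Fin n → ℤ)
    (x-feasible : LPFeasible A b u x) (z-feasible : IPFeasible A b u z)
    (K : ConformalKernelVector A (λ j → x j - ℤtoℚ (z j))) where

    open ConformalKernelVector K

    v : Fin n → ℚ
    v j = x j - ℤtoℚ (z j)

    z' : Fin n → ℤ
    z' j = z j ℤ.+ y j

    x' : Fin n → ℚ
    x' j = x j - ℤtoℚ (y j)

    Ay≡0ℚ : ∀ i → sumℚ (λ j → ℤtoℚ (A i j) * ℤtoℚ (y j)) ≡ 0ℚ
    Ay≡0ℚ i = trans (sym (sumℤ-as-ℚ (A i) y)) (cong ℤtoℚ (Ay≡0 i))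

    z-box : ∀ j → 0ℚ ≤ ℤtoℚ (z j) × ℤtoℚ (z j) ≤ ℕtoℚ (u j)
    z-box j = ℤtoℚ-mono-≤ (proj₁ (proj₂ z-feasible j)) , ℤtoℚ-mono-≤ (proj₂ (proj₂ z-feasible j))

    z'-feasible : IPFeasible A b u z'
    z'-feasible = Az'≡b , λ j → ℤtoℚ-cancel-≤ (subst (0ℚ ≤_) (sym (ℤtoℚ-homo-+ (z j) (y j))) (proj₁ (z'-box j))) ,
                                ℤtoℚ-cancel-≤ (subst (_≤ ℕtoℚ (u j)) (sym (ℤtoℚ-homo-+ (z j) (y j))) (proj₂ (z'-box j)))
      where
      open ≡-Reasoning
      z'-box : ∀ j → 0ℚ ≤ ℤtoℚ (z j) + ℤtoℚ (y j) × ℤtoℚ (z j) + ℤtoℚ (y j) ≤ ℕtoℚ (u j)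
      z'-box j = conformal-shift-in-box (sign±1 j) (proj₁ (conformal j)) (proj₂ (conformal j))
                   (proj₁ (z-box j)) (proj₁ (proj₂ x-feasible j)) (proj₂ (z-box j)) (proj₂ (proj₂ x-feasible j))
      Az'≡b : ∀ i → sumℤ (λ j → A i j ℤ.* z' j) ≡ b i
      Az'≡b i = ℤtoℚ-injective (begin
        ℤtoℚ (sumℤ (λ j → A i j ℤ.* z' j))
          ≡⟨ sumℤ-as-ℚ (A i) z' ⟩
        sumℚ (λ j → ℤtoℚ (A i j) * ℤtoℚ (z' j))
          ≡⟨ sumℚ-cong (λ j → trans (cong (ℤtoℚ (A i j) *_) (ℤtoℚ-homo-+ (z j) (y j))) (*-distribˡ-+ (ℤtoℚ (A i j)) _ _)) ⟩
        sumℚ (λ j → ℤtoℚ (A i j) * ℤtoℚ (z j) + ℤtoℚ (A i j) * ℤtoℚ (y j))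
          ≡⟨ sumℚ-+ (λ j → ℤtoℚ (A i j) * ℤtoℚ (z j)) (λ j → ℤtoℚ (A i j) * ℤtoℚ (y j)) ⟩
        sumℚ (λ j → ℤtoℚ (A i j) * ℤtoℚ (z j)) + sumℚ (λ j → ℤtoℚ (A i j) * ℤtoℚ (y j))
          ≡⟨ cong₂ _+_ (trans (sym (sumℤ-as-ℚ (A i) z)) (cong ℤtoℚ (proj₁ z-feasible i))) (Ay≡0ℚ i) ⟩
        ℤtoℚ (b i) + 0ℚ
          ≡⟨ +-identityʳ _ ⟩
        ℤtoℚ (b i) ∎)

    x'-feasible : LPFeasible A b u x'
    x'-feasible = Ax'≡b , x'-box
      where
      Ax'≡b : ∀ i → sumℚ (λ j → ℤtoℚ (A i j) * x' j) ≡ ℤtoℚ (b i)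
      Ax'≡b i = trans (sumℚ-cong (λ j → *-distribˡ-+ (ℤtoℚ (A i j)) (x j) (- ℤtoℚ (y j))))
        (trans (sumℚ-+ (λ j → ℤtoℚ (A i j) * x j) (λ j → ℤtoℚ (A i j) * - ℤtoℚ (y j)))
        (trans (cong₂ _+_ (proj₁ x-feasible i)
                          (trans (sumℚ-cong (λ j → sym (neg-distribʳ-* (ℤtoℚ (A i j)) (ℤtoℚ (y j)))))
                                 (trans (sumℚ-neg (λ j → ℤtoℚ (A i j) * ℤtoℚ (y j))) (cong -_ (Ay≡0ℚ i)))))
               (+-identityʳ _)))
      x'-box : ∀ j → 0ℚ ≤ x' j × x' j ≤ ℕtoℚ (u j)
      x'-box j = subst (λ w → 0ℚ ≤ w × w ≤ ℕtoℚ (u j))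
        (solve 3 (λ z x y → z :+ (x :- z :- y) := x :- y) refl (ℤtoℚ (z j)) (x j) (ℤtoℚ (y j)))
        (conformal-shift-in-box (sign±1 j)
          (subst (0ℚ ≤_) (solve 3 (λ s v y → s :* v :- s :* y := s :* (v :- y)) refl (sign j) (v j) (ℤtoℚ (y j)))
                 (p≤q⇒0≤q-p (proj₂ (conformal j))))
          (≤-by-diff (sign j * ℤtoℚ (y j)) (solve 3 (λ s v y → s :* v :- s :* (v :- y) := s :* y) refl (sign j) (v j) (ℤtoℚ (y j)))
                     (proj₁ (conformal j)))
          (proj₁ (z-box j)) (proj₁ (proj₂ x-feasible j)) (proj₂ (z-box j)) (proj₂ (proj₂ x-feasible j)))

    dist-decreases : dist₁ z' x + 1ℚ ≤ dist₁ z x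
    dist-decreases = subst₂ (λ a b → a + 1ℚ ≤ b) (sym dist-z') (sym dist-z)
      (≤-by-diff (sumℚ (λ j → sign j * ℤtoℚ (y j)) - 1ℚ)
                 (solve 2 (λ a s → a :- (a :- s :+ con 1ℚ) := s :- con 1ℚ) refl (sumℚ (λ j → ∣ v j ∣)) (sumℚ (λ j → sign j * ℤtoℚ (y j))))
                 (p≤q⇒0≤q-p 1≤∣y∣₁))
      where
      dist-z : dist₁ z x ≡ sumℚ (λ j → ∣ v j ∣)
      dist-z = sumℚ-cong (λ j → trans (cong ∣_∣ (solve 2 (λ z x → z :- x := :- (x :- z)) refl (ℤtoℚ (z j)) (x j))) (∣-p∣≡∣p∣ (v j)))
      coordinate : ∀ j → ∣ ℤtoℚ (z' j) - x j ∣ ≡ ∣ v j ∣ - sign j * ℤtoℚ (y j)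
      coordinate j = begin
        ∣ ℤtoℚ (z' j) - x j ∣             ≡⟨ cong ∣_∣ flip ⟩
        ∣ - (v j - ℤtoℚ (y j)) ∣          ≡⟨ ∣-p∣≡∣p∣ (v j - ℤtoℚ (y j)) ⟩
        ∣ v j - ℤtoℚ (y j) ∣              ≡⟨ sym (trans (∣p*q∣≡∣p∣*∣q∣ (sign j) _) (trans (cong (_* ∣ v j - ℤtoℚ (y j) ∣) (±1⇒∣s∣≡1 (sign±1 j))) (*-identityˡ _))) ⟩
        ∣ sign j * (v j - ℤtoℚ (y j)) ∣   ≡⟨ 0≤p⇒∣p∣≡p nonneg ⟩
        sign j * (v j - ℤtoℚ (y j))       ≡⟨ solve 3 (λ s v y → s :* (v :- y) := s :* v :- s :* y) refl (sign j) (v j) (ℤtoℚ (y j)) ⟩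
        sign j * v j - sign j * ℤtoℚ (y j) ≡⟨ cong (_- sign j * ℤtoℚ (y j)) (sign-abs j) ⟩
        ∣ v j ∣ - sign j * ℤtoℚ (y j)     ∎
        where
        open ≡-Reasoning
        flip : ℤtoℚ (z' j) - x j ≡ - (v j - ℤtoℚ (y j))
        flip = trans (cong (_- x j) (ℤtoℚ-homo-+ (z j) (y j)))
                     (solve 3 (λ z y x → z :+ y :- x := :- ((x :- z) :- y)) refl (ℤtoℚ (z j)) (ℤtoℚ (y j)) (x j))
        nonneg : 0ℚ ≤ sign j * (v j - ℤtoℚ (y j))
        nonneg = subst (0ℚ ≤_) (solve 3 (λ s v y → s :* v :- s :* y := s :* (v :- y)) refl (sign j) (v j) (ℤtoℚ (y j)))
                       (p≤q⇒0≤q-p (proj₂ (conformal j)))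
      dist-z' : dist₁ z' x ≡ sumℚ (λ j → ∣ v j ∣) - sumℚ (λ j → sign j * ℤtoℚ (y j))
      dist-z' = trans (sumℚ-cong coordinate) (sumℚ-- (λ j → ∣ v j ∣) (λ j → sign j * ℤtoℚ (y j)))

    objective-shift : ∀ (c : Fin n → ℤ) →
      ℤtoℚ (objℤ c z') ≡ ℤtoℚ (objℤ c z) + sumℚ (λ j → ℤtoℚ (c j) * ℤtoℚ (y j)) ×
      objℚ c x' ≡ objℚ c x - sumℚ (λ j → ℤtoℚ (c j) * ℤtoℚ (y j))
    objective-shift c =
      trans (sumℤ-as-ℚ c z') (trans (sumℚ-cong (λ j → trans (cong (ℤtoℚ (c j) *_) (ℤtoℚ-homo-+ (z j) (y j))) (*-distribˡ-+ (ℤtoℚ (c j)) _ _)))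
        (trans (sumℚ-+ (λ j → ℤtoℚ (c j) * ℤtoℚ (z j)) (λ j → ℤtoℚ (c j) * ℤtoℚ (y j))) (cong (_+ _) (sym (sumℤ-as-ℚ c z))))) ,
      trans (sumℚ-cong (λ j → solve 3 (λ c x y → c :* (x :- y) := c :* x :- c :* y) refl (ℤtoℚ (c j)) (x j) (ℤtoℚ (y j))))
        (sumℚ-- (λ j → ℤtoℚ (c j) * x j) (λ j → ℤtoℚ (c j) * ℤtoℚ (y j)))

  -- Moving z by y and x by −y keeps both feasible; optimality of x forces c·y ≥ 0, so z + y is again optimal.
  exchange : ∀ {m n} (A : Matrix m n) (b : Fin m → ℤ) (c : Fin n → ℤ) (u : Fin n → ℕ) (x : Fin n → ℚ) (z : Fin n → ℤ) →
    LPFeasible A b u x → (∀ w → LPFeasible A b u w → objℚ c w ≤ objℚ c x) → IsOptimalIP A b c u z →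
    ConformalKernelVector A (λ j → x j - ℤtoℚ (z j)) →
    Σ (Fin n → ℤ) λ z' → IsOptimalIP A b c u z' × dist₁ z' x + 1ℚ ≤ dist₁ z x
  exchange A b c u x z x-feasible x-optimal (z-feasible , z-optimal) K =
    z' , (z'-feasible , λ w w-feasible → subst (objℤ c w ℤ.≤_) (sym same-objective) (z-optimal w w-feasible)) , dist-decreases
    where
    open Exchange A b u x z x-feasible z-feasible K
    cy : ℚ
    cy = sumℚ (λ j → ℤtoℚ (c j) * ℤtoℚ (ConformalKernelVector.y K j))
    0≤cy : 0ℚ ≤ cy
    0≤cy = subst (0ℚ ≤_) (solve 2 (λ o y → o :- (o :- y) := y) refl (objℚ c x) cy)
             (p≤q⇒0≤q-p (subst (_≤ objℚ c x) (proj₂ (objective-shift c)) (x-optimal x' x'-feasible)))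
    same-objective : objℤ c z' ≡ objℤ c z
    same-objective = ℤP.≤-antisym (z-optimal z' z'-feasible)
      (ℤtoℚ-cancel-≤ (subst (ℤtoℚ (objℤ c z) ≤_) (sym (proj₁ (objective-shift c)))
        (≤-by-diff cy (solve 2 (λ a y → a :+ y :- a := y) refl (ℤtoℚ (objℤ c z)) cy) 0≤cy)))

  LP-minus-IP-in-kernel : ∀ {m n} (A : Matrix m n) (b : Fin m → ℤ) (u : Fin n → ℕ) (x : Fin n → ℚ) (z : Fin n → ℤ) →
    LPFeasible A b u x → IPFeasible A b u z → ∀ i → sumℚ (λ j → ℤtoℚ (A i j) * (x j - ℤtoℚ (z j))) ≡ 0ℚ
  LP-minus-IP-in-kernel A b u x z (Ax≡b , _) (Az≡b , _) i =
    trans (sumℚ-cong (λ j → solve 3 (λ a x z → a :* (x :- z) := a :* x :- a :* z) refl (ℤtoℚ (A i j)) (x j) (ℤtoℚ (z j))))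
    (trans (sumℚ-- (λ j → ℤtoℚ (A i j) * x j) (λ j → ℤtoℚ (A i j) * ℤtoℚ (z j)))
    (trans (cong₂ _-_ (Ax≡b i) (trans (sym (sumℤ-as-ℚ (A i) z)) (cong ℤtoℚ (Az≡b i)))) (+-inverseʳ (ℤtoℚ (b i)))))

  far⇒conformal-kernel-vector : ∀ {m n} (A : Matrix m n) (Δ : ℕ) → (∀ i j → ℤ.∣ A i j ∣ ℕ.≤ Δ) → (u : Fin n → ℕ)
    (x : Fin n → ℚ) → InBox x (uℚ u) → count (Interior? x (uℚ u)) ℕ.≤ m → (z : Fin n → ℤ) → InBoxZ u z →
    (∀ i → sumℚ (λ j → ℤtoℚ (A i j) * (x j - ℤtoℚ (z j))) ≡ 0ℚ) →
    ℕtoℚ (m ℕ.* (2 ℕ.* m ℕ.* Δ ℕ.+ 1) ^ m) < dist₁ z x → ConformalKernelVector A (λ j → x j - ℤtoℚ (z j))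
  far⇒conformal-kernel-vector {m} A Δ bounded u x x-box few z z-box Av≡0 far = record
    { y = y ; sign = σ ; sign±1 = λ j → sgnℚ-±1 (v j) ; sign-abs = λ j → sgnℚ*p≡∣p∣ (v j)
    ; Ay≡0 = Ay≡0 ; conformal = conformal ; 1≤∣y∣₁ = 1≤∣y∣₁ }
    where
    open Decomposition A Δ bounded u x x-box few z z-box Av≡0
    open Tags splitting
    distv : dist₁ z x ≡ sumℚ (λ j → ∣ v j ∣)
    distv = sumℚ-cong (λ j → trans (cong ∣_∣ (solve 2 (λ z x → z :- x := :- (x :- z)) refl (ℤtoℚ (z j)) (x j))) (∣-p∣≡∣p∣ (v j)))
    Kc : ZeroSumBlock.K m vec fractional integral-vec vec-integral (m ℕ.* Δ) ≡ (2 ℕ.* m ℕ.* Δ ℕ.+ 1) ^ m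
    Kc = cong (_^ m) (trans (cong suc (sym (ℕP.*-assoc 2 m Δ))) (ℕP.+-comm 1 (2 ℕ.* m ℕ.* Δ)))
    long : ZeroSumBlock.K m vec fractional integral-vec vec-integral (m ℕ.* Δ) ℕ.* m ℕ.< length ordered
    long = subst₂ ℕ._<_ (trans (ℕP.*-comm m _) (cong (ℕ._* m) (sym Kc))) refl
            (ℕP.≰⇒> (λ le → <-irrefl refl (<-≤-trans far (≤-trans (≤-reflexive distv) (≤-trans ∣v∣₁≤#tags
               (≤-trans (≤-reflexive (sym length-ordered)) (ℕtoℚ-mono-≤ le)))))))
    open Cycle long

  improve-far-optimum : ∀ {m n} (A : Matrix m n) (b : Fin m → ℤ) (c : Fin n → ℤ) (u : Fin n → ℕ) (Δ : ℕ) →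
    (∀ i j → ℤ.∣ A i j ∣ ℕ.≤ Δ) → (x : Fin n → ℚ) → IsOptimalLPVertex A b c u x →
    ∀ z → IsOptimalIP A b c u z → ℕtoℚ (m ℕ.* (2 ℕ.* m ℕ.* Δ ℕ.+ 1) ^ m) < dist₁ z x →
    Σ (Fin n → ℤ) λ z' → IsOptimalIP A b c u z' × dist₁ z' x + 1ℚ ≤ dist₁ z x
  improve-far-optimum A b c u Δ bounded x (vertex@(x-feasible , _) , x-optimal) z z-optimal far =
    exchange A b c u x z x-feasible x-optimal z-optimal
      (far⇒conformal-kernel-vector A Δ bounded u x (proj₂ x-feasible) (vertex-interior-count A b u x vertex)
         z (proj₂ (proj₁ z-optimal)) (LP-minus-IP-in-kernel A b u x z x-feasible (proj₁ z-optimal)) far)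

  dist₁-bounded : ∀ {m n} (A : Matrix m n) (b : Fin m → ℤ) (u : Fin n → ℕ) (x : Fin n → ℚ) (z : Fin n → ℤ) →
    LPFeasible A b u x → IPFeasible A b u z → dist₁ z x ≤ ℕtoℚ (sumℕ u)
  dist₁-bounded A b u x z (_ , x-box) (_ , z-box) = subst (dist₁ z x ≤_) (sym (ℕtoℚ-sumℕ u)) (sumℚ-mono-≤ coordinate)
    where
    coordinate : ∀ j → ∣ ℤtoℚ (z j) - x j ∣ ≤ ℕtoℚ (u j)
    coordinate j = ±p≤r⇒∣p∣≤r
      (≤-by-diff (ℕtoℚ (u j) - ℤtoℚ (z j) + x j) (solve 3 (λ u z x → u :- (z :- x) := u :- z :+ x) refl (ℕtoℚ (u j)) (ℤtoℚ (z j)) (x j))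
                 (+-pres-0≤ (p≤q⇒0≤q-p (ℤtoℚ-mono-≤ (proj₂ (z-box j)))) (proj₁ (x-box j))))
      (≤-by-diff (ℕtoℚ (u j) - x j + ℤtoℚ (z j)) (solve 3 (λ u z x → u :- (:- (z :- x)) := u :- x :+ z) refl (ℕtoℚ (u j)) (ℤtoℚ (z j)) (x j))
                 (+-pres-0≤ (p≤q⇒0≤q-p (proj₂ (x-box j))) (ℤtoℚ-mono-≤ (proj₁ (z-box j)))))

  descend : ∀ {X : Set} (P : X → Set) (d : X → ℚ) {B : ℚ} → 0ℚ ≤ B →
    (∀ a → P a → B < d a → Σ X λ a' → P a' × d a' + 1ℚ ≤ d a) →
    (F : ℕ) → ∀ a → P a → d a ≤ ℕtoℚ F → Σ X λ a → P a × d a ≤ B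
  descend P d {B} 0≤B improve F a Pa da≤F with d a ≤? B
  ... | yes da≤B = a , Pa , da≤B
  descend P d 0≤B improve zero a Pa da≤0 | no _ = a , Pa , ≤-trans da≤0 0≤B
  descend P d 0≤B improve (suc F) a Pa da≤1+F | no da≰B with improve a Pa (≰⇒> da≰B)
  ... | a' , Pa' , da'+1≤da = descend P d 0≤B improve F a' Pa' (p+1≤1+n⇒p≤n F (≤-trans da'+1≤da da≤1+F))

open import Defs
open import Data.Nat using (ℕ; _+_; _*_; _^_)
open import Data.Integer using (ℤ; ∣_∣)
open import Data.Rational using (ℚ; _≤_)
open import Data.Fin using (Fin)
open import Data.Product using (Σ; _×_; proj₁; proj₂)
import Data.Nat
open Proximity using (descend; improve-far-optimum; dist₁-bounded; module IntegerOptimum; sumℕ; 0≤ℕtoℚ)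

theorem4 : (m n : ℕ) (A : Matrix m n) (b : Fin m → ℤ) (c : Fin n → ℤ) (u : Fin n → ℕ) (Δ : ℕ) →
    (∀ i j → Data.Nat._≤_ ∣ A i j ∣ Δ) →
    Σ (Fin n → ℤ) (IPFeasible A b u) →
    (x : Fin n → ℚ) → IsOptimalLPVertex A b c u x →
    Σ (Fin n → ℤ) (λ z → IsOptimalIP A b c u z × (dist₁ z x ≤ ℕtoℚ (m * (2 * m * Δ + 1) ^ m)))
theorem4 m n A b c u Δ hΔ feasible x x-optimal =
  descend (IsOptimalIP A b c u) (λ z → dist₁ z x) (0≤ℕtoℚ (m * (2 * m * Δ + 1) ^ m)) (improve-far-optimum A b c u Δ hΔ x x-optimal)
    (sumℕ u) z₀ z₀-optimal (dist₁-bounded A b u x z₀ (proj₁ (proj₁ x-optimal)) (proj₁ z₀-optimal))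
  where
  open IntegerOptimum A b c u using (optimal-solution-exists)
  z₀ : Fin n → ℤ
  z₀ = proj₁ (optimal-solution-exists feasible)
  z₀-optimal : IsOptimalIP A b c u z₀
  z₀-optimal = proj₂ (optimal-solution-exists feasible)
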